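{- For integers $n\ge 1$, $t\ge 1$, $r\ge 1$, let $wg(n,t,r)$ denote the number (up to isomorphism) of weighted games with $n$ players, exactly $t$ equivalence classes of equi-desirable players, and exactly $r$ shift-minimal winning vectors, and let $\widehat{wg}(n,t,r)$ denote the number (up to isomorphism) of such weighted games that are non-trivial. Set $\widehat{wg}(n,t,r)=0$ whenever $n<t$ or $t<1$. If $r>1$ or $t>2$, then $$wg(n,t,r)=\widehat{wg}(n,t,r)+\sum_{h=1}^{n-1}\Big(2\,\widehat{wg}(n-h,t-1,r)+(h-1)\,\widehat{wg}(n-h,t-2,r)\Big).$$ For $r=1$ and $t=1$ the same identity holds after adding $1$ to the right-hand side, and for $r=1$ and $t=2$ it holds after adding $n-1$ to the right-hand side.
   Context: A simple game on $N=\{1,\dots,n\}$ is a family $\mathcal W$ of subsets of $N$ (winning coalitions) with $\emptyset\notin\mathcal W$, $N\in\mathcal W$, and $S\in\mathcal W$, $S\subseteq T\Rightarrow T\in\mathcal W$. It is weighted if there are reals $w_1,\dots,w_n\ge 0$ and $q>0$ with $S\in\mathcal W$ iff $\sum_{i\in S}w_i\ge q$. Two games are isomorphic if a bijection of the player sets maps winning coalitions exactly onto winning coalitions. Desirability: $i\succsim j$ iff for every $S\subseteq N\setminus\{i,j\}$, $S\cup\{j\}\in\mathcal W$ implies $S\cup\{i\}\in\mathcal W$; $i\approx j$ if both $i\succsim j$ and $j\succsim i$. In a complete game (every weighted game is complete) $\succsim$ is total, and the $\approx$-classes $N_1,\dots,N_t$ are ordered so that players of $N_h$ are strictly more desirable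 than those of $N_{h+1}$; let $n_h=|N_h|$. A vector $(m_1,\dots,m_t)$ with $0\le m_h\le n_h$ is winning (losing) if the coalitions containing exactly $m_h$ players of $N_h$ for each $h$ are winning (losing). For vectors write $\tilde a\succeq\tilde b$ iff $\sum_{i=1}^k a_i\ge\sum_{i=1}^k b_i$ for all $1\le k\le t$, and $\tilde a\succ\tilde b$ if moreover $\tilde a\ne\tilde b$. A shift-minimal winning vector is a winning vector $\tilde m$ such that every vector $\tilde m'$ with $\tilde m\succ\tilde m'$ is losing. A player is a veto player if it belongs to every winning coalition, and a null player if it belongs to no minimal winning coalition. A game is non-trivial if it has neither veto players nor null players.
   Formalization: The weights $w_1,\dots,w_n$ and the quota $q$ of a weighted game are rational rather than real. -}

module Defs where

open import Data.Bool using (Bool; true; false; if_then_else_)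
open import Data.Nat using (ℕ; zero; suc; _+_; _≤_; _<_)
open import Data.Fin using (Fin; _≟_) renaming (_<_ to _<ᶠ_)
open import Data.Fin.Subset using (Subset; _∈_; _∉_; _⊆_; _∪_; _-_; ⁅_⁆) renaming (⊥ to ∅; ⊤ to Full)
open import Data.Fin.Permutation using (Permutation; _⟨$⟩ˡ_)
open import Data.Vec using (Vec; []; _∷_; lookup; tabulate)
open import Data.List using (List; length; filter; foldr)
open import Data.List.Base using (allFin)
open import Data.List.Membership.Propositional using () renaming (_∈_ to _∈ₗ_)
open import Data.List.Relation.Unary.All using (All)
open import Data.List.Relation.Unary.Any using (Any)
open import Data.List.Relation.Unary.AllPairs using (AllPairs)
open import Data.List.Relation.Unary.Unique.Propositional using (Unique)
open import Data.Product using (Σ; ∃; _×_)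
open import Relation.Nullary using (¬_)
open import Relation.Binary.PropositionalEquality using (_≡_; _≢_)
open import Function.Bundles using (_⇔_)
open import Data.Rational as ℚ using (ℚ; 0ℚ)

record SimpleGame (n : ℕ) : Set where
  field
    win       : Subset n → Bool
    emptyLose : win ∅ ≡ false
    fullWin   : win Full ≡ true
    monotone  : ∀ S T → S ⊆ T → win S ≡ true → win T ≡ true
open SimpleGame public

Winning : ∀ {n} → SimpleGame n → Subset n → Set
Winning G S = win G S ≡ true

image : ∀ {n} → Permutation n n → Subset n → Subset n
image π S = tabulate (λ j → lookup S (π ⟨$⟩ˡ j))

Iso : ∀ {n} → SimpleGame n → SimpleGame n → Set
Iso G H = Σ (Permutation _ _) λ π → ∀ S → win H (image π S) ≡ win G S

weightOf : ∀ {n} → (Fin n → ℚ) → Subset n → ℚ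
weightOf {n} w S = foldr (λ i acc → (if lookup S i then w i else 0ℚ) ℚ.+ acc) 0ℚ (allFin n)

Weighted : ∀ {n} → SimpleGame n → Set
Weighted {n} G =
  Σ (Fin n → ℚ) λ w → Σ ℚ λ q →
    (∀ i → 0ℚ ℚ.≤ w i) × (0ℚ ℚ.< q) ×
    (∀ S → Winning G S ⇔ (q ℚ.≤ weightOf w S))

_≿[_]_ : ∀ {n} → Fin n → SimpleGame n → Fin n → Set
i ≿[ G ] j = ∀ S → i ∉ S → j ∉ S → Winning G (S ∪ ⁅ j ⁆) → Winning G (S ∪ ⁅ i ⁆)

_≈[_]_ : ∀ {n} → Fin n → SimpleGame n → Fin n → Set
i ≈[ G ] j = (i ≿[ G ] j) × (j ≿[ G ] i)

_≻[_]_ : ∀ {n} → Fin n → SimpleGame n → Fin n → Set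
i ≻[ G ] j = (i ≿[ G ] j) × ¬ (j ≿[ G ] i)

-- c : Fin n → Fin t is the ordered partition N_1,…,N_t into ≈-classes:
-- c i = h means i ∈ N_(h+1); classes are nonempty, c i ≡ c j iff i ≈ j,
-- and players of lower-indexed classes are strictly more desirable.
OrderedClasses : ∀ {n} → SimpleGame n → (t : ℕ) → (Fin n → Fin t) → Set
OrderedClasses G t c =
  (∀ h → ∃ λ i → c i ≡ h) ×
  (∀ i j → (c i ≡ c j) ⇔ (i ≈[ G ] j)) ×
  (∀ i j → c i <ᶠ c j → i ≻[ G ] j)

countIn : ∀ {n t} → (Fin n → Fin t) → Subset n → Fin t → ℕ
countIn {n} c S h = length (filter (λ i → c i ≟ h) (filter (λ i → lookup S i Data.Bool.≟ true) (allFin n)))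
  where import Data.Bool

classSize : ∀ {n t} → (Fin n → Fin t) → Fin t → ℕ
classSize c h = countIn c Full h

ValidVec : ∀ {n t} → (Fin n → Fin t) → Vec ℕ t → Set
ValidVec c m = ∀ h → lookup m h ≤ classSize c h

Realizes : ∀ {n t} → (Fin n → Fin t) → Vec ℕ t → Subset n → Set
Realizes c m S = ∀ h → countIn c S h ≡ lookup m h

WinningVec : ∀ {n t} → SimpleGame n → (Fin n → Fin t) → Vec ℕ t → Set
WinningVec G c m = ValidVec c m × (∀ S → Realizes c m S → win G S ≡ true)

LosingVec : ∀ {n t} → SimpleGame n → (Fin n → Fin t) → Vec ℕ t → Set
LosingVec G c m = ValidVec c m × (∀ S → Realizes c m S → win G S ≡ false)

psum : ∀ {t} → Vec ℕ t → ℕ → ℕ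
psum []       _       = 0
psum (x ∷ v)  zero    = 0
psum (x ∷ v)  (suc k) = x + psum v k

_⪰_ : ∀ {t} → Vec ℕ t → Vec ℕ t → Set
_⪰_ {t} a b = ∀ k → 1 ≤ k → k ≤ t → psum b k ≤ psum a k

_≻ᵥ_ : ∀ {t} → Vec ℕ t → Vec ℕ t → Set
a ≻ᵥ b = (a ⪰ b) × (a ≢ b)

ShiftMinWinning : ∀ {n t} → SimpleGame n → (Fin n → Fin t) → Vec ℕ t → Set
ShiftMinWinning G c m =
  WinningVec G c m × (∀ m' → ValidVec c m' → m ≻ᵥ m' → LosingVec G c m')

ExactlyShiftMin : ∀ {n t} → SimpleGame n → (Fin n → Fin t) → ℕ → Set
ExactlyShiftMin {t = t} G c r =
  Σ (List (Vec ℕ t)) λ L → Unique L × length L ≡ r ×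
    (∀ m → (m ∈ₗ L) ⇔ ShiftMinWinning G c m)

HasTR : ∀ {n} → SimpleGame n → ℕ → ℕ → Set
HasTR {n} G t r = Σ (Fin n → Fin t) λ c → OrderedClasses G t c × ExactlyShiftMin G c r

IsVeto : ∀ {n} → SimpleGame n → Fin n → Set
IsVeto G i = ∀ S → Winning G S → i ∈ S

MinimalWinning : ∀ {n} → SimpleGame n → Subset n → Set
MinimalWinning G S = Winning G S × (∀ j → j ∈ S → win G (S - j) ≡ false)

IsNull : ∀ {n} → SimpleGame n → Fin n → Set
IsNull G i = ∀ S → MinimalWinning G S → i ∉ S

NonTrivial : ∀ {n} → SimpleGame n → Set
NonTrivial G = ∀ i → ¬ IsVeto G i × ¬ IsNull G i

WG : (n t r : ℕ) → SimpleGame n → Set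
WG n t r G = Weighted G × HasTR G t r

WGhat : (n t r : ℕ) → SimpleGame n → Set
WGhat n t r G = WG n t r G × NonTrivial G

-- "P has exactly k games up to isomorphism": a list of k pairwise
-- non-isomorphic games satisfying P, representing every game satisfying P.
IsoCount : ∀ {n} → (SimpleGame n → Set) → ℕ → Set
IsoCount {n} P k =
  Σ (List (SimpleGame n)) λ L → length L ≡ k × All P L ×
    AllPairs (λ G H → ¬ Iso G H) L × (∀ G → P G → Any (Iso G) L)

sumTo : ℕ → (ℕ → ℕ) → ℕ
sumTo zero    f = 0
sumTo (suc k) f = sumTo k f + f (suc k)

-- Every simple game is isomorphic to a core without veto and null players, or to the one-player
-- game, with a veto players and b null players added; a, b and the core (up to isomorphism) are
-- invariants of the game.  Adding vetoes (null players) keeps weightedness, creates one new most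
-- (least) desirable class, and turns the shift-minimal winning vectors u of the core into a ∷ u
-- (u ∷ʳ 0).  Hence the weighted games with t classes and r shift-minimal winning vectors and a
-- nontrivial core are counted by ŵ (n ∸ h) (t ∸ [a > 0] ∸ [b > 0]) summed over a + b = h < n,
-- and for h > 0 the pairs (h, 0), (0, h) and the h ∸ 1 pairs with a, b > 0 give
-- 2 ŵ (n ∸ h) (t ∸ 1) + (h ∸ 1) ŵ (n ∸ h) (t ∸ 2).  Games with the one-player core are unanimity
-- games with b null players; they have one shift-minimal winning vector and 1 + [b > 0] classes,
-- which accounts for the extra 1 when t = 1 and the extra n ∸ 1 (one game for each b) when t = 2.

module Submission where

open import Defs
open import Algebra.Properties.CommutativeMonoid.Sum as Sum using ()
open import Data.Bool using (Bool; true; false; _∧_; _∨_; if_then_else_)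
import Data.Bool as Bool
open import Data.Bool.Properties using (∨-identityʳ; ∨-zeroʳ; not-¬; ¬-not)
open import Data.Empty using (⊥)
open import Data.Fin using (Fin; zero; suc; _≟_; _↑ˡ_; _↑ʳ_; fromℕ; inject₁; toℕ; punchOut) renaming (_<_ to _<ᶠ_)
open import Data.Fin.Properties
  using (any?; pigeonhole; suc-injective; inject₁-injective; fromℕ≢inject₁; toℕ-inject₁; toℕ-fromℕ; toℕ<n; ≤fromℕ; punchIn-punchOut)
open import Data.Fin.Relation.Unary.Top using (View; view; ‵fromℕ; ‵inject₁)
open import Data.Fin.Subset using (Subset; _∈_; _∉_; _⊆_; _∪_; _-_; ⁅_⁆; ∣_∣) renaming (⊥ to ∅; ⊤ to Full)
open import Data.Fin.Subset.Properties using (drop-∷-⊆; p─⊥≡p; anySubset?; ∣⊤∣≡n; ∣p∣≤n; ∣p∣≡n⇒p≡⊤)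
open import Data.Fin.Permutation as Perm
  using (Permutation; _⟨$⟩ˡ_; _⟨$⟩ʳ_; inverseˡ; inverseʳ; flip; _∘ₚ_; transpose; lift₀; remove; lift₀-remove)
import Data.Fin.Permutation.Components as PermC
open import Data.List using (List; []; _∷_; map; length; filter; foldr; tabulate; allFin)
import Data.List as List
open import Data.List.Properties using (length-++; length-map)
open import Data.List.Membership.Propositional using () renaming (_∈_ to _∈ₗ_)
open import Data.List.Membership.Propositional.Properties using (∈-map⁺; ∈-map⁻; ∈-allFin)
open import Data.List.Relation.Unary.All using (All; []; _∷_)
import Data.List.Relation.Unary.All as All
import Data.List.Relation.Unary.All.Properties as All
open import Data.List.Relation.Unary.Any using (here; there)
import Data.List.Relation.Unary.Any as Any
import Data.List.Relation.Unary.Any.Properties as Any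
open import Data.List.Relation.Unary.AllPairs using (AllPairs; []; _∷_)
import Data.List.Relation.Unary.AllPairs.Properties as AllPairs
open import Data.List.Relation.Unary.Unique.Propositional using (Unique)
import Data.List.Relation.Unary.Unique.Propositional.Properties as Unique
open import Data.Nat using (ℕ; zero; suc; _+_; _*_; _∸_; _≤_; _<_; _≤?_; z≤n; s≤s; s≤s⁻¹; s<s⁻¹)
import Data.Nat as ℕ
open import Data.Nat.Properties
  using (≤-refl; ≤-trans; ≤-reflexive; <⇒≤; <⇒≱; ≰⇒>; <-irrefl; m≤n⇒m<n∨m≡n; m≤n⇒m≤1+n; n≤1+n; 1+n≢n; n≤0⇒n≡0;
         +-identityʳ; +-assoc; +-comm; +-suc; +-mono-≤; +-monoʳ-≤; +-cancelˡ-≤; *-identityʳ; +-0-commutativeMonoid; ≡-irrelevant;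
         m+n∸m≡n; m+[n∸m]≡n; m≤n⇒m∸n≡0; m<n⇒0<n∸m; m∸n≢0⇒n<m; m≤m+n; m≤n+m)
open import Data.Product using (Σ; ∃; _×_; _,_; proj₁; proj₂)
open import Data.Rational as ℚ using (ℚ; 0ℚ; 1ℚ)
import Data.Rational.Properties as ℚₚ
open import Data.Sum using (_⊎_; inj₁; inj₂; [_,_]; map₂)
open import Data.Vec using (Vec; []; _∷_; _++_; _∷ʳ_; lookup; replicate; splitAt; initLast; init; tail; _[_]≔_; here; there)
open import Data.Vec.Properties
  using ([]=⇒lookup; lookup⇒[]=; tabulate∘lookup; tabulate-cong; lookup-replicate; lookup∘tabulate; lookup∘update; lookup∘update′;
         ∷-injective; ∷ʳ-injectiveˡ; ∷ʳ-injectiveʳ; init-∷ʳ; ≡-dec)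
open import Function using (_∘_)
open import Function.Bundles using (_⇔_; mk⇔; Equivalence)
import Function.Properties.Equivalence as ⇔
open import Relation.Nullary using (¬_; Dec; yes; no; does; contradiction; _×-dec_)
open import Relation.Nullary.Decidable using (dec-true; dec-false)
open import Relation.Binary.PropositionalEquality
  using (_≡_; _≢_; refl; sym; trans; cong; cong₂; subst; subst₂; module ≡-Reasoning)

open Equivalence

private
  variable
    k l m n s t r : ℕ

-- Coalitions as Boolean vectors; veto and dummy players

_≡ᵇ_ : Fin n → Fin n → Bool
i ≡ᵇ j = does (i ≟ j)

≡ᵇ-refl : (i : Fin n) → (i ≡ᵇ i) ≡ true
≡ᵇ-refl i = dec-true (i ≟ i) refl

≡ᵇ⇒≡ : (i j : Fin n) → (i ≡ᵇ j) ≡ true → i ≡ j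
≡ᵇ⇒≡ i j e with i ≟ j
... | yes p = p
≡ᵇ⇒≡ i j () | no _

≢⇒≡ᵇ-false : (i j : Fin n) → i ≢ j → (i ≡ᵇ j) ≡ false
≢⇒≡ᵇ-false i j = dec-false (i ≟ j)

≡ᵇ-false⇒≢ : (i j : Fin n) → (i ≡ᵇ j) ≡ false → i ≢ j
≡ᵇ-false⇒≢ i .i e refl = not-¬ (≡ᵇ-refl i) e

∉⇒lookup-false : {i : Fin n} {S : Subset n} → i ∉ S → lookup S i ≡ false
∉⇒lookup-false {i = i} {S} i∉S = ¬-not (λ e → i∉S (lookup⇒[]= i S e))

lookup-false⇒∉ : {i : Fin n} {S : Subset n} → lookup S i ≡ false → i ∉ S
lookup-false⇒∉ e i∈S = not-¬ ([]=⇒lookup i∈S) e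

Subset-ext : {S T : Subset n} → (∀ i → lookup S i ≡ lookup T i) → S ≡ T
Subset-ext {S = S} {T} p = trans (sym (tabulate∘lookup S)) (trans (tabulate-cong p) (tabulate∘lookup T))

lookup-∪ : (S T : Subset n) (i : Fin n) → lookup (S ∪ T) i ≡ lookup S i ∨ lookup T i
lookup-∪ (x ∷ S) (y ∷ T) zero = refl
lookup-∪ (x ∷ S) (y ∷ T) (suc i) = lookup-∪ S T i

lookup-⁅⁆ : (j i : Fin n) → lookup ⁅ j ⁆ i ≡ (i ≡ᵇ j)
lookup-⁅⁆ zero zero = refl
lookup-⁅⁆ zero (suc i) = lookup-replicate i false
lookup-⁅⁆ (suc j) zero = refl
lookup-⁅⁆ (suc j) (suc i) = lookup-⁅⁆ j i

lookup-∪-⁅⁆ : (S : Subset n) (j i : Fin n) → lookup (S ∪ ⁅ j ⁆) i ≡ (if i ≡ᵇ j then true else lookup S i)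
lookup-∪-⁅⁆ S j i rewrite lookup-∪ S ⁅ j ⁆ i | lookup-⁅⁆ j i with i ≡ᵇ j
... | true = ∨-zeroʳ (lookup S i)
... | false = ∨-identityʳ (lookup S i)

lookup-remove : (S : Subset n) (j i : Fin n) → lookup (S - j) i ≡ (if i ≡ᵇ j then false else lookup S i)
lookup-remove (x ∷ S) zero zero = refl
lookup-remove (x ∷ S) zero (suc i) = cong (λ T → lookup T i) (p─⊥≡p S)
lookup-remove (x ∷ S) (suc j) zero = refl
lookup-remove (x ∷ S) (suc j) (suc i) = lookup-remove S j i

lookup-remove² : (S : Subset n) (i j k : Fin n) →
  lookup ((S - i) - j) k ≡ (if k ≡ᵇ j then false else if k ≡ᵇ i then false else lookup S k)
lookup-remove² S i j k rewrite lookup-remove (S - i) j k | lookup-remove S i k = refl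

lookup-remove-self : (S : Subset n) (j : Fin n) → lookup (S - j) j ≡ false
lookup-remove-self S j rewrite lookup-remove S j j | ≡ᵇ-refl j = refl

remove-⊆ : (S : Subset n) (j : Fin n) → ∀ k → lookup (S - j) k ≡ true → lookup S k ≡ true
remove-⊆ S j k e rewrite lookup-remove S j k with k ≡ᵇ j
... | true = contradiction e λ ()
... | false = e

∉-remove-self : (S : Subset n) (j : Fin n) → j ∉ S - j
∉-remove-self S j = lookup-false⇒∉ (lookup-remove-self S j)

∉-remove : {S : Subset n} {i : Fin n} (j : Fin n) → i ∉ S → i ∉ S - j
∉-remove {S = S} {i} j i∉S i∈S-j = i∉S (lookup⇒[]= i S (remove-⊆ S j i ([]=⇒lookup i∈S-j)))

lookup⇒⊆ : {S T : Subset n} → (∀ i → lookup S i ≡ true → lookup T i ≡ true) → S ⊆ T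
lookup⇒⊆ {S = S} {T} p {i} i∈S = lookup⇒[]= i T (p i ([]=⇒lookup i∈S))

win-mono : (G : SimpleGame n) (S T : Subset n) → (∀ i → lookup S i ≡ true → lookup T i ≡ true) →
           Winning G S → Winning G T
win-mono G S T p = monotone G S T (lookup⇒⊆ p)

losing-mono : (G : SimpleGame n) (S T : Subset n) → (∀ i → lookup S i ≡ true → lookup T i ≡ true) →
              win G T ≡ false → win G S ≡ false
losing-mono G S T p l = ¬-not λ w → not-¬ (win-mono G S T p w) l

veto-absent-losing : (G : SimpleGame n) (i : Fin n) → IsVeto G i → ∀ S → lookup S i ≡ false → win G S ≡ false
veto-absent-losing G i v S e = ¬-not λ w → not-¬ ([]=⇒lookup (v S w)) e

IsVeto⇒Full-i-losing : (G : SimpleGame n) (i : Fin n) → IsVeto G i → win G (Full - i) ≡ false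
IsVeto⇒Full-i-losing G i v = veto-absent-losing G i v (Full - i) (lookup-remove-self Full i)

Full-i-losing⇒IsVeto : (G : SimpleGame n) (i : Fin n) → win G (Full - i) ≡ false → IsVeto G i
Full-i-losing⇒IsVeto G i l S w with lookup S i in e
... | true = lookup⇒[]= i S e
... | false = contradiction (losing-mono G S (Full - i) S⊆Full-i l) (not-¬ w)
  where
  S⊆Full-i : ∀ k → lookup S k ≡ true → lookup (Full - i) k ≡ true
  S⊆Full-i k p rewrite lookup-remove Full i k with k ≡ᵇ i in k≡i
  ... | true rewrite ≡ᵇ⇒≡ k i k≡i = contradiction (trans (sym p) e) λ ()
  ... | false = lookup-replicate k true

IsDummy : SimpleGame n → Fin n → Set
IsDummy G i = ∀ S → Winning G S → Winning G (S - i)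

Pivotal : SimpleGame n → Fin n → Set
Pivotal G i = ∃ λ T → Winning G T × win G (T - i) ≡ false

IsDummy⇒IsNull : (G : SimpleGame n) (i : Fin n) → IsDummy G i → IsNull G i
IsDummy⇒IsNull G i d S (w , minimal) i∈S = not-¬ (d S w) (minimal i i∈S)

Pivotal⇒¬IsDummy : (G : SimpleGame n) (i : Fin n) → Pivotal G i → ¬ IsDummy G i
Pivotal⇒¬IsDummy G i (T , w , l) d = not-¬ (d T w) l

dummy-invisible : (G : SimpleGame n) (i : Fin n) → IsDummy G i → ∀ T → win G T ≡ win G (T - i)
dummy-invisible G i d T with win G T in e
... | true = sym (d T e)
... | false = sym (losing-mono G (T - i) T (remove-⊆ T i) e)

-- Isomorphisms

lookup-image : (π : Permutation n n) (S : Subset n) (j : Fin n) → lookup (image π S) j ≡ lookup S (π ⟨$⟩ˡ j)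
lookup-image π S j = lookup∘tabulate _ j

lookup-image-⟨$⟩ʳ : (π : Permutation n n) (S : Subset n) (i : Fin n) → lookup (image π S) (π ⟨$⟩ʳ i) ≡ lookup S i
lookup-image-⟨$⟩ʳ π S i = trans (lookup-image π S (π ⟨$⟩ʳ i)) (cong (lookup S) (inverseˡ π))

≡ᵇ-⟨$⟩ˡ : (π : Permutation n n) (j i : Fin n) → ((π ⟨$⟩ˡ j) ≡ᵇ i) ≡ (j ≡ᵇ (π ⟨$⟩ʳ i))
≡ᵇ-⟨$⟩ˡ π j i with (π ⟨$⟩ˡ j) ≟ i | j ≟ (π ⟨$⟩ʳ i)
... | yes _ | yes _ = refl
... | no _ | no _ = refl
... | yes p | no q = contradiction (trans (sym (inverseʳ π)) (cong (π ⟨$⟩ʳ_) p)) q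
... | no p | yes q = contradiction (trans (cong (π ⟨$⟩ˡ_) q) (inverseˡ π)) p

image-∪-⁅⁆ : (π : Permutation n n) (S : Subset n) (i : Fin n) → image π (S ∪ ⁅ i ⁆) ≡ image π S ∪ ⁅ π ⟨$⟩ʳ i ⁆
image-∪-⁅⁆ π S i = Subset-ext λ j → begin
  lookup (image π (S ∪ ⁅ i ⁆)) j                              ≡⟨ lookup-image π (S ∪ ⁅ i ⁆) j ⟩
  lookup (S ∪ ⁅ i ⁆) (π ⟨$⟩ˡ j)                               ≡⟨ lookup-∪-⁅⁆ S i _ ⟩
  (if (π ⟨$⟩ˡ j) ≡ᵇ i then true else lookup S (π ⟨$⟩ˡ j))     ≡⟨ cong₂ (if_then true else_) (≡ᵇ-⟨$⟩ˡ π j i) (sym (lookup-image π S j)) ⟩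
  (if j ≡ᵇ (π ⟨$⟩ʳ i) then true else lookup (image π S) j)    ≡⟨ lookup-∪-⁅⁆ (image π S) _ j ⟨
  lookup (image π S ∪ ⁅ π ⟨$⟩ʳ i ⁆) j                         ∎
  where open ≡-Reasoning

image-remove : (π : Permutation n n) (S : Subset n) (i : Fin n) → image π (S - i) ≡ image π S - (π ⟨$⟩ʳ i)
image-remove π S i = Subset-ext λ j → begin
  lookup (image π (S - i)) j                                  ≡⟨ lookup-image π (S - i) j ⟩
  lookup (S - i) (π ⟨$⟩ˡ j)                                   ≡⟨ lookup-remove S i _ ⟩
  (if (π ⟨$⟩ˡ j) ≡ᵇ i then false else lookup S (π ⟨$⟩ˡ j))    ≡⟨ cong₂ (if_then false else_) (≡ᵇ-⟨$⟩ˡ π j i) (sym (lookup-image π S j)) ⟩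
  (if j ≡ᵇ (π ⟨$⟩ʳ i) then false else lookup (image π S) j)   ≡⟨ lookup-remove (image π S) _ j ⟨
  lookup (image π S - (π ⟨$⟩ʳ i)) j                           ∎
  where open ≡-Reasoning

image-replicate : (π : Permutation n n) (b : Bool) → image π (replicate n b) ≡ replicate n b
image-replicate π b = Subset-ext λ j →
  trans (lookup-image π (replicate _ b) j) (trans (lookup-replicate (π ⟨$⟩ˡ j) b) (sym (lookup-replicate j b)))

image-flip-image : (π : Permutation n n) (S : Subset n) → image (flip π) (image π S) ≡ S
image-flip-image π S = Subset-ext λ j →
  trans (lookup-image (flip π) (image π S) j) (trans (lookup-image π S _) (cong (lookup S) (inverseˡ π)))

image-image-flip : (π : Permutation n n) (S : Subset n) → image π (image (flip π) S) ≡ S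
image-image-flip π S = Subset-ext λ j →
  trans (lookup-image π (image (flip π) S) j) (trans (lookup-image (flip π) S _) (cong (lookup S) (inverseʳ π)))

image-∘ₚ : (π ρ : Permutation n n) (S : Subset n) → image (π ∘ₚ ρ) S ≡ image ρ (image π S)
image-∘ₚ π ρ S = Subset-ext λ j →
  trans (lookup-image (π ∘ₚ ρ) S j) (sym (trans (lookup-image ρ (image π S) j) (lookup-image π S (ρ ⟨$⟩ˡ j))))

image-id : (S : Subset n) → image Perm.id S ≡ S
image-id S = Subset-ext (lookup-image Perm.id S)

image-⊆ : (π : Permutation n n) (S T : Subset n) → (∀ i → lookup S i ≡ true → lookup T i ≡ true) →
          ∀ j → lookup (image π S) j ≡ true → lookup (image π T) j ≡ true
image-⊆ π S T S⊆T j e = trans (lookup-image π T j) (S⊆T _ (trans (sym (lookup-image π S j)) e))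

Iso-refl : (G : SimpleGame n) → Iso G G
Iso-refl G = Perm.id , λ S → cong (win G) (image-id S)

Iso-sym : {G H : SimpleGame n} → Iso G H → Iso H G
Iso-sym {H = H} (π , p) = flip π , λ S → trans (sym (p (image (flip π) S))) (cong (win H) (image-image-flip π S))

Iso-trans : {G H K : SimpleGame n} → Iso G H → Iso H K → Iso G K
Iso-trans {K = K} (π , p) (ρ , q) = π ∘ₚ ρ , λ S → trans (cong (win K) (image-∘ₚ π ρ S)) (trans (q (image π S)) (p S))

≗⇒Iso : (G H : SimpleGame n) → (∀ S → win H S ≡ win G S) → Iso G H
≗⇒Iso G H p = Perm.id , λ S → trans (cong (win H) (image-id S)) (p S)

permute : Permutation n n → SimpleGame n → SimpleGame n
permute π G = record
  { win = λ S → win G (image (flip π) S)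
  ; emptyLose = trans (cong (win G) (image-replicate (flip π) false)) (emptyLose G)
  ; fullWin = trans (cong (win G) (image-replicate (flip π) true)) (fullWin G)
  ; monotone = λ S T S⊆T → win-mono G _ _ (image-⊆ (flip π) S T λ i e → []=⇒lookup (S⊆T (lookup⇒[]= i S e)))
  }

Iso-permute : (π : Permutation n n) (G : SimpleGame n) → Iso G (permute π G)
Iso-permute π G = π , λ S → cong (win G) (image-flip-image π S)

Iso-IsVeto : {G H : SimpleGame n} (I : Iso G H) (i : Fin n) → IsVeto G i → IsVeto H (proj₁ I ⟨$⟩ʳ i)
Iso-IsVeto {G = G} {H} (π , p) i v = Full-i-losing⇒IsVeto H _ (begin
  win H (Full - (π ⟨$⟩ʳ i))          ≡⟨ cong (λ S → win H (S - (π ⟨$⟩ʳ i))) (image-replicate π true) ⟨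
  win H (image π Full - (π ⟨$⟩ʳ i))  ≡⟨ cong (win H) (image-remove π Full i) ⟨
  win H (image π (Full - i))         ≡⟨ p (Full - i) ⟩
  win G (Full - i)                   ≡⟨ IsVeto⇒Full-i-losing G i v ⟩
  false                              ∎)
  where open ≡-Reasoning

Iso-IsDummy : {G H : SimpleGame n} (I : Iso G H) (i : Fin n) → IsDummy G i → IsDummy H (proj₁ I ⟨$⟩ʳ i)
Iso-IsDummy {G = G} {H} (π , p) i d S w = begin
  win H (S - (π ⟨$⟩ʳ i))               ≡⟨ cong (λ T → win H (T - (π ⟨$⟩ʳ i))) (image-image-flip π S) ⟨
  win H (image π S₀ - (π ⟨$⟩ʳ i))      ≡⟨ cong (win H) (image-remove π S₀ i) ⟨
  win H (image π (S₀ - i))             ≡⟨ p (S₀ - i) ⟩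
  win G (S₀ - i)                       ≡⟨ d S₀ (trans (sym (p S₀)) (trans (cong (win H) (image-image-flip π S)) w)) ⟩
  true                                 ∎
  where
  open ≡-Reasoning
  S₀ = image (flip π) S

Iso-Pivotal : {G H : SimpleGame n} (I : Iso G H) (i : Fin n) → Pivotal G i → Pivotal H (proj₁ I ⟨$⟩ʳ i)
Iso-Pivotal {G = G} {H} (π , p) i (T , w , l) =
  image π T , trans (p T) w , trans (cong (win H) (sym (image-remove π T i))) (trans (p (T - i)) l)

Iso-all-Pivotal : {G H : SimpleGame n} → Iso G H → (∀ i → Pivotal G i) → ∀ j → Pivotal H j
Iso-all-Pivotal {G = G} {H} I pivotal j =
  subst (Pivotal H) (inverseʳ (proj₁ I)) (Iso-Pivotal {G = G} {H} I _ (pivotal (proj₁ I ⟨$⟩ˡ j)))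

transpose-i : (i j : Fin n) → PermC.transpose i j i ≡ j
transpose-i i j rewrite dec-true (i ≟ i) refl = refl

transpose-j : (i j : Fin n) → PermC.transpose i j j ≡ i
transpose-j i j with j ≟ i
... | yes p = p
... | no p rewrite dec-true (j ≟ j) refl = refl

transpose-other : (i j k : Fin n) → k ≢ i → k ≢ j → PermC.transpose i j k ≡ k
transpose-other i j k p q rewrite dec-false (k ≟ i) p | dec-false (k ≟ j) q = refl

lookup-transpose : (S : Subset n) (i j : Fin n) → lookup S i ≡ lookup S j →
                   ∀ k → lookup S (PermC.transpose j i k) ≡ lookup S k
lookup-transpose S i j e k = by-cases (k ≟ j) (k ≟ i)
  where
  by-cases : Dec (k ≡ j) → Dec (k ≡ i) → lookup S (PermC.transpose j i k) ≡ lookup S k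
  by-cases (yes refl) _ = trans (cong (lookup S) (transpose-i k i)) e
  by-cases (no _) (yes refl) = trans (cong (lookup S) (transpose-j j k)) (sym e)
  by-cases (no p) (no q) = cong (lookup S) (transpose-other j i k p q)

transpose-vetoes-automorphism : (H : SimpleGame n) (i j : Fin n) → IsVeto H i → IsVeto H j →
                                ∀ S → win H (image (transpose i j) S) ≡ win H S
transpose-vetoes-automorphism H i j vi vj S with lookup S i in ei | lookup S j in ej
... | true | true = cong (win H) (Subset-ext λ k →
  trans (lookup-image (transpose i j) S k) (lookup-transpose S i j (trans ei (sym ej)) k))
... | false | _ = trans (veto-absent-losing H j vj _ (begin
  lookup (image τ S) j                ≡⟨ cong (lookup (image τ S)) (transpose-i i j) ⟨
  lookup (image τ S) (τ ⟨$⟩ʳ i)       ≡⟨ lookup-image-⟨$⟩ʳ τ S i ⟩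
  lookup S i                          ≡⟨ ei ⟩
  false                               ∎)) (sym (veto-absent-losing H i vi S ei))
  where
  open ≡-Reasoning
  τ = transpose i j
... | true | false = trans (veto-absent-losing H i vi _ (begin
  lookup (image τ S) i                ≡⟨ cong (lookup (image τ S)) (transpose-j i j) ⟨
  lookup (image τ S) (τ ⟨$⟩ʳ j)       ≡⟨ lookup-image-⟨$⟩ʳ τ S j ⟩
  lookup S j                          ≡⟨ ej ⟩
  false                               ∎)) (sym (veto-absent-losing H j vj S ej))
  where
  open ≡-Reasoning
  τ = transpose i j

transpose-dummies-automorphism : (H : SimpleGame n) (i j : Fin n) → IsDummy H i → IsDummy H j →
                                 ∀ S → win H (image (transpose i j) S) ≡ win H S
transpose-dummies-automorphism H i j di dj S = begin
  win H X                  ≡⟨ dummy-invisible H i di X ⟩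
  win H (X - i)            ≡⟨ dummy-invisible H j dj (X - i) ⟩
  win H ((X - i) - j)      ≡⟨ cong (win H) (Subset-ext same-outside-i-j) ⟩
  win H ((S - i) - j)      ≡⟨ dummy-invisible H j dj (S - i) ⟨
  win H (S - i)            ≡⟨ dummy-invisible H i di S ⟨
  win H S                  ∎
  where
  open ≡-Reasoning
  X = image (transpose i j) S
  same-outside-i-j : ∀ k → lookup ((X - i) - j) k ≡ lookup ((S - i) - j) k
  same-outside-i-j k rewrite lookup-remove² X i j k | lookup-remove² S i j k with k ≡ᵇ j in kj | k ≡ᵇ i in ki
  ... | true | _ = refl
  ... | false | true = refl
  ... | false | false = trans (lookup-image (transpose i j) S k)
                              (cong (lookup S) (transpose-other j i k (≡ᵇ-false⇒≢ k j kj) (≡ᵇ-false⇒≢ k i ki)))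

-- Adding veto and null players

addVeto : SimpleGame n → SimpleGame (suc n)
addVeto G = record { win = win′ ; emptyLose = refl ; fullWin = fullWin G ; monotone = mono }
  where
  win′ : Subset (suc _) → Bool
  win′ (x ∷ S) = x ∧ win G S
  mono : ∀ S T → S ⊆ T → win′ S ≡ true → win′ T ≡ true
  mono (true ∷ S) (y ∷ T) S⊆T w rewrite []=⇒lookup (S⊆T here) = monotone G S T (drop-∷-⊆ S⊆T) w
  mono (false ∷ S) T _ ()

addNull : SimpleGame n → SimpleGame (suc n)
addNull G = record { win = win′ ; emptyLose = emptyLose G ; fullWin = fullWin G ; monotone = mono }
  where
  win′ : Subset (suc _) → Bool
  win′ (x ∷ S) = win G S
  mono : ∀ S T → S ⊆ T → win′ S ≡ true → win′ T ≡ true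
  mono (x ∷ S) (y ∷ T) S⊆T = monotone G S T (drop-∷-⊆ S⊆T)

dictator : SimpleGame 1
dictator = record { win = win′ ; emptyLose = refl ; fullWin = refl ; monotone = mono }
  where
  win′ : Subset 1 → Bool
  win′ (x ∷ []) = x
  mono : ∀ S T → S ⊆ T → win′ S ≡ true → win′ T ≡ true
  mono (true ∷ []) (y ∷ []) S⊆T _ = []=⇒lookup (S⊆T here)

addVetoes : (a : ℕ) → SimpleGame m → SimpleGame (a + m)
addVetoes zero G = G
addVetoes (suc a) G = addVeto (addVetoes a G)

addNulls : (b : ℕ) → SimpleGame m → SimpleGame (b + m)
addNulls zero G = G
addNulls (suc b) G = addNull (addNulls b G)

addVeto-veto : (G : SimpleGame n) → IsVeto (addVeto G) zero
addVeto-veto G = Full-i-losing⇒IsVeto (addVeto G) zero refl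

addNull-dummy : (G : SimpleGame n) → IsDummy (addNull G) zero
addNull-dummy G (x ∷ S) w = trans (cong (win G) (p─⊥≡p S)) w

addVeto-cong : {G H : SimpleGame n} → Iso G H → Iso (addVeto G) (addVeto H)
addVeto-cong (π , p) = lift₀ π , λ { (x ∷ S) → cong (x ∧_) (p S) }

addNull-cong : {G H : SimpleGame n} → Iso G H → Iso (addNull G) (addNull H)
addNull-cong (π , p) = lift₀ π , λ { (x ∷ S) → p S }

image-≗ : (π ρ : Permutation n n) → (∀ i → π ⟨$⟩ʳ i ≡ ρ ⟨$⟩ʳ i) → ∀ S → image π S ≡ image ρ S
image-≗ π ρ p S = Subset-ext λ j → trans (lookup-image π S j) (trans (cong (lookup S) inverses-agree) (sym (lookup-image ρ S j)))
  where
  inverses-agree : ∀ {j} → π ⟨$⟩ˡ j ≡ ρ ⟨$⟩ˡ j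
  inverses-agree {j} = trans (sym (inverseˡ ρ)) (cong (ρ ⟨$⟩ˡ_) (trans (sym (p (π ⟨$⟩ˡ j))) (inverseʳ π)))

Iso-restrict-zero : (G H : SimpleGame (suc n)) (ρ : Permutation (suc n) (suc n)) → ρ ⟨$⟩ʳ zero ≡ zero →
  (∀ S → win H (image ρ S) ≡ win G S) → ∀ x S → win H (x ∷ image (remove zero ρ) S) ≡ win G (x ∷ S)
Iso-restrict-zero G H ρ ρ0 p x S =
  trans (cong (win H) (sym (image-≗ ρ (lift₀ (remove zero ρ)) (λ i → sym (lift₀-remove ρ ρ0 i)) (x ∷ S)))) (p (x ∷ S))

-- Composing with the transposition of 0 and its image, an automorphism when both are vetoes
-- (or both dummies), yields an isomorphism that fixes 0 and hence restricts to the other players.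
Iso-fixing-zero : {G H : SimpleGame (suc n)} (I : Iso G H) →
  (∀ S → win H (image (transpose (proj₁ I ⟨$⟩ʳ zero) zero) S) ≡ win H S) →
  Σ (Permutation (suc n) (suc n)) λ ρ → ρ ⟨$⟩ʳ zero ≡ zero × (∀ S → win H (image ρ S) ≡ win G S)
Iso-fixing-zero {G = G} {H} I auto = proj₁ I∘τ , transpose-i (proj₁ I ⟨$⟩ʳ zero) zero , proj₂ I∘τ
  where I∘τ = Iso-trans {G = G} {H} {H} I (transpose (proj₁ I ⟨$⟩ʳ zero) zero , auto)

addVeto-cancel : {G H : SimpleGame n} → Iso (addVeto G) (addVeto H) → Iso G H
addVeto-cancel {G = G} {H} I with Iso-fixing-zero {G = addVeto G} {addVeto H} I
  (transpose-vetoes-automorphism (addVeto H) _ zero (Iso-IsVeto {G = addVeto G} {addVeto H} I zero (addVeto-veto G)) (addVeto-veto H))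
... | ρ , ρ0 , p = remove zero ρ , Iso-restrict-zero (addVeto G) (addVeto H) ρ ρ0 p true

addNull-cancel : {G H : SimpleGame n} → Iso (addNull G) (addNull H) → Iso G H
addNull-cancel {G = G} {H} I with Iso-fixing-zero {G = addNull G} {addNull H} I
  (transpose-dummies-automorphism (addNull H) _ zero (Iso-IsDummy {G = addNull G} {addNull H} I zero (addNull-dummy G)) (addNull-dummy H))
... | ρ , ρ0 , p = remove zero ρ , Iso-restrict-zero (addNull G) (addNull H) ρ ρ0 p false

addVetoes-cong : ∀ a {G H : SimpleGame m} → Iso G H → Iso (addVetoes a G) (addVetoes a H)
addVetoes-cong zero I = I
addVetoes-cong (suc a) {G} {H} I = addVeto-cong {G = addVetoes a G} {addVetoes a H} (addVetoes-cong a I)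

addNulls-cong : ∀ b {G H : SimpleGame m} → Iso G H → Iso (addNulls b G) (addNulls b H)
addNulls-cong zero I = I
addNulls-cong (suc b) {G} {H} I = addNull-cong {G = addNulls b G} {addNulls b H} (addNulls-cong b I)

-- Class counts and weights of coalitions

module ∑ℕ = Sum +-0-commutativeMonoid
module ∑ℚ = Sum ℚₚ.+-0-commutativeMonoid

contribution : Bool → Fin t → Fin t → ℕ
contribution b x h = if b then (if x ≡ᵇ h then 1 else 0) else 0

countIn-tabulate : (c : Fin n → Fin t) (S : Subset n) (h : Fin t) → ∀ k (g : Fin k → Fin n) →
  length (filter (λ i → c i ≟ h) (filter (λ i → lookup S i Bool.≟ true) (tabulate g)))
  ≡ ∑ℕ.sum (λ j → contribution (lookup S (g j)) (c (g j)) h)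
countIn-tabulate c S h zero g = refl
countIn-tabulate c S h (suc k) g with lookup S (g zero) | countIn-tabulate c S h k (λ j → g (suc j))
... | false | ih = ih
... | true | ih with c (g zero) ≟ h
...   | yes _ = cong suc ih
...   | no _ = ih

countIn-sum : (c : Fin n → Fin t) (S : Subset n) (h : Fin t) →
  countIn c S h ≡ ∑ℕ.sum (λ i → contribution (lookup S i) (c i) h)
countIn-sum {n} c S h = countIn-tabulate c S h n (λ i → i)

countIn-∷ : (c : Fin (suc n) → Fin t) (x : Bool) (S : Subset n) (h : Fin t) →
  countIn c (x ∷ S) h ≡ contribution x (c zero) h + countIn (λ i → c (suc i)) S h
countIn-∷ c x S h = trans (countIn-sum c (x ∷ S) h) (cong (contribution x (c zero) h +_) (sym (countIn-sum (λ i → c (suc i)) S h)))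

countIn-image : (π : Permutation n n) (c : Fin n → Fin t) (S : Subset n) (h : Fin t) →
  countIn (λ j → c (π ⟨$⟩ˡ j)) (image π S) h ≡ countIn c S h
countIn-image π c S h = begin
  countIn (λ j → c (π ⟨$⟩ˡ j)) (image π S) h   ≡⟨ countIn-sum _ (image π S) h ⟩
  ∑ℕ.sum f                                     ≡⟨ ∑ℕ.sum-permute f π ⟩
  ∑ℕ.sum (λ i → f (π ⟨$⟩ʳ i))                  ≡⟨ ∑ℕ.sum-cong-≗ f∘π≗ ⟩
  ∑ℕ.sum (λ i → contribution (lookup S i) (c i) h) ≡⟨ countIn-sum c S h ⟨
  countIn c S h                                ∎
  where
  open ≡-Reasoning
  f = λ j → contribution (lookup (image π S) j) (c (π ⟨$⟩ˡ j)) h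
  f∘π≗ : ∀ i → f (π ⟨$⟩ʳ i) ≡ contribution (lookup S i) (c i) h
  f∘π≗ i = cong₂ (λ b x → contribution b x h) (lookup-image-⟨$⟩ʳ π S i) (cong c (inverseˡ π))

countIn-∷-other : (c : Fin (suc n) → Fin t) (x : Bool) (S : Subset n) (h : Fin t) → c zero ≢ h →
  countIn c (x ∷ S) h ≡ countIn (λ i → c (suc i)) S h
countIn-∷-other c false S h _ = countIn-∷ c false S h
countIn-∷-other c true S h ne rewrite countIn-∷ c true S h | ≢⇒≡ᵇ-false (c zero) h ne = refl

countIn-∷-own : (c : Fin (suc n) → Fin t) (S : Subset n) →
  countIn c (true ∷ S) (c zero) ≡ suc (countIn (λ i → c (suc i)) S (c zero))
countIn-∷-own c S rewrite countIn-∷ c true S (c zero) | ≡ᵇ-refl (c zero) = refl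

share : (Fin n → ℚ) → Subset n → Fin n → ℚ
share w S i = if lookup S i then w i else 0ℚ

weightOf-tabulate : (w : Fin n → ℚ) (S : Subset n) → ∀ k (g : Fin k → Fin n) →
  foldr (λ i acc → share w S i ℚ.+ acc) 0ℚ (tabulate g) ≡ ∑ℚ.sum (λ j → share w S (g j))
weightOf-tabulate w S zero g = refl
weightOf-tabulate w S (suc k) g = cong (share w S (g zero) ℚ.+_) (weightOf-tabulate w S k (λ j → g (suc j)))

weightOf-sum : (w : Fin n → ℚ) (S : Subset n) → weightOf w S ≡ ∑ℚ.sum (share w S)
weightOf-sum {n} w S = weightOf-tabulate w S n (λ i → i)

weightOf-∷ : (w : Fin (suc n) → ℚ) (x : Bool) (S : Subset n) →
  weightOf w (x ∷ S) ≡ (if x then w zero else 0ℚ) ℚ.+ weightOf (λ i → w (suc i)) S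
weightOf-∷ w x S = trans (weightOf-sum w (x ∷ S)) (cong ((if x then w zero else 0ℚ) ℚ.+_) (sym (weightOf-sum (λ i → w (suc i)) S)))

weightOf-image : (π : Permutation n n) (w : Fin n → ℚ) (S : Subset n) →
  weightOf (λ j → w (π ⟨$⟩ˡ j)) (image π S) ≡ weightOf w S
weightOf-image π w S = begin
  weightOf (λ j → w (π ⟨$⟩ˡ j)) (image π S)   ≡⟨ weightOf-sum _ (image π S) ⟩
  ∑ℚ.sum f                                    ≡⟨ ∑ℚ.sum-permute f π ⟩
  ∑ℚ.sum (λ i → f (π ⟨$⟩ʳ i))                 ≡⟨ ∑ℚ.sum-cong-≗ f∘π≗ ⟩
  ∑ℚ.sum (share w S)                          ≡⟨ weightOf-sum w S ⟨
  weightOf w S                                ∎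
  where
  open ≡-Reasoning
  f = share (λ j → w (π ⟨$⟩ˡ j)) (image π S)
  f∘π≗ : ∀ i → f (π ⟨$⟩ʳ i) ≡ share w S i
  f∘π≗ i = cong₂ (λ b x → if b then x else 0ℚ) (lookup-image-⟨$⟩ʳ π S i) (cong w (inverseˡ π))

realizing-coalition : (c : Fin n → Fin t) (v : Vec ℕ t) → ValidVec c v → ∃ (Realizes c v)
realizing-coalition {zero} c v valid = [] , λ h → sym (n≤0⇒n≡0 (valid h))
realizing-coalition {suc n} c v valid with lookup v (c zero) in e
... | zero = false ∷ proj₁ rest , λ h → trans (countIn-∷ c false _ h) (proj₂ rest h)
  where
  valid′ : ∀ h → Dec (c zero ≡ h) → lookup v h ≤ classSize (λ i → c (suc i)) h
  valid′ h (yes refl) = subst (_≤ _) (sym e) z≤n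
  valid′ h (no ne) = subst (lookup v h ≤_) (countIn-∷-other c true Full h ne) (valid h)
  rest = realizing-coalition (λ i → c (suc i)) v (λ h → valid′ h (c zero ≟ h))
... | suc k = true ∷ proj₁ rest , λ h → realizes h (c zero ≟ h)
  where
  v′ = v [ c zero ]≔ k
  valid′ : ∀ h → Dec (c zero ≡ h) → lookup v′ h ≤ classSize (λ i → c (suc i)) h
  valid′ h (yes refl) = subst (_≤ _) (sym (lookup∘update (c zero) v k))
    (s≤s⁻¹ (subst₂ _≤_ e (countIn-∷-own c Full) (valid (c zero))))
  valid′ h (no ne) = subst₂ _≤_ (sym (lookup∘update′ (λ q → ne (sym q)) v k)) (countIn-∷-other c true Full h ne) (valid h)
  rest = realizing-coalition (λ i → c (suc i)) v′ (λ h → valid′ h (c zero ≟ h))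
  realizes : ∀ h → Dec (c zero ≡ h) → countIn c (true ∷ proj₁ rest) h ≡ lookup v h
  realizes h (yes refl) = trans (countIn-∷-own c (proj₁ rest))
    (trans (cong suc (trans (proj₂ rest (c zero)) (lookup∘update (c zero) v k))) (sym e))
  realizes h (no ne) = trans (countIn-∷-other c true (proj₁ rest) h ne)
    (trans (proj₂ rest h) (lookup∘update′ (λ q → ne (sym q)) v k))

WinningVec⇒¬LosingVec : {G : SimpleGame n} {c : Fin n → Fin t} {v : Vec ℕ t} → WinningVec G c v → LosingVec G c v → ⊥
WinningVec⇒¬LosingVec {c = c} {v} (valid , w) (_ , l) with realizing-coalition c v valid
... | S , r = not-¬ (w S r) (l S r)

-- Isomorphism invariance

-- Instances: isomorphisms (φ = image π) and relabellings of the same classes (φ = id).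
module CoalitionCorrespondence {G H : SimpleGame n} {c d : Fin n → Fin t}
  (φ ψ : Subset n → Subset n) (φ∘ψ : ∀ T → φ (ψ T) ≡ T) (φ-Full : φ Full ≡ Full)
  (win-φ : ∀ S → win H (φ S) ≡ win G S) (countIn-φ : ∀ S h → countIn d (φ S) h ≡ countIn c S h) where

  classSize-φ : ∀ h → classSize d h ≡ classSize c h
  classSize-φ h = trans (cong (λ S → countIn d S h) (sym φ-Full)) (countIn-φ Full h)

  ValidVec⇔ : ∀ v → ValidVec d v ⇔ ValidVec c v
  ValidVec⇔ v = mk⇔ (λ valid h → subst (lookup v h ≤_) (classSize-φ h) (valid h))
                    (λ valid h → subst (lookup v h ≤_) (sym (classSize-φ h)) (valid h))

  Realizes-φ : ∀ v S → Realizes d v (φ S) ⇔ Realizes c v S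
  Realizes-φ v S = mk⇔ (λ r h → trans (sym (countIn-φ S h)) (r h)) (λ r h → trans (countIn-φ S h) (r h))

  Realizes-ψ : ∀ v T → Realizes d v T → Realizes c v (ψ T)
  Realizes-ψ v T r = to (Realizes-φ v (ψ T)) (subst (Realizes d v) (sym (φ∘ψ T)) r)

  win-ψ : ∀ T → win H T ≡ win G (ψ T)
  win-ψ T = trans (cong (win H) (sym (φ∘ψ T))) (win-φ (ψ T))

  outcome⇔ : ∀ {b} v → (∀ T → Realizes d v T → win H T ≡ b) ⇔ (∀ S → Realizes c v S → win G S ≡ b)
  outcome⇔ v = mk⇔ (λ o S r → trans (sym (win-φ S)) (o (φ S) (from (Realizes-φ v S) r)))
                   (λ o T r → trans (win-ψ T) (o (ψ T) (Realizes-ψ v T r)))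

  WinningVec⇔ : ∀ v → WinningVec H d v ⇔ WinningVec G c v
  WinningVec⇔ v = mk⇔ (λ (valid , o) → to (ValidVec⇔ v) valid , to (outcome⇔ v) o)
                      (λ (valid , o) → from (ValidVec⇔ v) valid , from (outcome⇔ v) o)

  LosingVec⇔ : ∀ v → LosingVec H d v ⇔ LosingVec G c v
  LosingVec⇔ v = mk⇔ (λ (valid , o) → to (ValidVec⇔ v) valid , to (outcome⇔ v) o)
                     (λ (valid , o) → from (ValidVec⇔ v) valid , from (outcome⇔ v) o)

  ShiftMinWinning⇔ : ∀ v → ShiftMinWinning H d v ⇔ ShiftMinWinning G c v
  ShiftMinWinning⇔ v =
    mk⇔ (λ (w , minimal) → to (WinningVec⇔ v) w , λ v′ valid ≻ → to (LosingVec⇔ v′) (minimal v′ (from (ValidVec⇔ v′) valid) ≻))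
        (λ (w , minimal) → from (WinningVec⇔ v) w , λ v′ valid ≻ → from (LosingVec⇔ v′) (minimal v′ (to (ValidVec⇔ v′) valid) ≻))

  ExactlyShiftMin⇔ : ∀ r → ExactlyShiftMin H d r ⇔ ExactlyShiftMin G c r
  ExactlyShiftMin⇔ r =
    mk⇔ (λ (L , unique , len , mem) → L , unique , len , λ v → mk⇔ (to (ShiftMinWinning⇔ v) ∘ to (mem v)) (from (mem v) ∘ from (ShiftMinWinning⇔ v)))
        (λ (L , unique , len , mem) → L , unique , len , λ v → mk⇔ (from (ShiftMinWinning⇔ v) ∘ to (mem v)) (from (mem v) ∘ to (ShiftMinWinning⇔ v)))

ExactlyShiftMin-cong : {G : SimpleGame n} (c d : Fin n → Fin t) → (∀ i → c i ≡ d i) →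
                       ∀ r → ExactlyShiftMin G c r → ExactlyShiftMin G d r
ExactlyShiftMin-cong {G = G} c d c≗d r =
  from (CoalitionCorrespondence.ExactlyShiftMin⇔ {G = G} {G} {c} {d} (λ S → S) (λ S → S) (λ _ → refl) refl (λ _ → refl) countIn-d r)
  where
  countIn-d : ∀ S h → countIn d S h ≡ countIn c S h
  countIn-d S h = trans (countIn-sum d S h)
    (trans (∑ℕ.sum-cong-≗ (λ i → cong (λ x → contribution (lookup S i) x h) (sym (c≗d i)))) (sym (countIn-sum c S h)))

≿-Iso : {G H : SimpleGame n} (I : Iso G H) {i j : Fin n} → i ≿[ G ] j → (proj₁ I ⟨$⟩ʳ i) ≿[ H ] (proj₁ I ⟨$⟩ʳ j)
≿-Iso {G = G} {H} (π , iso) {i} {j} i≿j S i∉S j∉S w = begin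
  win H (S ∪ ⁅ π ⟨$⟩ʳ i ⁆)                 ≡⟨ win-preimage (S ∪ ⁅ π ⟨$⟩ʳ i ⁆) ⟩
  win G (image (flip π) (S ∪ ⁅ π ⟨$⟩ʳ i ⁆)) ≡⟨ cong (win G) (preimage-∪ i) ⟩
  win G (S₀ ∪ ⁅ i ⁆)                       ≡⟨ i≿j S₀ (∉-preimage i∉S) (∉-preimage j∉S) w₀ ⟩
  true                                     ∎
  where
  open ≡-Reasoning
  S₀ = image (flip π) S
  win-preimage : ∀ T → win H T ≡ win G (image (flip π) T)
  win-preimage T = trans (cong (win H) (sym (image-image-flip π T))) (iso (image (flip π) T))
  preimage-∪ : ∀ k → image (flip π) (S ∪ ⁅ π ⟨$⟩ʳ k ⁆) ≡ S₀ ∪ ⁅ k ⁆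
  preimage-∪ k = trans (image-∪-⁅⁆ (flip π) S _) (cong (λ l → S₀ ∪ ⁅ l ⁆) (inverseˡ π))
  ∉-preimage : ∀ {k} → (π ⟨$⟩ʳ k) ∉ S → k ∉ S₀
  ∉-preimage {k} k∉S = lookup-false⇒∉ (trans (lookup-image (flip π) S k) (∉⇒lookup-false k∉S))
  w₀ : win G (S₀ ∪ ⁅ j ⁆) ≡ true
  w₀ = trans (cong (win G) (sym (preimage-∪ j))) (trans (sym (win-preimage _)) w)

≿-Iso⁻¹ : {G H : SimpleGame n} (I : Iso G H) {i j : Fin n} →
  (proj₁ I ⟨$⟩ˡ i) ≿[ G ] (proj₁ I ⟨$⟩ˡ j) → i ≿[ H ] j
≿-Iso⁻¹ {G = G} {H} I d = subst₂ (λ k l → k ≿[ H ] l) (inverseʳ (proj₁ I)) (inverseʳ (proj₁ I)) (≿-Iso {G = G} {H} I d)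

≈-Iso⇔ : {G H : SimpleGame n} (I : Iso G H) (i j : Fin n) →
  ((proj₁ I ⟨$⟩ˡ i) ≈[ G ] (proj₁ I ⟨$⟩ˡ j)) ⇔ (i ≈[ H ] j)
≈-Iso⇔ {G = G} {H} I i j =
  mk⇔ (λ (p , q) → ≿-Iso⁻¹ {G = G} {H} I p , ≿-Iso⁻¹ {G = G} {H} I q)
      (λ (p , q) → ≿-Iso {G = H} {G} (Iso-sym {G = G} {H} I) p , ≿-Iso {G = H} {G} (Iso-sym {G = G} {H} I) q)

module _ {G H : SimpleGame n} (I : Iso G H) (c : Fin n → Fin t) where
  private
    π = proj₁ I
    c′ : Fin n → Fin t
    c′ j = c (π ⟨$⟩ˡ j)

  OrderedClasses-Iso : OrderedClasses G t c → OrderedClasses H t c′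
  OrderedClasses-Iso (onto , same⇔≈ , <⇒≻) = onto′ , same⇔≈′ , <⇒≻′
    where
    onto′ : ∀ h → ∃ λ i → c′ i ≡ h
    onto′ h = π ⟨$⟩ʳ proj₁ (onto h) , trans (cong c (inverseˡ π)) (proj₂ (onto h))
    same⇔≈′ : ∀ i j → (c′ i ≡ c′ j) ⇔ (i ≈[ H ] j)
    same⇔≈′ i j = mk⇔ (to (≈-Iso⇔ {G = G} {H} I i j) ∘ to (same⇔≈ _ _)) (from (same⇔≈ _ _) ∘ from (≈-Iso⇔ {G = G} {H} I i j))
    <⇒≻′ : ∀ i j → c′ i <ᶠ c′ j → i ≻[ H ] j
    <⇒≻′ i j lt with <⇒≻ _ _ lt
    ... | i≿j , j⋡i = ≿-Iso⁻¹ {G = G} {H} I i≿j , λ j≿i → j⋡i (≿-Iso {G = H} {G} (Iso-sym {G = G} {H} I) j≿i)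

  ExactlyShiftMin-Iso : ∀ r → ExactlyShiftMin G c r → ExactlyShiftMin H c′ r
  ExactlyShiftMin-Iso r = from (CoalitionCorrespondence.ExactlyShiftMin⇔ {G = G} {H} {c} {c′}
    (image π) (image (flip π)) (image-image-flip π) (image-replicate π true) (proj₂ I) (countIn-image π c) r)

Iso-HasTR : {G H : SimpleGame n} → Iso G H → ∀ {t r} → HasTR G t r → HasTR H t r
Iso-HasTR {G = G} {H} I (c , ordered , exact) =
  _ , OrderedClasses-Iso {G = G} {H} I c ordered , ExactlyShiftMin-Iso {G = G} {H} I c _ exact

Iso-Weighted : {G H : SimpleGame n} → Iso G H → Weighted G → Weighted H
Iso-Weighted {G = G} {H} (π , iso) (w , q , w≥0 , q>0 , win⇔) = w′ , q , (λ j → w≥0 (π ⟨$⟩ˡ j)) , q>0 , win⇔′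
  where
  w′ = λ j → w (π ⟨$⟩ˡ j)
  win⇔′ : ∀ S → Winning H S ⇔ (q ℚ.≤ weightOf w′ S)
  win⇔′ S = subst₂ (λ b x → (b ≡ true) ⇔ (q ℚ.≤ x)) (sym win-S) (sym weight-S) (win⇔ S₀)
    where
    S₀ = image (flip π) S
    win-S : win H S ≡ win G S₀
    win-S = trans (cong (win H) (sym (image-image-flip π S))) (iso S₀)
    weight-S : weightOf w′ S ≡ weightOf w S₀
    weight-S = trans (cong (weightOf w′) (sym (image-image-flip π S))) (weightOf-image π w S₀)

Iso-WG : ∀ {t r} {G H : SimpleGame n} → Iso G H → WG n t r G → WG n t r H
Iso-WG {G = G} {H} I (weighted , hasTR) = Iso-Weighted {G = G} {H} I weighted , Iso-HasTR {G = G} {H} I hasTR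

-- Desirability of veto and dummy players

Pivotal? : (G : SimpleGame n) (j : Fin n) → Dec (Pivotal G j)
Pivotal? G j = anySubset? (λ T → (win G T Bool.≟ true) ×-dec (win G (T - j) Bool.≟ false))

¬Pivotal⇒IsDummy : (G : SimpleGame n) (j : Fin n) → ¬ Pivotal G j → IsDummy G j
¬Pivotal⇒IsDummy G j ¬pivotal T w = ¬-not λ l → ¬pivotal (T , w , l)

IsDummy? : (G : SimpleGame n) (j : Fin n) → Dec (IsDummy G j)
IsDummy? G j with Pivotal? G j
... | yes pivotal = no (Pivotal⇒¬IsDummy G j pivotal)
... | no ¬pivotal = yes (¬Pivotal⇒IsDummy G j ¬pivotal)

¬IsDummy⇒Pivotal : (G : SimpleGame n) (j : Fin n) → ¬ IsDummy G j → Pivotal G j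
¬IsDummy⇒Pivotal G j ¬dummy with Pivotal? G j
... | yes pivotal = pivotal
... | no ¬pivotal = contradiction (¬Pivotal⇒IsDummy G j ¬pivotal) ¬dummy

¬IsNull⇒Pivotal : (G : SimpleGame n) (j : Fin n) → ¬ IsNull G j → Pivotal G j
¬IsNull⇒Pivotal G j ¬null = ¬IsDummy⇒Pivotal G j (λ d → ¬null (IsDummy⇒IsNull G j d))

¬IsVeto⇒Full-i-winning : (G : SimpleGame n) (j : Fin n) → ¬ IsVeto G j → win G (Full - j) ≡ true
¬IsVeto⇒Full-i-winning G j ¬veto with win G (Full - j) in e
... | true = refl
... | false = contradiction (Full-i-losing⇒IsVeto G j e) ¬veto

IsVeto⇒Pivotal : (G : SimpleGame n) (i : Fin n) → IsVeto G i → Pivotal G i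
IsVeto⇒Pivotal G i v = Full , fullWin G , IsVeto⇒Full-i-losing G i v

IsVeto⇒≿ : (G : SimpleGame n) (i j : Fin n) → IsVeto G i → i ≿[ G ] j
IsVeto⇒≿ G i j v S i∉S j∉S w = subst (λ k → Winning G (S ∪ ⁅ k ⁆)) (sym i≡j) w
  where
  i≡j : i ≡ j
  i≡j with i ≟ j
  ... | yes p = p
  ... | no i≢j = contradiction (v _ w) (lookup-false⇒∉ (trans (lookup-∪-⁅⁆ S j i)
                   (trans (cong (if_then true else lookup S i) (≢⇒≡ᵇ-false i j i≢j)) (∉⇒lookup-false i∉S))))

-- Compare i and j on the coalition of all other players.
IsVeto⇒⋡ : (G : SimpleGame n) (i j : Fin n) → IsVeto G i → ¬ IsVeto G j → ¬ (j ≿[ G ] i)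
IsVeto⇒⋡ G i j vi ¬vj j≿i = not-¬ Full-i-winning (IsVeto⇒Full-i-losing G i vi)
  where
  i≢j : i ≢ j
  i≢j refl = ¬vj vi
  S = (Full - i) - j
  Full-j⊆S∪i : ∀ k → lookup (Full - j) k ≡ true → lookup (S ∪ ⁅ i ⁆) k ≡ true
  Full-j⊆S∪i k p rewrite lookup-∪-⁅⁆ S i k | lookup-remove² Full i j k | lookup-remove Full j k with k ≡ᵇ i | k ≡ᵇ j
  ... | true | _ = refl
  ... | false | true = p
  ... | false | false = p
  S∪j⊆Full-i : ∀ k → lookup (S ∪ ⁅ j ⁆) k ≡ true → lookup (Full - i) k ≡ true
  S∪j⊆Full-i k p rewrite lookup-∪-⁅⁆ S j k | lookup-remove² Full i j k | lookup-remove Full i k with k ≡ᵇ i in ki | k ≡ᵇ j in kj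
  ... | true | true = contradiction (trans (sym (≡ᵇ⇒≡ k i ki)) (≡ᵇ⇒≡ k j kj)) i≢j
  ... | true | false = p
  ... | false | _ = lookup-replicate k true
  Full-i-winning : win G (Full - i) ≡ true
  Full-i-winning = win-mono G _ _ S∪j⊆Full-i (j≿i S (∉-remove-self (Full - i) j) (∉-remove j (∉-remove-self Full i))
                     (win-mono G _ _ Full-j⊆S∪i (¬IsVeto⇒Full-i-winning G j ¬vj)))

IsDummy⇒≾ : (G : SimpleGame n) (i j : Fin n) → IsDummy G j → i ≿[ G ] j
IsDummy⇒≾ G i j d S i∉S j∉S w = win-mono G _ _ S∪j-j⊆S∪i (d _ w)
  where
  S∪j-j⊆S∪i : ∀ k → lookup ((S ∪ ⁅ j ⁆) - j) k ≡ true → lookup (S ∪ ⁅ i ⁆) k ≡ true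
  S∪j-j⊆S∪i k p rewrite lookup-∪-⁅⁆ S i k | lookup-remove (S ∪ ⁅ j ⁆) j k | lookup-∪-⁅⁆ S j k with k ≡ᵇ i | k ≡ᵇ j
  ... | true | _ = refl
  ... | false | false = p

-- Compare i and j on T - j - i, where T is a coalition for which j is pivotal.
IsDummy⇒⋡ : (G : SimpleGame n) (i j : Fin n) → IsDummy G i → Pivotal G j → ¬ (i ≿[ G ] j)
IsDummy⇒⋡ G i j d (T , wT , lT) i≿j = not-¬ (i≿j S (∉-remove-self (T - j) i) (∉-remove i (∉-remove-self T j)) S∪j-winning) S∪i-losing
  where
  S = (T - j) - i
  T-i⊆S∪j : ∀ k → lookup (T - i) k ≡ true → lookup (S ∪ ⁅ j ⁆) k ≡ true
  T-i⊆S∪j k p rewrite lookup-∪-⁅⁆ S j k | lookup-remove² T j i k | lookup-remove T i k with k ≡ᵇ i | k ≡ᵇ j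
  ... | _ | true = refl
  ... | true | false = p
  ... | false | false = p
  S∪j-winning : win G (S ∪ ⁅ j ⁆) ≡ true
  S∪j-winning = win-mono G _ _ T-i⊆S∪j (d T wT)
  S∪i-i⊆T-j : ∀ k → lookup ((S ∪ ⁅ i ⁆) - i) k ≡ true → lookup (T - j) k ≡ true
  S∪i-i⊆T-j k p rewrite lookup-remove (S ∪ ⁅ i ⁆) i k | lookup-∪-⁅⁆ S i k | lookup-remove² T j i k | lookup-remove T j k with k ≡ᵇ i | k ≡ᵇ j
  ... | false | true = p
  ... | false | false = p
  S∪i-losing : win G (S ∪ ⁅ i ⁆) ≡ false
  S∪i-losing = trans (dummy-invisible G i d _) (losing-mono G _ _ S∪i-i⊆T-j lT)

IsVeto⇒≈ : (G : SimpleGame n) (i j : Fin n) → IsVeto G i → IsVeto G j → i ≈[ G ] j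
IsVeto⇒≈ G i j vi vj = IsVeto⇒≿ G i j vi , IsVeto⇒≿ G j i vj

IsDummy⇒≈ : (G : SimpleGame n) (i j : Fin n) → IsDummy G i → IsDummy G j → i ≈[ G ] j
IsDummy⇒≈ G i j di dj = IsDummy⇒≾ G i j dj , IsDummy⇒≾ G j i di

∉-∷⁻ : ∀ {x} {S : Subset n} {i : Fin n} → suc i ∉ (x ∷ S) → i ∉ S
∉-∷⁻ i∉ i∈ = i∉ (there i∈)

∉-∷⁺ : ∀ {x} {S : Subset n} {i : Fin n} → i ∉ S → suc i ∉ (x ∷ S)
∉-∷⁺ i∉ (there i∈) = i∉ i∈

≿-addVeto⇔ : (G : SimpleGame n) (i j : Fin n) → (suc i ≿[ addVeto G ] suc j) ⇔ (i ≿[ G ] j)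
≿-addVeto⇔ G i j = mk⇔ (λ d S i∉ j∉ → d (true ∷ S) (∉-∷⁺ i∉) (∉-∷⁺ j∉)) lift
  where
  lift : i ≿[ G ] j → suc i ≿[ addVeto G ] suc j
  lift d (true ∷ S) i∉ j∉ = d S (∉-∷⁻ i∉) (∉-∷⁻ j∉)
  lift d (false ∷ S) i∉ j∉ ()

≿-addNull⇔ : (G : SimpleGame n) (i j : Fin n) → (suc i ≿[ addNull G ] suc j) ⇔ (i ≿[ G ] j)
≿-addNull⇔ G i j = mk⇔ (λ d S i∉ j∉ → d (false ∷ S) (∉-∷⁺ i∉) (∉-∷⁺ j∉)) lift
  where
  lift : i ≿[ G ] j → suc i ≿[ addNull G ] suc j
  lift d (x ∷ S) i∉ j∉ = d S (∉-∷⁻ i∉) (∉-∷⁻ j∉)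

IsVeto-addVeto⇔ : (G : SimpleGame n) (i : Fin n) → IsVeto (addVeto G) (suc i) ⇔ IsVeto G i
IsVeto-addVeto⇔ G i = mk⇔ (λ v → Full-i-losing⇒IsVeto G i (IsVeto⇒Full-i-losing (addVeto G) (suc i) v))
                          (λ v → Full-i-losing⇒IsVeto (addVeto G) (suc i) (IsVeto⇒Full-i-losing G i v))

Pivotal-addVeto : (G : SimpleGame n) (j : Fin n) → Pivotal G j → Pivotal (addVeto G) (suc j)
Pivotal-addVeto G j (T , w , l) = true ∷ T , w , l

Pivotal-addNull : (G : SimpleGame n) (j : Fin n) → Pivotal G j → Pivotal (addNull G) (suc j)
Pivotal-addNull G j (T , w , l) = false ∷ T , w , l

IsDummy-addNull : (G : SimpleGame n) (j : Fin n) → IsDummy G j → IsDummy (addNull G) (suc j)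
IsDummy-addNull G j d (x ∷ S) w with x
... | true = d S w
... | false = d S w

≿-addVetoes⇔ : ∀ a (G : SimpleGame m) (i j : Fin m) → ((a ↑ʳ i) ≿[ addVetoes a G ] (a ↑ʳ j)) ⇔ (i ≿[ G ] j)
≿-addVetoes⇔ zero G i j = ⇔.refl
≿-addVetoes⇔ (suc a) G i j = ⇔.trans (≿-addVeto⇔ (addVetoes a G) _ _) (≿-addVetoes⇔ a G i j)

≿-addNulls⇔ : ∀ b (G : SimpleGame m) (i j : Fin m) → ((b ↑ʳ i) ≿[ addNulls b G ] (b ↑ʳ j)) ⇔ (i ≿[ G ] j)
≿-addNulls⇔ zero G i j = ⇔.refl
≿-addNulls⇔ (suc b) G i j = ⇔.trans (≿-addNull⇔ (addNulls b G) _ _) (≿-addNulls⇔ b G i j)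

addVetoes-veto : ∀ a (G : SimpleGame m) (k : Fin a) → IsVeto (addVetoes a G) (k ↑ˡ m)
addVetoes-veto (suc a) G zero = addVeto-veto (addVetoes a G)
addVetoes-veto (suc a) G (suc k) = from (IsVeto-addVeto⇔ (addVetoes a G) _) (addVetoes-veto a G k)

IsVeto-addVetoes⇔ : ∀ a (G : SimpleGame m) (j : Fin m) → IsVeto (addVetoes a G) (a ↑ʳ j) ⇔ IsVeto G j
IsVeto-addVetoes⇔ zero G j = ⇔.refl
IsVeto-addVetoes⇔ (suc a) G j = ⇔.trans (IsVeto-addVeto⇔ (addVetoes a G) _) (IsVeto-addVetoes⇔ a G j)

Pivotal-addVetoes : ∀ a (G : SimpleGame m) (j : Fin m) → Pivotal G j → Pivotal (addVetoes a G) (a ↑ʳ j)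
Pivotal-addVetoes zero G j p = p
Pivotal-addVetoes (suc a) G j p = Pivotal-addVeto (addVetoes a G) _ (Pivotal-addVetoes a G j p)

Pivotal-addNulls : ∀ b (G : SimpleGame m) (j : Fin m) → Pivotal G j → Pivotal (addNulls b G) (b ↑ʳ j)
Pivotal-addNulls zero G j p = p
Pivotal-addNulls (suc b) G j p = Pivotal-addNull (addNulls b G) _ (Pivotal-addNulls b G j p)

addNulls-dummy : ∀ b (G : SimpleGame m) (k : Fin b) → IsDummy (addNulls b G) (k ↑ˡ m)
addNulls-dummy (suc b) G zero = addNull-dummy (addNulls b G)
addNulls-dummy (suc b) G (suc k) = IsDummy-addNull (addNulls b G) _ (addNulls-dummy b G k)

data Split (a : ℕ) {m : ℕ} : Fin (a + m) → Set where
  added : (k : Fin a) → Split a (k ↑ˡ m)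
  old : (j : Fin m) → Split a (a ↑ʳ j)

split : ∀ a (i : Fin (a + m)) → Split a i
split zero i = old i
split (suc a) zero = added zero
split (suc a) (suc i) with split a i
... | added k = added (suc k)
... | old j = old j

-- Shift-minimal winning vectors of extensions

HasExactly : {A : Set} → (A → Set) → ℕ → Set
HasExactly {A} P r = Σ (List A) λ L → Unique L × length L ≡ r × (∀ x → (x ∈ₗ L) ⇔ P x)

HasExactly-⇔ : {A : Set} {P Q : A → Set} → (∀ x → P x ⇔ Q x) → ∀ {r} → HasExactly P r → HasExactly Q r
HasExactly-⇔ P⇔Q (L , unique , len , mem) = L , unique , len , λ x → ⇔.trans (mem x) (P⇔Q x)

module _ {A B : Set} (f : A → B) (f-injective : ∀ {x y} → f x ≡ f y → x ≡ y) {P : A → Set} {Q : B → Set}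
         (Q⇒image : ∀ y → Q y → ∃ λ x → y ≡ f x × P x) (P⇒Q : ∀ x → P x → Q (f x)) where

  HasExactly-image : ∀ {r} → HasExactly P r → HasExactly Q r
  HasExactly-image (L , unique , len , mem) =
    map f L , Unique.map⁺ f-injective unique , trans (length-map f L) len , λ y → mk⇔ (sound y) (complete y)
    where
    sound : ∀ y → y ∈ₗ map f L → Q y
    sound y y∈ with ∈-map⁻ f y∈
    ... | x , x∈ , refl = P⇒Q x (to (mem x) x∈)
    complete : ∀ y → Q y → y ∈ₗ map f L
    complete y q with Q⇒image y q
    ... | x , refl , p = ∈-map⁺ f (from (mem x) p)

  module _ (g : B → A) (g∘f : ∀ x → g (f x) ≡ x) where

    map-f∘g : (L : List B) → (∀ y → y ∈ₗ L → Q y) → map f (map g L) ≡ L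
    map-f∘g [] _ = refl
    map-f∘g (y ∷ L) q with Q⇒image y (q y (here refl))
    ... | x , refl , _ = cong₂ _∷_ (cong f (g∘f x)) (map-f∘g L (λ z z∈ → q z (there z∈)))

    HasExactly-preimage : ∀ {r} → HasExactly Q r → HasExactly P r
    HasExactly-preimage (L , unique , len , mem) =
      map g L , Unique.map⁻ (subst Unique (sym (map-f∘g L (λ y → to (mem y)))) unique) ,
      trans (length-map g L) len , λ x → mk⇔ (sound x) (complete x)
      where
      sound : ∀ x → x ∈ₗ map g L → P x
      sound x x∈ with ∈-map⁻ g x∈
      ... | y , y∈ , refl with Q⇒image y (to (mem y) y∈)
      ...   | x′ , refl , p = subst P (sym (g∘f x′)) p
      complete : ∀ x → P x → x ∈ₗ map g L
      complete x p = subst (_∈ₗ map g L) (g∘f x) (∈-map⁺ g (from (mem (f x)) (P⇒Q x p)))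

countIn-absent : (c : Fin n → Fin t) (S : Subset n) (h : Fin t) → (∀ i → c i ≢ h) → countIn c S h ≡ 0
countIn-absent {zero} c [] h _ = refl
countIn-absent {suc n} c (x ∷ S) h c≢h =
  trans (countIn-∷-other c x S h (c≢h zero)) (countIn-absent (λ i → c (suc i)) S h (λ i → c≢h (suc i)))

countIn-injective : (f : Fin t → Fin s) → (∀ {x y} → f x ≡ f y → x ≡ y) →
  (c : Fin n → Fin t) (S : Subset n) (h : Fin t) → countIn (λ i → f (c i)) S (f h) ≡ countIn c S h
countIn-injective f f-injective c S h =
  trans (countIn-sum _ S (f h)) (trans (∑ℕ.sum-cong-≗ same-contribution) (sym (countIn-sum c S h)))
  where
  ≡ᵇ-f : ∀ x → (f x ≡ᵇ f h) ≡ (x ≡ᵇ h)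
  ≡ᵇ-f x with x ≟ h
  ... | yes refl = ≡ᵇ-refl (f x)
  ... | no x≢h = ≢⇒≡ᵇ-false (f x) (f h) (λ e → x≢h (f-injective e))
  same-contribution : ∀ i → contribution (lookup S i) (f (c i)) (f h) ≡ contribution (lookup S i) (c i) h
  same-contribution i = cong (λ b → if lookup S i then (if b then 1 else 0) else 0) (≡ᵇ-f (c i))

Full-++ : ∀ a → Full {a + m} ≡ Full {a} ++ Full {m}
Full-++ zero = refl
Full-++ (suc a) = cong (true ∷_) (Full-++ a)

∣∷∣ : ∀ x (A : Subset n) → ∣ x ∷ A ∣ ≡ (if x then 1 else 0) + ∣ A ∣
∣∷∣ true A = refl
∣∷∣ false A = refl

subset-of-size : ∀ b l → l ≤ b → Σ (Subset b) λ A → ∣ A ∣ ≡ l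
subset-of-size zero zero _ = [] , refl
subset-of-size (suc b) zero _ with subset-of-size b zero z≤n
... | A , e = false ∷ A , e
subset-of-size (suc b) (suc l) (s≤s l≤b) with subset-of-size b l l≤b
... | A , e = true ∷ A , cong suc e

psum-zero : (v : Vec ℕ t) → psum v 0 ≡ 0
psum-zero [] = refl
psum-zero (x ∷ v) = refl

⪰-∷⇔ : ∀ x (u u′ : Vec ℕ t) → (x ∷ u) ⪰ (x ∷ u′) ⇔ u ⪰ u′
⪰-∷⇔ x u u′ = mk⇔ (λ d k k≥1 k≤t → +-cancelˡ-≤ x _ _ (d (suc k) (s≤s z≤n) (s≤s k≤t))) from′
  where
  from′ : u ⪰ u′ → (x ∷ u) ⪰ (x ∷ u′)
  from′ d (suc zero) _ _ rewrite psum-zero u | psum-zero u′ = ≤-refl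
  from′ d (suc (suc k)) _ (s≤s k≤t) = +-monoʳ-≤ x (d (suc k) (s≤s z≤n) k≤t)

vetoClasses : (a : ℕ) → (Fin m → Fin s) → Fin (a + m) → Fin (suc s)
vetoClasses zero c i = suc (c i)
vetoClasses (suc a) c zero = zero
vetoClasses (suc a) c (suc i) = vetoClasses a c i

countIn-vetoClasses-zero : ∀ a (c : Fin m → Fin s) (A : Subset a) (B : Subset m) →
  countIn (vetoClasses a c) (A ++ B) zero ≡ ∣ A ∣
countIn-vetoClasses-zero zero c [] B = countIn-absent (λ i → suc (c i)) B zero (λ i ())
countIn-vetoClasses-zero (suc a) c (x ∷ A) B =
  trans (countIn-∷ (vetoClasses (suc a) c) x (A ++ B) zero)
        (trans (cong ((if x then 1 else 0) +_) (countIn-vetoClasses-zero a c A B)) (sym (∣∷∣ x A)))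

countIn-vetoClasses-suc : ∀ a (c : Fin m → Fin s) (A : Subset a) (B : Subset m) (h : Fin s) →
  countIn (vetoClasses a c) (A ++ B) (suc h) ≡ countIn c B h
countIn-vetoClasses-suc zero c [] B h = countIn-injective suc suc-injective c B h
countIn-vetoClasses-suc (suc a) c (x ∷ A) B h =
  trans (countIn-∷-other (vetoClasses (suc a) c) x (A ++ B) (suc h) (λ ())) (countIn-vetoClasses-suc a c A B h)

win-addVetoes-Full : ∀ a (C : SimpleGame m) (B : Subset m) → win (addVetoes a C) (Full ++ B) ≡ win C B
win-addVetoes-Full zero C B = refl
win-addVetoes-Full (suc a) C B = win-addVetoes-Full a C B

win-addVetoes-lacking : ∀ a (C : SimpleGame m) (A : Subset a) (B : Subset m) → ∣ A ∣ < a →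
  win (addVetoes a C) (A ++ B) ≡ false
win-addVetoes-lacking (suc a) C (false ∷ A) B _ = refl
win-addVetoes-lacking (suc a) C (true ∷ A) B (s≤s lt) = win-addVetoes-lacking a C A B lt

module AddVetoesVectors (a : ℕ) (C : SimpleGame m) (c : Fin m → Fin s) where
  private
    G′ = addVetoes a C
    c′ = vetoClasses a c

  classSize-zero : classSize c′ zero ≡ a
  classSize-zero = trans (cong (λ S → countIn c′ S zero) (Full-++ a)) (trans (countIn-vetoClasses-zero a c Full Full) (∣⊤∣≡n a))

  classSize-suc : ∀ h → classSize c′ (suc h) ≡ classSize c h
  classSize-suc h = trans (cong (λ S → countIn c′ S (suc h)) (Full-++ a)) (countIn-vetoClasses-suc a c Full Full h)

  Realizes⇔ : ∀ k u A B → Realizes c′ (k ∷ u) (A ++ B) ⇔ (∣ A ∣ ≡ k × Realizes c u B)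
  Realizes⇔ k u A B = mk⇔
    (λ r → trans (sym (countIn-vetoClasses-zero a c A B)) (r zero) , λ h → trans (sym (countIn-vetoClasses-suc a c A B h)) (r (suc h)))
    λ { (e , r) zero → trans (countIn-vetoClasses-zero a c A B) e
      ; (e , r) (suc h) → trans (countIn-vetoClasses-suc a c A B h) (r h) }

  ValidVec⇔ : ∀ k u → ValidVec c′ (k ∷ u) ⇔ (k ≤ a × ValidVec c u)
  ValidVec⇔ k u = mk⇔
    (λ valid → subst (k ≤_) classSize-zero (valid zero) , λ h → subst (lookup u h ≤_) (classSize-suc h) (valid (suc h)))
    λ { (k≤a , valid) zero → subst (k ≤_) (sym classSize-zero) k≤a
      ; (k≤a , valid) (suc h) → subst (lookup u h ≤_) (sym (classSize-suc h)) (valid h) }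

  outcome⇔ : ∀ {b} u → (∀ S → Realizes c′ (a ∷ u) S → win G′ S ≡ b) ⇔ (∀ B → Realizes c u B → win C B ≡ b)
  outcome⇔ u = mk⇔
    (λ o B r → trans (sym (win-addVetoes-Full a C B)) (o (Full ++ B) (from (Realizes⇔ a u Full B) (∣⊤∣≡n a , r))))
    (λ o S r → outcome o S r (splitAt a S))
    where
    outcome : ∀ {b} → (∀ B → Realizes c u B → win C B ≡ b) → ∀ S → Realizes c′ (a ∷ u) S →
              (∃ λ A → ∃ λ B → S ≡ A ++ B) → win G′ S ≡ b
    outcome o S r (A , B , refl) with to (Realizes⇔ a u A B) r
    ... | ∣A∣≡a , rB = subst (λ A′ → win G′ (A′ ++ B) ≡ _) (sym (∣p∣≡n⇒p≡⊤ {p = A} ∣A∣≡a))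
                           (trans (win-addVetoes-Full a C B) (o B rB))

  WinningVec⇔ : ∀ u → WinningVec G′ c′ (a ∷ u) ⇔ WinningVec C c u
  WinningVec⇔ u = mk⇔ (λ (valid , o) → proj₂ (to (ValidVec⇔ a u) valid) , to (outcome⇔ u) o)
                      (λ (valid , o) → from (ValidVec⇔ a u) (≤-refl , valid) , from (outcome⇔ u) o)

  LosingVec⇔ : ∀ u → LosingVec G′ c′ (a ∷ u) ⇔ LosingVec C c u
  LosingVec⇔ u = mk⇔ (λ (valid , o) → proj₂ (to (ValidVec⇔ a u) valid) , to (outcome⇔ u) o)
                     (λ (valid , o) → from (ValidVec⇔ a u) (≤-refl , valid) , from (outcome⇔ u) o)

  LosingVec-short : ∀ k u → k < a → ValidVec c u → LosingVec G′ c′ (k ∷ u)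
  LosingVec-short k u k<a valid = from (ValidVec⇔ k u) (<⇒≤ k<a , valid) , λ S r → losing S r (splitAt a S)
    where
    losing : ∀ S → Realizes c′ (k ∷ u) S → (∃ λ A → ∃ λ B → S ≡ A ++ B) → win G′ S ≡ false
    losing S r (A , B , refl) = win-addVetoes-lacking a C A B (subst (_< a) (sym (proj₁ (to (Realizes⇔ k u A B) r))) k<a)

  ShiftMinWinning⇒ : ∀ k u → ShiftMinWinning G′ c′ (k ∷ u) → k ≡ a × ShiftMinWinning C c u
  ShiftMinWinning⇒ k u (w@(valid , _) , minimal) with to (ValidVec⇔ k u) valid
  ... | k≤a , valid-u with m≤n⇒m<n∨m≡n k≤a
  ...   | inj₁ k<a = contradiction (LosingVec-short k u k<a valid-u) (WinningVec⇒¬LosingVec {G = G′} {c′} {k ∷ u} w)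
  ...   | inj₂ refl = refl , to (WinningVec⇔ u) w , λ u′ valid′ (u⪰u′ , u≢u′) →
          to (LosingVec⇔ u′) (minimal (a ∷ u′) (from (ValidVec⇔ a u′) (≤-refl , valid′))
                                      (from (⪰-∷⇔ a u u′) u⪰u′ , λ e → u≢u′ (proj₂ (∷-injective e))))

  ShiftMinWinning⇐ : ∀ u → ShiftMinWinning C c u → ShiftMinWinning G′ c′ (a ∷ u)
  ShiftMinWinning⇐ u (w , minimal) = from (WinningVec⇔ u) w , λ { (k ∷ u′) valid′ ≻ → below k u′ valid′ ≻ }
    where
    below : ∀ k u′ → ValidVec c′ (k ∷ u′) → (a ∷ u) ≻ᵥ (k ∷ u′) → LosingVec G′ c′ (k ∷ u′)
    below k u′ valid′ (d , ≢) with to (ValidVec⇔ k u′) valid′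
    ... | k≤a , valid-u′ with m≤n⇒m<n∨m≡n k≤a
    ...   | inj₁ k<a = LosingVec-short k u′ k<a valid-u′
    ...   | inj₂ refl = from (LosingVec⇔ u′) (minimal u′ valid-u′ (to (⪰-∷⇔ a u u′) d , λ e → ≢ (cong (a ∷_) e)))

  ShiftMinWinning⇒image : ∀ v → ShiftMinWinning G′ c′ v → ∃ λ u → v ≡ a ∷ u × ShiftMinWinning C c u
  ShiftMinWinning⇒image (k ∷ u) smw with ShiftMinWinning⇒ k u smw
  ... | refl , smw′ = u , refl , smw′

  ExactlyShiftMin⇔ : ∀ r → ExactlyShiftMin G′ c′ r ⇔ ExactlyShiftMin C c r
  ExactlyShiftMin⇔ r = mk⇔
    (HasExactly-preimage (a ∷_) (λ e → proj₂ (∷-injective e)) ShiftMinWinning⇒image ShiftMinWinning⇐ tail (λ _ → refl))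
    (HasExactly-image (a ∷_) (λ e → proj₂ (∷-injective e)) ShiftMinWinning⇒image ShiftMinWinning⇐)

lookup-∷ʳ-inject₁ : (u : Vec ℕ s) (l : ℕ) (h : Fin s) → lookup (u ∷ʳ l) (inject₁ h) ≡ lookup u h
lookup-∷ʳ-inject₁ (x ∷ u) l zero = refl
lookup-∷ʳ-inject₁ (x ∷ u) l (suc h) = lookup-∷ʳ-inject₁ u l h

lookup-∷ʳ-fromℕ : (u : Vec ℕ s) (l : ℕ) → lookup (u ∷ʳ l) (fromℕ s) ≡ l
lookup-∷ʳ-fromℕ [] l = refl
lookup-∷ʳ-fromℕ (x ∷ u) l = lookup-∷ʳ-fromℕ u l

psum-∷ʳ : (u : Vec ℕ s) (l k : ℕ) → k ≤ s → psum (u ∷ʳ l) k ≡ psum u k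
psum-∷ʳ [] l zero _ = refl
psum-∷ʳ (x ∷ u) l zero _ = refl
psum-∷ʳ (x ∷ u) l (suc k) (s≤s k≤s) = cong (x +_) (psum-∷ʳ u l k k≤s)

psum-∷ʳ-all : (u : Vec ℕ s) (l : ℕ) → psum (u ∷ʳ l) (suc s) ≡ psum u s + l
psum-∷ʳ-all [] l = +-identityʳ l
psum-∷ʳ-all (x ∷ u) l = trans (cong (x +_) (psum-∷ʳ-all u l)) (sym (+-assoc x _ l))

psum-all-⪰ : (u u′ : Vec ℕ s) → u ⪰ u′ → psum u′ s ≤ psum u s
psum-all-⪰ [] [] _ = z≤n
psum-all-⪰ {suc s} u u′ d = d (suc s) (s≤s z≤n) ≤-refl

⪰-∷ʳ : (u u′ : Vec ℕ s) (l l′ : ℕ) → u ⪰ u′ → l′ ≤ l → (u ∷ʳ l) ⪰ (u′ ∷ʳ l′)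
⪰-∷ʳ {s} u u′ l l′ d l′≤l k k≥1 k≤1+s with m≤n⇒m<n∨m≡n k≤1+s
... | inj₁ (s≤s k≤s) = subst₂ _≤_ (sym (psum-∷ʳ u′ l′ k k≤s)) (sym (psum-∷ʳ u l k k≤s)) (d k k≥1 k≤s)
... | inj₂ refl = subst₂ _≤_ (sym (psum-∷ʳ-all u′ l′)) (sym (psum-∷ʳ-all u l)) (+-mono-≤ (psum-all-⪰ u u′ d) l′≤l)

⪰-∷ʳ⁻ : (u u′ : Vec ℕ s) (l l′ : ℕ) → (u ∷ʳ l) ⪰ (u′ ∷ʳ l′) → u ⪰ u′ × psum u′ s + l′ ≤ psum u s + l
⪰-∷ʳ⁻ {s} u u′ l l′ d =
  (λ k k≥1 k≤s → subst₂ _≤_ (psum-∷ʳ u′ l′ k k≤s) (psum-∷ʳ u l k k≤s) (d k k≥1 (m≤n⇒m≤1+n k≤s))) ,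
  subst₂ _≤_ (psum-∷ʳ-all u′ l′) (psum-∷ʳ-all u l) (d (suc s) (s≤s z≤n) ≤-refl)

nullClasses : (b : ℕ) → (Fin m → Fin s) → Fin (b + m) → Fin (suc s)
nullClasses zero c i = inject₁ (c i)
nullClasses {s = s} (suc b) c zero = fromℕ s
nullClasses (suc b) c (suc i) = nullClasses b c i

countIn-nullClasses-fromℕ : ∀ b (c : Fin m → Fin s) (A : Subset b) (B : Subset m) →
  countIn (nullClasses b c) (A ++ B) (fromℕ s) ≡ ∣ A ∣
countIn-nullClasses-fromℕ zero c [] B = countIn-absent _ B _ (λ i e → fromℕ≢inject₁ (sym e))
countIn-nullClasses-fromℕ {s = s} (suc b) c (x ∷ A) B = begin
  countIn (nullClasses (suc b) c) (x ∷ A ++ B) (fromℕ s)  ≡⟨ countIn-∷ (nullClasses (suc b) c) x (A ++ B) (fromℕ s) ⟩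
  contribution x (fromℕ s) (fromℕ s) + countIn (nullClasses b c) (A ++ B) (fromℕ s)
    ≡⟨ cong₂ _+_ (cong (λ e → if x then (if e then 1 else 0) else 0) (≡ᵇ-refl (fromℕ s))) (countIn-nullClasses-fromℕ b c A B) ⟩
  (if x then 1 else 0) + ∣ A ∣                               ≡⟨ ∣∷∣ x A ⟨
  ∣ x ∷ A ∣                                                  ∎
  where open ≡-Reasoning

countIn-nullClasses-inject₁ : ∀ b (c : Fin m → Fin s) (A : Subset b) (B : Subset m) (h : Fin s) →
  countIn (nullClasses b c) (A ++ B) (inject₁ h) ≡ countIn c B h
countIn-nullClasses-inject₁ zero c [] B h = countIn-injective inject₁ inject₁-injective c B h
countIn-nullClasses-inject₁ (suc b) c (x ∷ A) B h =
  trans (countIn-∷-other (nullClasses (suc b) c) x (A ++ B) (inject₁ h) fromℕ≢inject₁) (countIn-nullClasses-inject₁ b c A B h)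

win-addNulls : ∀ b (X : SimpleGame m) (A : Subset b) (B : Subset m) → win (addNulls b X) (A ++ B) ≡ win X B
win-addNulls zero X [] B = refl
win-addNulls (suc b) X (x ∷ A) B = win-addNulls b X A B

module AddNullsVectors (b : ℕ) (X : SimpleGame m) (c : Fin m → Fin s) where
  private
    G′ = addNulls b X
    c′ = nullClasses b c

  classSize-fromℕ : classSize c′ (fromℕ s) ≡ b
  classSize-fromℕ = trans (cong (λ S → countIn c′ S (fromℕ s)) (Full-++ b)) (trans (countIn-nullClasses-fromℕ b c Full Full) (∣⊤∣≡n b))

  classSize-inject₁ : ∀ h → classSize c′ (inject₁ h) ≡ classSize c h
  classSize-inject₁ h = trans (cong (λ S → countIn c′ S (inject₁ h)) (Full-++ b)) (countIn-nullClasses-inject₁ b c Full Full h)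

  Realizes⇔ : ∀ u l A B → Realizes c′ (u ∷ʳ l) (A ++ B) ⇔ (∣ A ∣ ≡ l × Realizes c u B)
  Realizes⇔ u l A B = mk⇔
    (λ r → trans (sym (countIn-nullClasses-fromℕ b c A B)) (trans (r (fromℕ s)) (lookup-∷ʳ-fromℕ u l)) ,
           λ h → trans (sym (countIn-nullClasses-inject₁ b c A B h)) (trans (r (inject₁ h)) (lookup-∷ʳ-inject₁ u l h)))
    (λ (e , r) h → realizes e r h (view h))
    where
    realizes : ∣ A ∣ ≡ l → Realizes c u B → ∀ h → View h → countIn c′ (A ++ B) h ≡ lookup (u ∷ʳ l) h
    realizes e r .(fromℕ s) ‵fromℕ = trans (countIn-nullClasses-fromℕ b c A B) (trans e (sym (lookup-∷ʳ-fromℕ u l)))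
    realizes e r .(inject₁ h) (‵inject₁ h) = trans (countIn-nullClasses-inject₁ b c A B h) (trans (r h) (sym (lookup-∷ʳ-inject₁ u l h)))

  ValidVec⇔ : ∀ u l → ValidVec c′ (u ∷ʳ l) ⇔ (l ≤ b × ValidVec c u)
  ValidVec⇔ u l = mk⇔
    (λ valid → subst₂ _≤_ (lookup-∷ʳ-fromℕ u l) classSize-fromℕ (valid (fromℕ s)) ,
               λ h → subst₂ _≤_ (lookup-∷ʳ-inject₁ u l h) (classSize-inject₁ h) (valid (inject₁ h)))
    (λ (l≤b , valid) h → valid′ l≤b valid h (view h))
    where
    valid′ : l ≤ b → ValidVec c u → ∀ h → View h → lookup (u ∷ʳ l) h ≤ classSize c′ h
    valid′ l≤b valid .(fromℕ s) ‵fromℕ = subst₂ _≤_ (sym (lookup-∷ʳ-fromℕ u l)) (sym classSize-fromℕ) l≤b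
    valid′ l≤b valid .(inject₁ h) (‵inject₁ h) = subst₂ _≤_ (sym (lookup-∷ʳ-inject₁ u l h)) (sym (classSize-inject₁ h)) (valid h)

  outcome⇔ : ∀ {β} u l → l ≤ b → (∀ S → Realizes c′ (u ∷ʳ l) S → win G′ S ≡ β) ⇔ (∀ B → Realizes c u B → win X B ≡ β)
  outcome⇔ u l l≤b = mk⇔
    (λ o B r → let (A , ∣A∣≡l) = subset-of-size b l l≤b in
               trans (sym (win-addNulls b X A B)) (o (A ++ B) (from (Realizes⇔ u l A B) (∣A∣≡l , r))))
    (λ o S r → outcome o S r (splitAt b S))
    where
    outcome : ∀ {β} → (∀ B → Realizes c u B → win X B ≡ β) → ∀ S → Realizes c′ (u ∷ʳ l) S →
              (∃ λ A → ∃ λ B → S ≡ A ++ B) → win G′ S ≡ β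
    outcome o S r (A , B , refl) = trans (win-addNulls b X A B) (o B (proj₂ (to (Realizes⇔ u l A B) r)))

  WinningVec⇔ : ∀ u l → WinningVec G′ c′ (u ∷ʳ l) ⇔ (l ≤ b × WinningVec X c u)
  WinningVec⇔ u l = mk⇔
    (λ (valid , o) → let (l≤b , valid-u) = to (ValidVec⇔ u l) valid in l≤b , valid-u , to (outcome⇔ u l l≤b) o)
    (λ (l≤b , valid , o) → from (ValidVec⇔ u l) (l≤b , valid) , from (outcome⇔ u l l≤b) o)

  LosingVec⇔ : ∀ u l → LosingVec G′ c′ (u ∷ʳ l) ⇔ (l ≤ b × LosingVec X c u)
  LosingVec⇔ u l = mk⇔
    (λ (valid , o) → let (l≤b , valid-u) = to (ValidVec⇔ u l) valid in l≤b , valid-u , to (outcome⇔ u l l≤b) o)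
    (λ (l≤b , valid , o) → from (ValidVec⇔ u l) (l≤b , valid) , from (outcome⇔ u l l≤b) o)

  ShiftMinWinning⇒ : ∀ u l → ShiftMinWinning G′ c′ (u ∷ʳ l) → l ≡ 0 × ShiftMinWinning X c u
  ShiftMinWinning⇒ u zero (w , minimal) = refl , proj₂ (to (WinningVec⇔ u 0) w) , λ u′ valid′ (d , ≢) →
    proj₂ (to (LosingVec⇔ u′ 0) (minimal (u′ ∷ʳ 0) (from (ValidVec⇔ u′ 0) (z≤n , valid′))
                                         (⪰-∷ʳ u u′ 0 0 d z≤n , λ e → ≢ (∷ʳ-injectiveˡ u u′ e))))
  -- A null player can be dropped from a winning vector, so shift-minimal ones contain none.
  ShiftMinWinning⇒ u (suc l) (w , minimal) =
    contradiction (minimal (u ∷ʳ l) (proj₁ w′) (⪰-∷ʳ u u (suc l) l (λ _ _ _ → ≤-refl) (n≤1+n l) , ≢))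
                  (WinningVec⇒¬LosingVec {G = G′} {c′} {u ∷ʳ l} w′)
    where
    w′ : WinningVec G′ c′ (u ∷ʳ l)
    w′ with to (WinningVec⇔ u (suc l)) w
    ... | 1+l≤b , wX = from (WinningVec⇔ u l) (<⇒≤ 1+l≤b , wX)
    ≢ : u ∷ʳ suc l ≢ u ∷ʳ l
    ≢ e = 1+n≢n (∷ʳ-injectiveʳ u u e)

  ShiftMinWinning⇐ : ∀ u → ShiftMinWinning X c u → ShiftMinWinning G′ c′ (u ∷ʳ 0)
  ShiftMinWinning⇐ u (w , minimal) = from (WinningVec⇔ u 0) (z≤n , w) , λ v valid ≻ → below v valid ≻ (initLast v)
    where
    below : ∀ v → ValidVec c′ v → (u ∷ʳ 0) ≻ᵥ v → (∃ λ u′ → ∃ λ l → v ≡ u′ ∷ʳ l) → LosingVec G′ c′ v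
    below v valid (d , ≢) (u′ , l , refl) with ⪰-∷ʳ⁻ u u′ 0 l d | to (ValidVec⇔ u′ l) valid | ≡-dec ℕ._≟_ u u′
    ... | u⪰u′ , total | l≤b , valid′ | no u≢u′ = from (LosingVec⇔ u′ l) (l≤b , minimal u′ valid′ (u⪰u′ , u≢u′))
    ... | u⪰u′ , total | l≤b , valid′ | yes refl =
          contradiction (cong (u ∷ʳ_) (sym (n≤0⇒n≡0 (+-cancelˡ-≤ (psum u s) l 0 total)))) ≢

  ShiftMinWinning⇒image : ∀ v → ShiftMinWinning G′ c′ v → ∃ λ u → v ≡ u ∷ʳ 0 × ShiftMinWinning X c u
  ShiftMinWinning⇒image v smw with initLast v
  ... | u , l , refl with ShiftMinWinning⇒ u l smw
  ...   | refl , smw′ = u , refl , smw′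

  ExactlyShiftMin⇔ : ∀ r → ExactlyShiftMin G′ c′ r ⇔ ExactlyShiftMin X c r
  ExactlyShiftMin⇔ r = mk⇔
    (HasExactly-preimage (_∷ʳ 0) (∷ʳ-injectiveˡ _ _) ShiftMinWinning⇒image ShiftMinWinning⇐ init (init-∷ʳ 0))
    (HasExactly-image (_∷ʳ 0) (∷ʳ-injectiveˡ _ _) ShiftMinWinning⇒image ShiftMinWinning⇐)

-- Desirability classes of extensions

vetoClasses-added : ∀ a (c : Fin m → Fin s) (k : Fin a) → vetoClasses a c (k ↑ˡ m) ≡ zero
vetoClasses-added (suc a) c zero = refl
vetoClasses-added (suc a) c (suc k) = vetoClasses-added a c k

vetoClasses-old : ∀ a (c : Fin m → Fin s) (j : Fin m) → vetoClasses a c (a ↑ʳ j) ≡ suc (c j)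
vetoClasses-old zero c j = refl
vetoClasses-old (suc a) c j = vetoClasses-old a c j

module AddVetoesClasses (a : ℕ) (C : SimpleGame m) (no-veto : ∀ j → ¬ IsVeto C j) where
  private
    G′ = addVetoes a C

  old-¬veto : ∀ j → ¬ IsVeto G′ (a ↑ʳ j)
  old-¬veto j v = no-veto j (to (IsVeto-addVetoes⇔ a C j) v)

  old-≈⇔ : ∀ i j → ((a ↑ʳ i) ≈[ G′ ] (a ↑ʳ j)) ⇔ (i ≈[ C ] j)
  old-≈⇔ i j = mk⇔ (λ (p , q) → to (≿-addVetoes⇔ a C i j) p , to (≿-addVetoes⇔ a C j i) q)
                   (λ (p , q) → from (≿-addVetoes⇔ a C i j) p , from (≿-addVetoes⇔ a C j i) q)

  added-≻-old : ∀ k j → (k ↑ˡ m) ≻[ G′ ] (a ↑ʳ j)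
  added-≻-old k j = IsVeto⇒≿ G′ _ _ (addVetoes-veto a C k) , IsVeto⇒⋡ G′ _ _ (addVetoes-veto a C k) (old-¬veto j)

  OrderedClasses-extend : (c : Fin m → Fin s) → Fin a → OrderedClasses C s c → OrderedClasses G′ (suc s) (vetoClasses a c)
  OrderedClasses-extend c k₀ (onto , same⇔≈ , <⇒≻) =
    onto′ , (λ i j → same⇔≈′ (split a i) (split a j)) , (λ i j → <⇒≻′ (split a i) (split a j))
    where
    c′ = vetoClasses a c
    onto′ : ∀ h → ∃ λ i → c′ i ≡ h
    onto′ zero = k₀ ↑ˡ m , vetoClasses-added a c k₀
    onto′ (suc h) with onto h
    ... | j , cj≡h = a ↑ʳ j , trans (vetoClasses-old a c j) (cong suc cj≡h)
    same⇔≈′ : ∀ {i j} → Split a i → Split a j → (c′ i ≡ c′ j) ⇔ (i ≈[ G′ ] j)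
    same⇔≈′ (added k) (added k′) = mk⇔ (λ _ → IsVeto⇒≈ G′ _ _ (addVetoes-veto a C k) (addVetoes-veto a C k′))
                                      (λ _ → trans (vetoClasses-added a c k) (sym (vetoClasses-added a c k′)))
    same⇔≈′ (added k) (old j) = mk⇔ (λ e → contradiction (trans (sym (vetoClasses-added a c k)) (trans e (vetoClasses-old a c j))) λ ())
                                   (λ (_ , j≿k) → contradiction j≿k (proj₂ (added-≻-old k j)))
    same⇔≈′ (old j) (added k) = mk⇔ (λ e → contradiction (trans (sym (vetoClasses-added a c k)) (trans (sym e) (vetoClasses-old a c j))) λ ())
                                   (λ (j≿k , _) → contradiction j≿k (proj₂ (added-≻-old k j)))
    same⇔≈′ (old i) (old j) = mk⇔
      (λ e → from (old-≈⇔ i j) (to (same⇔≈ i j) (suc-injective (trans (sym (vetoClasses-old a c i)) (trans e (vetoClasses-old a c j))))))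
      (λ i≈j → trans (vetoClasses-old a c i) (trans (cong suc (from (same⇔≈ i j) (to (old-≈⇔ i j) i≈j))) (sym (vetoClasses-old a c j))))
    <⇒≻′ : ∀ {i j} → Split a i → Split a j → c′ i <ᶠ c′ j → i ≻[ G′ ] j
    <⇒≻′ (added k) (added k′) lt = contradiction (subst₂ _<ᶠ_ (vetoClasses-added a c k) (vetoClasses-added a c k′) lt) λ ()
    <⇒≻′ (added k) (old j) _ = added-≻-old k j
    <⇒≻′ (old j) (added k) lt = contradiction (subst₂ _<ᶠ_ (vetoClasses-old a c j) (vetoClasses-added a c k) lt) λ ()
    <⇒≻′ (old i) (old j) lt with <⇒≻ i j (s<s⁻¹ (subst₂ _<ᶠ_ (vetoClasses-old a c i) (vetoClasses-old a c j) lt))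
    ... | i≿j , j⋡i = from (≿-addVetoes⇔ a C i j) i≿j , λ j≿i → j⋡i (to (≿-addVetoes⇔ a C j i) j≿i)

  module Restrict (c″ : Fin (a + m) → Fin (suc t)) (k₀ : Fin a) (ordered : OrderedClasses G′ (suc t) c″) where
    private
      onto = proj₁ ordered
      same⇔≈ = proj₁ (proj₂ ordered)
      <⇒≻ = proj₂ (proj₂ ordered)

    added-top : ∀ k → c″ (k ↑ˡ m) ≡ zero
    added-top k with c″ (k ↑ˡ m) ≟ zero
    ... | yes e = e
    ... | no ne with onto zero
    ...   | p , cp≡0 = contradiction (IsVeto⇒≿ G′ _ p (addVetoes-veto a C k))
                                     (proj₂ (<⇒≻ p (k ↑ˡ m) (subst (_<ᶠ c″ (k ↑ˡ m)) (sym cp≡0) (nonzero-pos ne))))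
      where
      nonzero-pos : ∀ {n} {x : Fin (suc n)} → x ≢ zero → zero {n} <ᶠ x
      nonzero-pos {x = zero} ne = contradiction refl ne
      nonzero-pos {x = suc x} _ = s≤s z≤n

    old-below : ∀ j → zero ≢ c″ (a ↑ʳ j)
    old-below j e = IsVeto⇒⋡ G′ _ _ (addVetoes-veto a C k₀) (old-¬veto j)
                      (proj₁ (to (same⇔≈ (a ↑ʳ j) (k₀ ↑ˡ m)) (trans (sym e) (sym (added-top k₀)))))

    restricted : Fin m → Fin t
    restricted j = punchOut (old-below j)

    suc-restricted : ∀ j → suc (restricted j) ≡ c″ (a ↑ʳ j)
    suc-restricted j = punchIn-punchOut (old-below j)

    c″≗vetoClasses : ∀ i → c″ i ≡ vetoClasses a restricted i
    c″≗vetoClasses i with split a i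
    ... | added k = trans (added-top k) (sym (vetoClasses-added a restricted k))
    ... | old j = trans (sym (suc-restricted j)) (sym (vetoClasses-old a restricted j))

    OrderedClasses-restrict : OrderedClasses C t restricted
    OrderedClasses-restrict = onto′ , same⇔≈′ , <⇒≻′
      where
      onto′ : ∀ h → ∃ λ j → restricted j ≡ h
      onto′ h with onto (suc h)
      ... | p , cp≡h with split a p
      ...   | added k = contradiction (trans (sym (added-top k)) cp≡h) λ ()
      ...   | old j = j , suc-injective (trans (suc-restricted j) cp≡h)
      same⇔≈′ : ∀ i j → (restricted i ≡ restricted j) ⇔ (i ≈[ C ] j)
      same⇔≈′ i j = mk⇔
        (λ e → to (old-≈⇔ i j) (to (same⇔≈ _ _) (trans (sym (suc-restricted i)) (trans (cong suc e) (suc-restricted j)))))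
        (λ i≈j → suc-injective (trans (suc-restricted i) (trans (from (same⇔≈ _ _) (from (old-≈⇔ i j) i≈j)) (sym (suc-restricted j)))))
      <⇒≻′ : ∀ i j → restricted i <ᶠ restricted j → i ≻[ C ] j
      <⇒≻′ i j lt with <⇒≻ _ _ (subst₂ _<ᶠ_ (suc-restricted i) (suc-restricted j) (s≤s lt))
      ... | i≿j , j⋡i = to (≿-addVetoes⇔ a C i j) i≿j , λ j≿i → j⋡i (from (≿-addVetoes⇔ a C j i) j≿i)

nullClasses-added : ∀ b (c : Fin m → Fin s) (k : Fin b) → nullClasses b c (k ↑ˡ m) ≡ fromℕ s
nullClasses-added (suc b) c zero = refl
nullClasses-added (suc b) c (suc k) = nullClasses-added b c k

nullClasses-old : ∀ b (c : Fin m → Fin s) (j : Fin m) → nullClasses b c (b ↑ʳ j) ≡ inject₁ (c j)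
nullClasses-old zero c j = refl
nullClasses-old (suc b) c j = nullClasses-old b c j

inject₁<fromℕ : (x : Fin s) → inject₁ x <ᶠ fromℕ s
inject₁<fromℕ {s} x = subst₂ ℕ._<_ (sym (toℕ-inject₁ x)) (sym (toℕ-fromℕ s)) (toℕ<n x)

fromℕ≮ : (x : Fin (suc s)) → ¬ (fromℕ s <ᶠ x)
fromℕ≮ x lt = <⇒≱ lt (≤fromℕ x)

inject₁-<⇔ : (x y : Fin s) → (inject₁ x <ᶠ inject₁ y) ⇔ (x <ᶠ y)
inject₁-<⇔ x y = mk⇔ (subst₂ ℕ._<_ (toℕ-inject₁ x) (toℕ-inject₁ y)) (subst₂ ℕ._<_ (sym (toℕ-inject₁ x)) (sym (toℕ-inject₁ y)))

lower : (x : Fin (suc t)) → x ≢ fromℕ t → Fin t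
lower x x≢top with view x
... | ‵fromℕ = contradiction refl x≢top
... | ‵inject₁ y = y

inject₁-lower : (x : Fin (suc t)) (x≢top : x ≢ fromℕ t) → inject₁ (lower x x≢top) ≡ x
inject₁-lower x x≢top with view x
... | ‵fromℕ = contradiction refl x≢top
... | ‵inject₁ y = refl

module AddNullsClasses (b : ℕ) (X : SimpleGame m) (pivotal : ∀ j → Pivotal X j) where
  private
    G′ = addNulls b X

  old-≈⇔ : ∀ i j → ((b ↑ʳ i) ≈[ G′ ] (b ↑ʳ j)) ⇔ (i ≈[ X ] j)
  old-≈⇔ i j = mk⇔ (λ (p , q) → to (≿-addNulls⇔ b X i j) p , to (≿-addNulls⇔ b X j i) q)
                   (λ (p , q) → from (≿-addNulls⇔ b X i j) p , from (≿-addNulls⇔ b X j i) q)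

  old-≻-added : ∀ j k → (b ↑ʳ j) ≻[ G′ ] (k ↑ˡ m)
  old-≻-added j k = IsDummy⇒≾ G′ _ _ (addNulls-dummy b X k) ,
                    IsDummy⇒⋡ G′ _ _ (addNulls-dummy b X k) (Pivotal-addNulls b X j (pivotal j))

  OrderedClasses-extend : (c : Fin m → Fin s) → Fin b → OrderedClasses X s c → OrderedClasses G′ (suc s) (nullClasses b c)
  OrderedClasses-extend {s} c k₀ (onto , same⇔≈ , <⇒≻) =
    onto′ , (λ i j → same⇔≈′ (split b i) (split b j)) , (λ i j → <⇒≻′ (split b i) (split b j))
    where
    c′ = nullClasses b c
    onto′ : ∀ h → ∃ λ i → c′ i ≡ h
    onto′ h with view h
    ... | ‵fromℕ = k₀ ↑ˡ m , nullClasses-added b c k₀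
    ... | ‵inject₁ h′ with onto h′
    ...   | j , cj≡h′ = b ↑ʳ j , trans (nullClasses-old b c j) (cong inject₁ cj≡h′)
    same⇔≈′ : ∀ {i j} → Split b i → Split b j → (c′ i ≡ c′ j) ⇔ (i ≈[ G′ ] j)
    same⇔≈′ (added k) (added k′) = mk⇔ (λ _ → IsDummy⇒≈ G′ _ _ (addNulls-dummy b X k) (addNulls-dummy b X k′))
                                      (λ _ → trans (nullClasses-added b c k) (sym (nullClasses-added b c k′)))
    same⇔≈′ (added k) (old j) = mk⇔ (λ e → contradiction (trans (sym (nullClasses-added b c k)) (trans e (nullClasses-old b c j))) fromℕ≢inject₁)
                                   (λ (k≿j , _) → contradiction k≿j (proj₂ (old-≻-added j k)))
    same⇔≈′ (old j) (added k) = mk⇔ (λ e → contradiction (trans (sym (nullClasses-added b c k)) (trans (sym e) (nullClasses-old b c j))) fromℕ≢inject₁)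
                                   (λ (_ , k≿j) → contradiction k≿j (proj₂ (old-≻-added j k)))
    same⇔≈′ (old i) (old j) = mk⇔
      (λ e → from (old-≈⇔ i j) (to (same⇔≈ i j) (inject₁-injective (trans (sym (nullClasses-old b c i)) (trans e (nullClasses-old b c j))))))
      (λ i≈j → trans (nullClasses-old b c i) (trans (cong inject₁ (from (same⇔≈ i j) (to (old-≈⇔ i j) i≈j))) (sym (nullClasses-old b c j))))
    <⇒≻′ : ∀ {i j} → Split b i → Split b j → c′ i <ᶠ c′ j → i ≻[ G′ ] j
    <⇒≻′ {j = j} (added k) _ lt = contradiction (subst (_<ᶠ c′ j) (nullClasses-added b c k) lt) (fromℕ≮ (c′ j))
    <⇒≻′ (old j) (added k) _ = old-≻-added j k
    <⇒≻′ (old i) (old j) lt with <⇒≻ i j (to (inject₁-<⇔ (c i) (c j)) (subst₂ _<ᶠ_ (nullClasses-old b c i) (nullClasses-old b c j) lt))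
    ... | i≿j , j⋡i = from (≿-addNulls⇔ b X i j) i≿j , λ j≿i → j⋡i (to (≿-addNulls⇔ b X j i) j≿i)

  module Restrict (c″ : Fin (b + m) → Fin (suc t)) (k₀ : Fin b) (ordered : OrderedClasses G′ (suc t) c″) where
    private
      onto = proj₁ ordered
      same⇔≈ = proj₁ (proj₂ ordered)
      <⇒≻ = proj₂ (proj₂ ordered)

    added-bottom : ∀ k → c″ (k ↑ˡ m) ≡ fromℕ t
    added-bottom k with c″ (k ↑ˡ m) ≟ fromℕ t
    ... | yes e = e
    ... | no ne with onto (fromℕ t)
    ...   | p , cp≡top = contradiction (IsDummy⇒≾ G′ p _ (addNulls-dummy b X k))
                                       (proj₂ (<⇒≻ (k ↑ˡ m) p (subst (c″ (k ↑ˡ m) <ᶠ_) (sym cp≡top) (below-top ne))))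
      where
      below-top : ∀ {x : Fin (suc t)} → x ≢ fromℕ t → x <ᶠ fromℕ t
      below-top {x} x≢top = subst (_<ᶠ fromℕ t) (inject₁-lower x x≢top) (inject₁<fromℕ (lower x x≢top))

    old-above : ∀ j → c″ (b ↑ʳ j) ≢ fromℕ t
    old-above j e = IsDummy⇒⋡ G′ _ _ (addNulls-dummy b X k₀) (Pivotal-addNulls b X j (pivotal j))
                      (proj₂ (to (same⇔≈ (b ↑ʳ j) (k₀ ↑ˡ m)) (trans e (sym (added-bottom k₀)))))

    restricted : Fin m → Fin t
    restricted j = lower (c″ (b ↑ʳ j)) (old-above j)

    inject₁-restricted : ∀ j → inject₁ (restricted j) ≡ c″ (b ↑ʳ j)
    inject₁-restricted j = inject₁-lower _ (old-above j)

    c″≗nullClasses : ∀ i → c″ i ≡ nullClasses b restricted i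
    c″≗nullClasses i with split b i
    ... | added k = trans (added-bottom k) (sym (nullClasses-added b restricted k))
    ... | old j = trans (sym (inject₁-restricted j)) (sym (nullClasses-old b restricted j))

    OrderedClasses-restrict : OrderedClasses X t restricted
    OrderedClasses-restrict = onto′ , same⇔≈′ , <⇒≻′
      where
      onto′ : ∀ h → ∃ λ j → restricted j ≡ h
      onto′ h with onto (inject₁ h)
      ... | p , cp≡h with split b p
      ...   | added k = contradiction (trans (sym (added-bottom k)) cp≡h) fromℕ≢inject₁
      ...   | old j = j , inject₁-injective (trans (inject₁-restricted j) cp≡h)
      same⇔≈′ : ∀ i j → (restricted i ≡ restricted j) ⇔ (i ≈[ X ] j)
      same⇔≈′ i j = mk⇔
        (λ e → to (old-≈⇔ i j) (to (same⇔≈ _ _) (trans (sym (inject₁-restricted i)) (trans (cong inject₁ e) (inject₁-restricted j)))))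
        (λ i≈j → inject₁-injective (trans (inject₁-restricted i) (trans (from (same⇔≈ _ _) (from (old-≈⇔ i j) i≈j)) (sym (inject₁-restricted j)))))
      <⇒≻′ : ∀ i j → restricted i <ᶠ restricted j → i ≻[ X ] j
      <⇒≻′ i j lt with <⇒≻ _ _ (subst₂ _<ᶠ_ (inject₁-restricted i) (inject₁-restricted j) (from (inject₁-<⇔ _ _) lt))
      ... | i≿j , j⋡i = to (≿-addNulls⇔ b X i j) i≿j , λ j≿i → j⋡i (from (≿-addNulls⇔ b X j i) j≿i)

sgn : ℕ → ℕ
sgn zero = 0
sgn (suc _) = 1

HasTR-addVetoes : ∀ a (C : SimpleGame m) → (∀ j → ¬ IsVeto C j) → HasTR C s r → HasTR (addVetoes a C) (sgn a + s) r
HasTR-addVetoes zero C _ hasTR = hasTR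
HasTR-addVetoes (suc a) C no-veto (c , ordered , exact) =
  vetoClasses (suc a) c ,
  AddVetoesClasses.OrderedClasses-extend (suc a) C no-veto c zero ordered ,
  from (AddVetoesVectors.ExactlyShiftMin⇔ (suc a) C c _) exact

HasTR-addVetoes⁻ : ∀ a (C : SimpleGame m) → (∀ j → ¬ IsVeto C j) → HasTR (addVetoes a C) t r →
  ∃ λ s → t ≡ sgn a + s × HasTR C s r
HasTR-addVetoes⁻ zero C _ hasTR = _ , refl , hasTR
HasTR-addVetoes⁻ {t = zero} (suc a) C _ (c″ , _) with c″ zero
... | ()
HasTR-addVetoes⁻ {t = suc t} (suc a) C no-veto (c″ , ordered , exact) =
  t , refl , restricted , OrderedClasses-restrict ,
  to (AddVetoesVectors.ExactlyShiftMin⇔ (suc a) C restricted _)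
     (ExactlyShiftMin-cong {G = addVetoes (suc a) C} c″ _ c″≗vetoClasses _ exact)
  where open AddVetoesClasses.Restrict (suc a) C no-veto c″ zero ordered

HasTR-addNulls : ∀ b (X : SimpleGame m) → (∀ j → Pivotal X j) → HasTR X s r → HasTR (addNulls b X) (sgn b + s) r
HasTR-addNulls zero X _ hasTR = hasTR
HasTR-addNulls (suc b) X pivotal (c , ordered , exact) =
  nullClasses (suc b) c ,
  AddNullsClasses.OrderedClasses-extend (suc b) X pivotal c zero ordered ,
  from (AddNullsVectors.ExactlyShiftMin⇔ (suc b) X c _) exact

HasTR-addNulls⁻ : ∀ b (X : SimpleGame m) → (∀ j → Pivotal X j) → HasTR (addNulls b X) t r →
  ∃ λ s → t ≡ sgn b + s × HasTR X s r
HasTR-addNulls⁻ zero X _ hasTR = _ , refl , hasTR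
HasTR-addNulls⁻ {t = zero} (suc b) X _ (c″ , _) with c″ zero
... | ()
HasTR-addNulls⁻ {t = suc t} (suc b) X pivotal (c″ , ordered , exact) =
  t , refl , restricted , OrderedClasses-restrict ,
  to (AddNullsVectors.ExactlyShiftMin⇔ (suc b) X restricted _)
     (ExactlyShiftMin-cong {G = addNulls (suc b) X} c″ _ c″≗nullClasses _ exact)
  where open AddNullsClasses.Restrict (suc b) X pivotal c″ zero ordered

-- Unanimity games

AllVeto : SimpleGame n → Set
AllVeto G = ∀ i → IsVeto G i

unanimity : (a : ℕ) → SimpleGame (a + 1)
unanimity a = addVetoes a dictator

unanimity-AllVeto : ∀ a → AllVeto (unanimity a)
unanimity-AllVeto a i with split a i
... | added k = addVetoes-veto a dictator k
... | old zero = from (IsVeto-addVetoes⇔ a dictator zero) (Full-i-losing⇒IsVeto dictator zero refl)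

missing-player : (S : Subset n) → ∣ S ∣ < n → ∃ λ i → lookup S i ≡ false
missing-player (false ∷ S) _ = zero , refl
missing-player (true ∷ S) (s≤s lt) with missing-player S lt
... | i , e = suc i , e

countIn-one-class : (S : Subset n) → countIn (λ _ → zero {0}) S zero ≡ ∣ S ∣
countIn-one-class [] = refl
countIn-one-class (x ∷ S) = trans (countIn-∷ (λ _ → zero) x S zero) (trans (cong (_ +_) (countIn-one-class S)) (sym (∣∷∣ x S)))

HasExactly-≡⇒1 : {A : Set} {y : A} {r : ℕ} → HasExactly (_≡ y) r → r ≡ 1
HasExactly-≡⇒1 {y = y} ([] , _ , _ , mem) = contradiction (from (mem y) refl) λ ()
HasExactly-≡⇒1 (x ∷ [] , _ , len , _) = sym len
HasExactly-≡⇒1 (x ∷ x′ ∷ _ , (x≢x′ ∷ _) ∷ _ , _ , mem) =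
  contradiction (trans (to (mem x) (here refl)) (sym (to (mem x′) (there (here refl))))) x≢x′

module AllVetoGame (G : SimpleGame n) (all-veto : AllVeto G) where

  c₀ : Fin n → Fin 1
  c₀ _ = zero

  small-losing : ∀ S → ∣ S ∣ < n → win G S ≡ false
  small-losing S lt with missing-player S lt
  ... | i , i∉S = veto-absent-losing G i (all-veto i) S i∉S

  winning-size : ∀ S → win G S ≡ true → ∣ S ∣ ≡ n
  winning-size S w with m≤n⇒m<n∨m≡n (∣p∣≤n S)
  ... | inj₁ lt = contradiction (small-losing S lt) (not-¬ w)
  ... | inj₂ e = e

  Realizes-size : ∀ k S → Realizes c₀ (k ∷ []) S → ∣ S ∣ ≡ k
  Realizes-size k S r = trans (sym (countIn-one-class S)) (r zero)

  ShiftMinWinning⇒ : ∀ v → ShiftMinWinning G c₀ v → v ≡ n ∷ []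
  ShiftMinWinning⇒ (k ∷ []) ((valid , w) , _) with realizing-coalition c₀ (k ∷ []) valid
  ... | S , r = cong (_∷ []) (trans (sym (Realizes-size k S r)) (winning-size S (w S r)))

  ShiftMinWinning-n : ShiftMinWinning G c₀ (n ∷ [])
  ShiftMinWinning-n =
    (valid , λ S r → subst (λ T → win G T ≡ true) (sym (∣p∣≡n⇒p≡⊤ (Realizes-size n S r))) (fullWin G)) , below
    where
    valid : ValidVec c₀ (n ∷ [])
    valid zero = subst (n ≤_) (sym (trans (countIn-one-class (Full {n})) (∣⊤∣≡n n))) ≤-refl
    below : ∀ v → ValidVec c₀ v → (n ∷ []) ≻ᵥ v → LosingVec G c₀ v
    below (k ∷ []) valid′ (d , ≢) = valid′ , λ S r → small-losing S (subst (_< n) (sym (Realizes-size k S r)) k<n)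
      where
      k≤n : k ≤ n
      k≤n = subst₂ _≤_ (+-identityʳ k) (+-identityʳ n) (d 1 (s≤s z≤n) (s≤s z≤n))
      k<n : k < n
      k<n with m≤n⇒m<n∨m≡n k≤n
      ... | inj₁ lt = lt
      ... | inj₂ refl = contradiction refl ≢

  ShiftMinWinning⇔ : ∀ v → ShiftMinWinning G c₀ v ⇔ (v ≡ n ∷ [])
  ShiftMinWinning⇔ v = mk⇔ (ShiftMinWinning⇒ v) λ { refl → ShiftMinWinning-n }

  HasTR-AllVeto : 1 ≤ n → HasTR G 1 1
  HasTR-AllVeto (s≤s _) = c₀ , ordered , HasExactly-⇔ (λ v → ⇔.sym (ShiftMinWinning⇔ v))
    ((n ∷ []) ∷ [] , [] ∷ [] , refl , λ v → mk⇔ (λ { (here e) → e ; (there ()) }) here)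
    where
    ordered : OrderedClasses G 1 c₀
    ordered = (λ { zero → zero , refl }) ,
              (λ i j → mk⇔ (λ _ → IsVeto⇒≈ G i j (all-veto i) (all-veto j)) (λ _ → refl)) , λ i j ()

  HasTR-AllVeto⁻ : 1 ≤ n → HasTR G t r → t ≡ 1 × r ≡ 1
  HasTR-AllVeto⁻ {t = zero} (s≤s _) (c , _) with c zero
  ... | ()
  HasTR-AllVeto⁻ {t = suc zero} {r} (s≤s _) (c , _ , exact) =
    refl , HasExactly-≡⇒1 (HasExactly-⇔ ShiftMinWinning⇔ (ExactlyShiftMin-cong {G = G} c c₀ one-class r exact))
    where
    one-class : ∀ i → c i ≡ c₀ i
    one-class i with c i
    ... | zero = refl
  HasTR-AllVeto⁻ {t = suc (suc t)} (s≤s _) (c , (onto , same⇔≈ , _) , _) =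
    contradiction (trans (sym (proj₂ (onto zero))) (trans same (proj₂ (onto (suc zero))))) λ ()
    where
    same : c (proj₁ (onto zero)) ≡ c (proj₁ (onto (suc zero)))
    same = from (same⇔≈ _ _) (IsVeto⇒≈ G _ _ (all-veto _) (all-veto _))

-- Weights of extensions

+-cancelʳ-≤ : ∀ {p q} r → p ℚ.+ r ℚ.≤ q ℚ.+ r → p ℚ.≤ q
+-cancelʳ-≤ {p} {q} r le = subst₂ ℚ._≤_ (+-r-r p) (+-r-r q) (ℚₚ.+-monoˡ-≤ (ℚ.- r) le)
  where
  +-r-r : ∀ x → (x ℚ.+ r) ℚ.+ (ℚ.- r) ≡ x
  +-r-r x = trans (ℚₚ.+-assoc x r (ℚ.- r)) (trans (cong (x ℚ.+_) (ℚₚ.+-inverseʳ r)) (ℚₚ.+-identityʳ x))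

≤-+⇔-≤ : ∀ (q p r : ℚ) → (q ℚ.≤ p ℚ.+ r) ⇔ (q ℚ.+ (ℚ.- p) ℚ.≤ r)
≤-+⇔-≤ q p r = mk⇔ (λ le → subst (q ℚ.+ (ℚ.- p) ℚ.≤_) p+r-p≡r (ℚₚ.+-monoˡ-≤ (ℚ.- p) le))
                   (λ le → +-cancelʳ-≤ (ℚ.- p) (subst (q ℚ.+ (ℚ.- p) ℚ.≤_) (sym p+r-p≡r) le))
  where
  p+r-p≡r : (p ℚ.+ r) ℚ.+ (ℚ.- p) ≡ r
  p+r-p≡r = trans (cong (ℚ._+ (ℚ.- p)) (ℚₚ.+-comm p r))
    (trans (ℚₚ.+-assoc r p (ℚ.- p)) (trans (cong (r ℚ.+_) (ℚₚ.+-inverseʳ p)) (ℚₚ.+-identityʳ r)))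

weightOf-nonneg : (w : Fin n → ℚ) → (∀ i → 0ℚ ℚ.≤ w i) → ∀ S → 0ℚ ℚ.≤ weightOf w S
weightOf-nonneg {zero} w w≥0 [] = ℚₚ.≤-refl
weightOf-nonneg {suc n} w w≥0 (x ∷ S) =
  subst₂ ℚ._≤_ (ℚₚ.+-identityˡ 0ℚ) (sym (weightOf-∷ w x S))
    (ℚₚ.+-mono-≤ (share≥0 x) (weightOf-nonneg (λ i → w (suc i)) (λ i → w≥0 (suc i)) S))
  where
  share≥0 : ∀ x → 0ℚ ℚ.≤ (if x then w zero else 0ℚ)
  share≥0 true = w≥0 zero
  share≥0 false = ℚₚ.≤-refl

weightOf-≤-Full : (w : Fin n → ℚ) → (∀ i → 0ℚ ℚ.≤ w i) → ∀ S → weightOf w S ℚ.≤ weightOf w Full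
weightOf-≤-Full {zero} w w≥0 [] = ℚₚ.≤-refl
weightOf-≤-Full {suc n} w w≥0 (x ∷ S) =
  subst₂ ℚ._≤_ (sym (weightOf-∷ w x S)) (sym (weightOf-∷ w true Full))
    (ℚₚ.+-mono-≤ (share≤ x) (weightOf-≤-Full (λ i → w (suc i)) (λ i → w≥0 (suc i)) S))
  where
  share≤ : ∀ x → (if x then w zero else 0ℚ) ℚ.≤ w zero
  share≤ true = ℚₚ.≤-refl
  share≤ false = w≥0 zero

weightOf-∅ : (w : Fin n → ℚ) → weightOf w ∅ ≡ 0ℚ
weightOf-∅ {zero} w = refl
weightOf-∅ {suc n} w = trans (weightOf-∷ w false ∅) (trans (ℚₚ.+-identityˡ _) (weightOf-∅ (λ i → w (suc i))))

Weighted-addVeto : (G : SimpleGame n) → Weighted G → Weighted (addVeto G)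
Weighted-addVeto {n} G (w , q , w≥0 , q>0 , win⇔) = w′ , q ℚ.+ total , w′≥0 , q+total>0 , win⇔′
  where
  total = weightOf w Full
  w′ : Fin (suc n) → ℚ
  w′ zero = total
  w′ (suc i) = w i
  w′≥0 : ∀ i → 0ℚ ℚ.≤ w′ i
  w′≥0 zero = weightOf-nonneg w w≥0 Full
  w′≥0 (suc i) = w≥0 i
  q+total>0 : 0ℚ ℚ.< q ℚ.+ total
  q+total>0 = subst (ℚ._< q ℚ.+ total) (ℚₚ.+-identityʳ 0ℚ) (ℚₚ.+-mono-<-≤ q>0 (weightOf-nonneg w w≥0 Full))
  win⇔′ : ∀ S → Winning (addVeto G) S ⇔ (q ℚ.+ total ℚ.≤ weightOf w′ S)
  win⇔′ (true ∷ S) = mk⇔ (λ wS → subst (q ℚ.+ total ℚ.≤_) (sym weight) (ℚₚ.+-monoˡ-≤ total (to (win⇔ S) wS)))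
                         (λ le → from (win⇔ S) (+-cancelʳ-≤ total (subst (q ℚ.+ total ℚ.≤_) weight le)))
    where
    weight : weightOf w′ (true ∷ S) ≡ weightOf w S ℚ.+ total
    weight = trans (weightOf-∷ w′ true S) (ℚₚ.+-comm total _)
  win⇔′ (false ∷ S) = mk⇔ (λ ())
    (λ le → contradiction (ℚₚ.<-≤-trans q>0 (+-cancelʳ-≤ total (ℚₚ.≤-trans le at-most-total))) (ℚₚ.<-irrefl refl))
    where
    at-most-total : weightOf w′ (false ∷ S) ℚ.≤ 0ℚ ℚ.+ total
    at-most-total = subst (ℚ._≤ 0ℚ ℚ.+ total) (sym (weightOf-∷ w′ false S)) (ℚₚ.+-monoʳ-≤ 0ℚ (weightOf-≤-Full w w≥0 S))

Weighted-addVeto⁻ : (G : SimpleGame n) → Weighted (addVeto G) → Weighted G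
Weighted-addVeto⁻ G (w , q , w≥0 , q>0 , win⇔) = w′ , q ℚ.+ (ℚ.- w zero) , (λ i → w≥0 (suc i)) , quota>0 , win⇔′
  where
  w′ = λ i → w (suc i)
  quota>0 : 0ℚ ℚ.< q ℚ.+ (ℚ.- w zero)
  quota>0 = subst (ℚ._< q ℚ.+ (ℚ.- w zero)) (ℚₚ.+-inverseʳ (w zero)) (ℚₚ.+-monoˡ-< (ℚ.- w zero) (ℚₚ.≰⇒> veto-alone-losing))
    where
    veto-alone : weightOf w (true ∷ ∅) ≡ w zero
    veto-alone = trans (weightOf-∷ w true ∅) (trans (cong (w zero ℚ.+_) (weightOf-∅ w′)) (ℚₚ.+-identityʳ _))
    veto-alone-losing : ¬ (q ℚ.≤ w zero)
    veto-alone-losing le = not-¬ (from (win⇔ (true ∷ ∅)) (subst (q ℚ.≤_) (sym veto-alone) le)) (emptyLose G)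
  win⇔′ : ∀ S → Winning G S ⇔ (q ℚ.+ (ℚ.- w zero) ℚ.≤ weightOf w′ S)
  win⇔′ S = mk⇔ (λ wS → to (≤-+⇔-≤ q (w zero) _) (subst (q ℚ.≤_) (weightOf-∷ w true S) (to (win⇔ (true ∷ S)) wS)))
                (λ le → from (win⇔ (true ∷ S)) (subst (q ℚ.≤_) (sym (weightOf-∷ w true S)) (from (≤-+⇔-≤ q (w zero) _) le)))

Weighted-addNull : (G : SimpleGame n) → Weighted G → Weighted (addNull G)
Weighted-addNull {n} G (w , q , w≥0 , q>0 , win⇔) = w′ , q , w′≥0 , q>0 , win⇔′
  where
  w′ : Fin (suc n) → ℚ
  w′ zero = 0ℚ
  w′ (suc i) = w i
  w′≥0 : ∀ i → 0ℚ ℚ.≤ w′ i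
  w′≥0 zero = ℚₚ.≤-refl
  w′≥0 (suc i) = w≥0 i
  weight : ∀ x S → weightOf w′ (x ∷ S) ≡ weightOf w S
  weight true S = trans (weightOf-∷ w′ true S) (ℚₚ.+-identityˡ _)
  weight false S = trans (weightOf-∷ w′ false S) (ℚₚ.+-identityˡ _)
  win⇔′ : ∀ S → Winning (addNull G) S ⇔ (q ℚ.≤ weightOf w′ S)
  win⇔′ (x ∷ S) = subst (λ v → Winning G S ⇔ (q ℚ.≤ v)) (sym (weight x S)) (win⇔ S)

Weighted-addNull⁻ : (G : SimpleGame n) → Weighted (addNull G) → Weighted G
Weighted-addNull⁻ G (w , q , w≥0 , q>0 , win⇔) = (λ i → w (suc i)) , q , (λ i → w≥0 (suc i)) , q>0 , win⇔′
  where
  win⇔′ : ∀ S → Winning G S ⇔ (q ℚ.≤ weightOf (λ i → w (suc i)) S)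
  win⇔′ S = subst (λ v → Winning G S ⇔ (q ℚ.≤ v)) (trans (weightOf-∷ w false S) (ℚₚ.+-identityˡ _)) (win⇔ (false ∷ S))

Weighted-dictator : Weighted dictator
Weighted-dictator = (λ _ → 1ℚ) , 1ℚ , (λ _ → ℚₚ.<⇒≤ (ℚₚ.positive⁻¹ 1ℚ)) , ℚₚ.positive⁻¹ 1ℚ , win⇔
  where
  win⇔ : ∀ S → Winning dictator S ⇔ (1ℚ ℚ.≤ weightOf (λ _ → 1ℚ) S)
  win⇔ (true ∷ []) = mk⇔ (λ _ → ℚₚ.≤-refl) (λ _ → refl)
  win⇔ (false ∷ []) = mk⇔ (λ ()) (λ le → contradiction (ℚₚ.<-≤-trans (ℚₚ.positive⁻¹ 1ℚ) le) (ℚₚ.<-irrefl refl))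

Weighted-addVetoes : ∀ a (G : SimpleGame m) → Weighted G → Weighted (addVetoes a G)
Weighted-addVetoes zero G wt = wt
Weighted-addVetoes (suc a) G wt = Weighted-addVeto (addVetoes a G) (Weighted-addVetoes a G wt)

Weighted-addVetoes⁻ : ∀ a (G : SimpleGame m) → Weighted (addVetoes a G) → Weighted G
Weighted-addVetoes⁻ zero G wt = wt
Weighted-addVetoes⁻ (suc a) G wt = Weighted-addVetoes⁻ a G (Weighted-addVeto⁻ (addVetoes a G) wt)

Weighted-addNulls : ∀ b (G : SimpleGame m) → Weighted G → Weighted (addNulls b G)
Weighted-addNulls zero G wt = wt
Weighted-addNulls (suc b) G wt = Weighted-addNull (addNulls b G) (Weighted-addNulls b G wt)

Weighted-addNulls⁻ : ∀ b (G : SimpleGame m) → Weighted (addNulls b G) → Weighted G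
Weighted-addNulls⁻ zero G wt = wt
Weighted-addNulls⁻ (suc b) G wt = Weighted-addNulls⁻ b G (Weighted-addNull⁻ (addNulls b G) wt)

-- Rigidity of extensions

castGame : m ≡ n → SimpleGame m → SimpleGame n
castGame refl G = G

HIso : SimpleGame m → SimpleGame n → Set
HIso {m} {n} G H = Σ (m ≡ n) λ p → Iso (castGame p G) H

Iso-cast⇒HIso : (e : m ≡ n) (e′ : k ≡ n) (G : SimpleGame m) (H : SimpleGame k) → Iso (castGame e G) (castGame e′ H) → HIso G H
Iso-cast⇒HIso refl refl G H I = refl , I

Iso-castGame : (e : m ≡ n) {G H : SimpleGame m} → Iso G H → Iso (castGame e G) (castGame e H)
Iso-castGame refl I = I

HIso⇒Iso : {G H : SimpleGame m} → HIso G H → Iso G H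
HIso⇒Iso (refl , I) = I

no-game-on-∅ : SimpleGame 0 → ⊥
no-game-on-∅ G = not-¬ (fullWin G) (emptyLose G)

NonTrivial⇒Pivotal : {G : SimpleGame n} → NonTrivial G → ∀ j → Pivotal G j
NonTrivial⇒Pivotal {G = G} nt j = ¬IsNull⇒Pivotal G j (proj₂ (nt j))

addNull-HIso-cancel : {G : SimpleGame m} {H : SimpleGame n} → HIso (addNull G) (addNull H) → HIso G H
addNull-HIso-cancel {G = G} {H} (refl , I) = refl , addNull-cancel {G = G} {H} I

addVeto-HIso-cancel : {G : SimpleGame m} {H : SimpleGame n} → HIso (addVeto G) (addVeto H) → HIso G H
addVeto-HIso-cancel {G = G} {H} (refl , I) = refl , addVeto-cancel {G = G} {H} I

HIso-sym : {G : SimpleGame m} {H : SimpleGame n} → HIso G H → HIso H G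
HIso-sym {G = G} {H} (refl , I) = refl , Iso-sym {G = G} {H} I

all-pivotal-¬HIso-addNull : {G : SimpleGame m} {H : SimpleGame n} → (∀ j → Pivotal G j) → ¬ HIso G (addNull H)
all-pivotal-¬HIso-addNull {G = G} {H} pivotal (refl , I) =
  Pivotal⇒¬IsDummy G _ (pivotal _) (Iso-IsDummy {G = addNull H} {G} (Iso-sym {G = G} {addNull H} I) zero (addNull-dummy H))

no-veto-¬HIso-addVeto : {G : SimpleGame m} {H : SimpleGame n} → (∀ j → ¬ IsVeto G j) → ¬ HIso G (addVeto H)
no-veto-¬HIso-addVeto {G = G} {H} no-veto (refl , I) =
  no-veto _ (Iso-IsVeto {G = addVeto H} {G} (Iso-sym {G = G} {addVeto H} I) zero (addVeto-veto H))

addNulls-rigid : ∀ b b′ {G : SimpleGame m} {H : SimpleGame n} → (∀ j → Pivotal G j) → (∀ j → Pivotal H j) →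
  HIso (addNulls b G) (addNulls b′ H) → b ≡ b′ × HIso G H
addNulls-rigid zero zero _ _ I = refl , I
addNulls-rigid zero (suc b′) {G} {H} pivotal _ I = contradiction I (all-pivotal-¬HIso-addNull {G = G} {addNulls b′ H} pivotal)
addNulls-rigid (suc b) zero {G} {H} _ pivotal I =
  contradiction (HIso-sym {G = addNulls (suc b) G} {H} I) (all-pivotal-¬HIso-addNull {G = H} {addNulls b G} pivotal)
addNulls-rigid (suc b) (suc b′) {G} {H} pG pH I with addNulls-rigid b b′ pG pH (addNull-HIso-cancel {G = addNulls b G} {addNulls b′ H} I)
... | refl , J = refl , J

addVetoes-rigid : ∀ a a′ {G : SimpleGame m} {H : SimpleGame n} → (∀ j → ¬ IsVeto G j) → (∀ j → ¬ IsVeto H j) →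
  HIso (addVetoes a G) (addVetoes a′ H) → a ≡ a′ × HIso G H
addVetoes-rigid zero zero _ _ I = refl , I
addVetoes-rigid zero (suc a′) {G} {H} no-veto _ I = contradiction I (no-veto-¬HIso-addVeto {G = G} {addVetoes a′ H} no-veto)
addVetoes-rigid (suc a) zero {G} {H} _ no-veto I =
  contradiction (HIso-sym {G = addVetoes (suc a) G} {H} I) (no-veto-¬HIso-addVeto {G = H} {addVetoes a G} no-veto)
addVetoes-rigid (suc a) (suc a′) {G} {H} vG vH I with addVetoes-rigid a a′ vG vH (addVeto-HIso-cancel {G = addVetoes a G} {addVetoes a′ H} I)
... | refl , J = refl , J

extend : (a b : ℕ) → SimpleGame m → SimpleGame (b + (a + m))
extend a b C = addNulls b (addVetoes a C)

Pivotal-addVetoes-all : ∀ a (G : SimpleGame m) → (∀ j → Pivotal G j) → ∀ i → Pivotal (addVetoes a G) i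
Pivotal-addVetoes-all a G pivotal i with split a i
... | added k = IsVeto⇒Pivotal (addVetoes a G) _ (addVetoes-veto a G k)
... | old j = Pivotal-addVetoes a G j (pivotal j)

AllVeto-Iso : {G H : SimpleGame n} → Iso G H → AllVeto G → AllVeto H
AllVeto-Iso {G = G} {H} I all-veto i = subst (IsVeto H) (inverseʳ (proj₁ I)) (Iso-IsVeto {G = G} {H} I _ (all-veto _))

unanimity-pivotal : ∀ a i → Pivotal (unanimity a) i
unanimity-pivotal a i = IsVeto⇒Pivotal (unanimity a) i (unanimity-AllVeto a i)

HIso-AllVeto : {G : SimpleGame m} {H : SimpleGame n} → HIso G H → AllVeto H → AllVeto G
HIso-AllVeto {G = G} {H} (refl , I) = AllVeto-Iso {G = H} {G} (Iso-sym {G = G} {H} I)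

extend-rigid : ∀ a b a′ b′ {C : SimpleGame m} {C′ : SimpleGame n} → NonTrivial C → NonTrivial C′ →
  HIso (extend a b C) (extend a′ b′ C′) → a ≡ a′ × b ≡ b′ × HIso C C′
extend-rigid a b a′ b′ {C} {C′} nt nt′ I
  with addNulls-rigid b b′ (Pivotal-addVetoes-all a C (NonTrivial⇒Pivotal {G = C} nt))
                           (Pivotal-addVetoes-all a′ C′ (NonTrivial⇒Pivotal {G = C′} nt′)) I
... | refl , J with addVetoes-rigid a a′ (λ j → proj₁ (nt j)) (λ j → proj₁ (nt′ j)) J
...   | refl , K = refl , refl , K

extend-¬HIso-unanimity : ∀ a b a′ b′ {C : SimpleGame m} → NonTrivial C → ¬ HIso (extend a b C) (extend a′ b′ dictator)
extend-¬HIso-unanimity {zero} a b a′ b′ {C} _ _ = no-game-on-∅ C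
extend-¬HIso-unanimity {suc m} a b a′ b′ {C} nt I
  with addNulls-rigid b b′ (Pivotal-addVetoes-all a C (NonTrivial⇒Pivotal {G = C} nt)) (unanimity-pivotal a′) I
... | _ , J = proj₁ (nt zero) (to (IsVeto-addVetoes⇔ a C zero)
                (HIso-AllVeto {G = addVetoes a C} {unanimity a′} J (unanimity-AllVeto a′) (a ↑ʳ zero)))

unanimity-rigid : ∀ a b a′ b′ → HIso (extend a b dictator) (extend a′ b′ dictator) → b ≡ b′
unanimity-rigid a b a′ b′ I = proj₁ (addNulls-rigid b b′ (unanimity-pivotal a) (unanimity-pivotal a′) I)

-- Decomposition of a game into a core and added players

shrink : SimpleGame n → List (Fin n) → Subset n → Subset n
shrink G [] S = S
shrink G (j ∷ js) S = if win G (S - j) then shrink G js (S - j) else shrink G js S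

record Shrunk (G : SimpleGame n) (js : List (Fin n)) (S R : Subset n) : Set where
  field
    winning : Winning G R
    ⊆-original : ∀ k → lookup R k ≡ true → lookup S k ≡ true
    minimal-on : ∀ j → j ∈ₗ js → lookup R j ≡ true → win G (R - j) ≡ false

shrink-Shrunk : (G : SimpleGame n) (js : List (Fin n)) (S : Subset n) → Winning G S → Shrunk G js S (shrink G js S)
shrink-Shrunk G [] S w = record { winning = w ; ⊆-original = λ _ p → p ; minimal-on = λ _ () }
shrink-Shrunk G (j ∷ js) S w with win G (S - j) in e
... | true = record
  { winning = winning
  ; ⊆-original = λ k p → remove-⊆ S j k (⊆-original k p)
  ; minimal-on = λ { j′ (here refl) p → contradiction (trans (sym (⊆-original j′ p)) (lookup-remove-self S j′)) λ ()
                   ; j′ (there j′∈) p → minimal-on j′ j′∈ p } }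
  where open Shrunk (shrink-Shrunk G js (S - j) e)
... | false = record
  { winning = winning
  ; ⊆-original = ⊆-original
  ; minimal-on = λ { j′ (here refl) p → losing-mono G _ (S - j′) (minus-mono {shrink G js S} ⊆-original) e
                   ; j′ (there j′∈) p → minimal-on j′ j′∈ p } }
  where
  open Shrunk (shrink-Shrunk G js S w)
  minus-mono : ∀ {R} → (∀ k → lookup R k ≡ true → lookup S k ≡ true) → ∀ k → lookup (R - j) k ≡ true → lookup (S - j) k ≡ true
  minus-mono {R} R⊆S k p rewrite lookup-remove R j k | lookup-remove S j k with k ≡ᵇ j
  ... | false = R⊆S k p

-- Shrinking a coalition T with T winning and T - i losing to a minimal winning one keeps i.
Pivotal⇒¬IsNull : (G : SimpleGame n) (i : Fin n) → Pivotal G i → ¬ IsNull G i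
Pivotal⇒¬IsNull {n} G i (T , wT , lT) null =
  null R (winning , λ j j∈R → minimal-on j (∈-allFin j) ([]=⇒lookup j∈R)) (lookup⇒[]= i R i∈R)
  where
  R = shrink G (allFin n) T
  open Shrunk (shrink-Shrunk G (allFin n) T wT)
  i∈R : lookup R i ≡ true
  i∈R = ¬-not λ i∉R → not-¬ winning (losing-mono G R (T - i) (R⊆T-i i∉R) lT)
    where
    R⊆T-i : lookup R i ≡ false → ∀ k → lookup R k ≡ true → lookup (T - i) k ≡ true
    R⊆T-i i∉R k p rewrite lookup-remove T i k with k ≡ᵇ i in k≡i
    ... | true rewrite ≡ᵇ⇒≡ k i k≡i = contradiction (trans (sym p) i∉R) λ ()
    ... | false = ⊆-original k p

IsVeto? : (G : SimpleGame n) (i : Fin n) → Dec (IsVeto G i)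
IsVeto? G i with win G (Full - i) in e
... | false = yes (Full-i-losing⇒IsVeto G i e)
... | true = no λ v → not-¬ e (IsVeto⇒Full-i-losing G i v)

removeNull : (G : SimpleGame (suc n)) → IsDummy G zero → SimpleGame n
removeNull G d = record
  { win = λ S → win G (false ∷ S)
  ; emptyLose = emptyLose G
  ; fullWin = trans (cong (λ S → win G (false ∷ S)) (sym (p─⊥≡p Full))) (d Full (fullWin G))
  ; monotone = λ S T S⊆T → monotone G (false ∷ S) (false ∷ T) λ { (there p) → there (S⊆T p) }
  }

Iso-addNull-removeNull : (G : SimpleGame (suc n)) (d : IsDummy G zero) → Iso G (addNull (removeNull G d))
Iso-addNull-removeNull G d = ≗⇒Iso G (addNull (removeNull G d)) λ
  { (true ∷ S) → sym (trans (dummy-invisible G zero d (true ∷ S)) (cong (λ T → win G (false ∷ T)) (p─⊥≡p S)))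
  ; (false ∷ S) → refl }

removeVeto : (G : SimpleGame (suc n)) → win G (true ∷ ∅) ≡ false → SimpleGame n
removeVeto G alone-losing = record
  { win = λ S → win G (true ∷ S)
  ; emptyLose = alone-losing
  ; fullWin = fullWin G
  ; monotone = λ S T S⊆T → monotone G (true ∷ S) (true ∷ T) λ { here → here ; (there p) → there (S⊆T p) }
  }

Iso-addVeto-removeVeto : (G : SimpleGame (suc n)) → IsVeto G zero → (alone-losing : win G (true ∷ ∅) ≡ false) →
  Iso G (addVeto (removeVeto G alone-losing))
Iso-addVeto-removeVeto G v alone-losing = ≗⇒Iso G (addVeto (removeVeto G alone-losing)) λ
  { (true ∷ S) → refl
  ; (false ∷ S) → sym (veto-absent-losing G zero v (false ∷ S) refl) }

addNull-cast : (e : m ≡ n) (G : SimpleGame m) → addNull (castGame e G) ≡ castGame (cong suc e) (addNull G)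
addNull-cast refl G = refl

addVeto-cast : (e : m ≡ n) (G : SimpleGame m) → addVeto (castGame e G) ≡ castGame (cong suc e) (addVeto G)
addVeto-cast refl G = refl

swap-to-zero : SimpleGame (suc n) → Fin (suc n) → SimpleGame (suc n)
swap-to-zero G i = permute (transpose i zero) G

Iso-swap-to-zero : (G : SimpleGame (suc n)) (i : Fin (suc n)) → Iso G (swap-to-zero G i)
Iso-swap-to-zero G i = Iso-permute (transpose i zero) G

IsDummy-swap-to-zero : (G : SimpleGame (suc n)) (i : Fin (suc n)) → IsDummy G i → IsDummy (swap-to-zero G i) zero
IsDummy-swap-to-zero G i d =
  subst (IsDummy (swap-to-zero G i)) (transpose-i i zero) (Iso-IsDummy {G = G} {swap-to-zero G i} (Iso-swap-to-zero G i) i d)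

IsVeto-swap-to-zero : (G : SimpleGame (suc n)) (i : Fin (suc n)) → IsVeto G i → IsVeto (swap-to-zero G i) zero
IsVeto-swap-to-zero G i v =
  subst (IsVeto (swap-to-zero G i)) (transpose-i i zero) (Iso-IsVeto {G = G} {swap-to-zero G i} (Iso-swap-to-zero G i) i v)

data NullsRemoved (G : SimpleGame n) : Set where
  nullsRemoved : ∀ b {m} (X : SimpleGame m) (e : b + m ≡ n) → (∀ j → Pivotal X j) →
                 Iso G (castGame e (addNulls b X)) → NullsRemoved G

NullsRemoved-Iso : {G H : SimpleGame n} → Iso G H → NullsRemoved H → NullsRemoved G
NullsRemoved-Iso {G = G} {H} I (nullsRemoved b X e pivotal J) =
  nullsRemoved b X e pivotal (Iso-trans {G = G} {H} {castGame e (addNulls b X)} I J)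

NullsRemoved-addNull : {G : SimpleGame n} → NullsRemoved G → NullsRemoved (addNull G)
NullsRemoved-addNull {G = G} (nullsRemoved b X e pivotal I) = nullsRemoved (suc b) X (cong suc e) pivotal
  (subst (Iso (addNull G)) (addNull-cast e (addNulls b X)) (addNull-cong {G = G} {castGame e (addNulls b X)} I))

remove-nulls : (G : SimpleGame n) → NullsRemoved G
remove-nulls {zero} G = contradiction G no-game-on-∅
remove-nulls {suc n} G with any? (IsDummy? G)
... | no ¬dummy = nullsRemoved 0 G refl (λ j → ¬IsDummy⇒Pivotal G j (λ d → ¬dummy (j , d))) (Iso-refl G)
... | yes (i , d) = NullsRemoved-Iso {G = G} {addNull G₀}
  (Iso-trans {G = G} {G′} {addNull G₀} (Iso-swap-to-zero G i) (Iso-addNull-removeNull G′ d₀))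
  (NullsRemoved-addNull (remove-nulls G₀))
  where
  G′ = swap-to-zero G i
  d₀ = IsDummy-swap-to-zero G i d
  G₀ = removeNull G′ d₀

-- If the veto player 0 wins alone, every other player is a dummy.
veto-alone-winning⇒dictator : (G : SimpleGame (suc n)) → IsVeto G zero → win G (true ∷ ∅) ≡ true → (∀ j → Pivotal G j) →
  Σ (0 + 1 ≡ suc n) λ e → Iso G (castGame e (unanimity 0))
veto-alone-winning⇒dictator {zero} G v alone _ =
  refl , ≗⇒Iso G dictator λ { (true ∷ []) → sym alone ; (false ∷ []) → sym (veto-absent-losing G zero v (false ∷ []) refl) }
veto-alone-winning⇒dictator {suc n} G v alone pivotal = contradiction dummy (Pivotal⇒¬IsDummy G (suc zero) (pivotal (suc zero)))
  where
  dummy : IsDummy G (suc zero)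
  dummy S w = win-mono G (true ∷ ∅) _ alone⊆S-1 alone
    where
    alone⊆S-1 : ∀ k → lookup (true ∷ ∅) k ≡ true → lookup (S - suc zero) k ≡ true
    alone⊆S-1 zero _ = trans (lookup-remove S (suc zero) zero) ([]=⇒lookup (v S w))
    alone⊆S-1 (suc k) p = contradiction (trans (sym p) (lookup-replicate k false)) λ ()

data VetoesRemoved (G : SimpleGame n) : Set where
  coreReached : ∀ a {m} (C : SimpleGame m) (e : a + m ≡ n) → (∀ j → ¬ IsVeto C j) → (∀ j → Pivotal C j) →
                Iso G (castGame e (addVetoes a C)) → VetoesRemoved G
  unanimous : ∀ a (e : a + 1 ≡ n) → Iso G (castGame e (unanimity a)) → VetoesRemoved G

VetoesRemoved-Iso : {G H : SimpleGame n} → Iso G H → VetoesRemoved H → VetoesRemoved G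
VetoesRemoved-Iso {G = G} {H} I (coreReached a C e no-veto pivotal J) =
  coreReached a C e no-veto pivotal (Iso-trans {G = G} {H} {castGame e (addVetoes a C)} I J)
VetoesRemoved-Iso {G = G} {H} I (unanimous a e J) = unanimous a e (Iso-trans {G = G} {H} {castGame e (unanimity a)} I J)

VetoesRemoved-addVeto : {G : SimpleGame n} → VetoesRemoved G → VetoesRemoved (addVeto G)
VetoesRemoved-addVeto {G = G} (coreReached a C e no-veto pivotal I) = coreReached (suc a) C (cong suc e) no-veto pivotal
  (subst (Iso (addVeto G)) (addVeto-cast e (addVetoes a C)) (addVeto-cong {G = G} {castGame e (addVetoes a C)} I))
VetoesRemoved-addVeto {G = G} (unanimous a e I) = unanimous (suc a) (cong suc e)
  (subst (Iso (addVeto G)) (addVeto-cast e (unanimity a)) (addVeto-cong {G = G} {castGame e (unanimity a)} I))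

mutual
  remove-vetoes : (G : SimpleGame n) → (∀ j → Pivotal G j) → VetoesRemoved G
  remove-vetoes {zero} G _ = contradiction G no-game-on-∅
  remove-vetoes {suc n} G pivotal with any? (IsVeto? G)
  ... | no ¬veto = coreReached 0 G refl (λ j v → ¬veto (j , v)) pivotal (Iso-refl G)
  ... | yes (i , v) = VetoesRemoved-Iso {G = G} {swap-to-zero G i} (Iso-swap-to-zero G i)
    (remove-vetoes-at-zero (swap-to-zero G i) (IsVeto-swap-to-zero G i v)
      (Iso-all-Pivotal {G = G} {swap-to-zero G i} (Iso-swap-to-zero G i) pivotal))

  remove-vetoes-at-zero : (G : SimpleGame (suc n)) → IsVeto G zero → (∀ j → Pivotal G j) → VetoesRemoved G
  remove-vetoes-at-zero G v pivotal with win G (true ∷ ∅) in alone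
  ... | true with veto-alone-winning⇒dictator G v alone pivotal
  ...   | e , I = unanimous 0 e I
  remove-vetoes-at-zero G v pivotal | false =
    VetoesRemoved-Iso {G = G} {addVeto G₀} (Iso-addVeto-removeVeto G v alone) (VetoesRemoved-addVeto (remove-vetoes G₀ pivotal₀))
    where
    G₀ = removeVeto G alone
    pivotal₀ : ∀ j → Pivotal G₀ j
    pivotal₀ j with pivotal (suc j)
    ... | true ∷ T , w , l = T , w , l
    ... | false ∷ T , w , l = contradiction w (not-¬ (veto-absent-losing G zero v (false ∷ T) refl))

data Decomposition (G : SimpleGame n) : Set where
  nontrivialCore : ∀ a b {m} (C : SimpleGame m) (e : b + (a + m) ≡ n) → NonTrivial C →
                   Iso G (castGame e (extend a b C)) → Decomposition G
  unanimityCore : ∀ a b (e : b + (a + 1) ≡ n) → Iso G (castGame e (extend a b dictator)) → Decomposition G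

Iso-addNulls-cast : ∀ b {k m} {G : SimpleGame n} {X : SimpleGame k} {Y : SimpleGame m} (e₁ : b + k ≡ n) (e₂ : m ≡ k) →
  Iso G (castGame e₁ (addNulls b X)) → Iso X (castGame e₂ Y) → Iso G (castGame (trans (cong (b +_) e₂) e₁) (addNulls b Y))
Iso-addNulls-cast b {G = G} {X} {Y} refl refl I J = Iso-trans {G = G} {addNulls b X} {addNulls b Y} I (addNulls-cong b {X} {Y} J)

decompose : (G : SimpleGame n) → Decomposition G
decompose G with remove-nulls G
... | nullsRemoved b X e₁ pivotalX I₁ with remove-vetoes X pivotalX
...   | coreReached a C e₂ no-veto pivotal I₂ =
        nontrivialCore a b C (trans (cong (b +_) e₂) e₁) (λ j → no-veto j , Pivotal⇒¬IsNull C j (pivotal j))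
          (Iso-addNulls-cast b {G = G} {X} {addVetoes a C} e₁ e₂ I₁ I₂)
...   | unanimous a e₂ I₂ =
        unanimityCore a b (trans (cong (b +_) e₂) e₁) (Iso-addNulls-cast b {G = G} {X} {unanimity a} e₁ e₂ I₁ I₂)

-- Counting up to isomorphism

IsoCount-∅ : {P : SimpleGame n → Set} → (∀ G → ¬ P G) → IsoCount P 0
IsoCount-∅ ¬P = [] , refl , [] , [] , λ G p → contradiction p (¬P G)

IsoCount-single : {P : SimpleGame n → Set} (G₀ : SimpleGame n) → P G₀ → (∀ G → P G → Iso G G₀) → IsoCount P 1
IsoCount-single G₀ p₀ unique = G₀ ∷ [] , refl , p₀ ∷ [] , [] ∷ [] , λ G p → here (unique G p)

IsoCount-⇔ : {P Q : SimpleGame n → Set} → (∀ G → P G ⇔ Q G) → IsoCount P k → IsoCount Q k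
IsoCount-⇔ P⇔Q (L , len , all , distinct , cover) =
  L , len , All.map (to (P⇔Q _)) all , distinct , λ G q → cover G (from (P⇔Q G) q)

IsoCount-⊎ : {P Q : SimpleGame n → Set} → (∀ {G H} → P G → Q H → ¬ Iso G H) →
  IsoCount P k → IsoCount Q l → IsoCount (λ G → P G ⊎ Q G) (k + l)
IsoCount-⊎ P≁Q (L , lenL , allL , distinctL , coverL) (M , lenM , allM , distinctM , coverM) =
  L List.++ M , trans (length-++ L) (cong₂ _+_ lenL lenM) ,
  All.++⁺ (All.map inj₁ allL) (All.map inj₂ allM) ,
  AllPairs.++⁺ distinctL distinctM (All.map (λ p → All.map (P≁Q p) allM) allL) ,
  λ G → [ (λ p → Any.++⁺ˡ (coverL G p)) , (λ q → Any.++⁺ʳ L (coverM G q)) ]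

AllPairs-map : {A B : Set} {P : A → Set} {R : A → A → Set} {S : B → B → Set} (f : A → B) {xs : List A} →
  (∀ {x y} → P x → P y → R x y → S (f x) (f y)) → All P xs → AllPairs R xs → AllPairs S (map f xs)
AllPairs-map f h [] [] = []
AllPairs-map f h (px ∷ pxs) (rx ∷ rxs) = All.map⁺ (All.zipWith (λ (py , r) → h px py r) (pxs , rx)) ∷ AllPairs-map f h pxs rxs

module _ {P : SimpleGame m → Set} (F : SimpleGame m → SimpleGame n)
         (F-cong : ∀ {X Y} → Iso X Y → Iso (F X) (F Y)) (F-reflects : ∀ {X Y} → P X → P Y → Iso (F X) (F Y) → Iso X Y) where

  IsoCount-image : IsoCount P k → IsoCount (λ G → ∃ λ X → P X × Iso G (F X)) k
  IsoCount-image (L , len , all , distinct , cover) =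
    map F L , trans (length-map F L) len ,
    All.map⁺ (All.map (λ {X} p → X , p , Iso-refl (F X)) all) ,
    AllPairs-map F (λ p q ≁ I → ≁ (F-reflects p q I)) all distinct ,
    λ { G (X , p , I) → Any.map⁺ (Any.map (λ {Y} J → Iso-trans {G = G} {F X} {F Y} I (F-cong J)) (cover X p)) }

sumTo-const : ∀ k x → sumTo k (λ _ → x) ≡ k * x
sumTo-const zero x = refl
sumTo-const (suc k) x = trans (cong (_+ x) (sumTo-const k x)) (+-comm (k * x) x)

IsoCount-sumTo : (Q : ℕ → SimpleGame n → Set) → (∀ {h h′ G H} → h ≢ h′ → Q h G → Q h′ H → ¬ Iso G H) →
  (c : ℕ → ℕ) → ∀ k → (∀ h → 1 ≤ h → h ≤ k → IsoCount (Q h) (c h)) →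
  IsoCount (λ G → ∃ λ h → 1 ≤ h × h ≤ k × Q h G) (sumTo k c)
IsoCount-sumTo Q Q≁ c zero _ = IsoCount-∅ λ { G (h , 1≤h , h≤0 , _) → contradiction (≤-trans 1≤h h≤0) λ () }
IsoCount-sumTo Q Q≁ c (suc k) counts = IsoCount-⇔ last-or-earlier
  (IsoCount-⊎ disjoint (IsoCount-sumTo Q Q≁ c k (λ h 1≤h h≤k → counts h 1≤h (m≤n⇒m≤1+n h≤k))) (counts (suc k) (s≤s z≤n) ≤-refl))
  where
  disjoint : ∀ {G H} → (∃ λ h → 1 ≤ h × h ≤ k × Q h G) → Q (suc k) H → ¬ Iso G H
  disjoint (h , _ , h≤k , q) q′ = Q≁ (λ { refl → <-irrefl refl h≤k }) q q′
  last-or-earlier : ∀ G → ((∃ λ h → 1 ≤ h × h ≤ k × Q h G) ⊎ Q (suc k) G) ⇔ (∃ λ h → 1 ≤ h × h ≤ suc k × Q h G)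
  last-or-earlier G = mk⇔ [ (λ (h , 1≤h , h≤k , q) → h , 1≤h , m≤n⇒m≤1+n h≤k , q) , (λ q → suc k , s≤s z≤n , ≤-refl , q) ]
                (λ (h , 1≤h , h≤1+k , q) → by-cases h 1≤h q (m≤n⇒m<n∨m≡n h≤1+k))
    where
    by-cases : ∀ h → 1 ≤ h → Q h G → h < suc k ⊎ h ≡ suc k → (∃ λ h → 1 ≤ h × h ≤ k × Q h G) ⊎ Q (suc k) G
    by-cases h 1≤h q (inj₁ (s≤s h≤k)) = inj₁ (h , 1≤h , h≤k , q)
    by-cases h _ q (inj₂ refl) = inj₂ q

-- Classification of weighted games by their cores

HasTR⇒1≤classes : {G : SimpleGame n} → HasTR G t r → 1 ≤ t
HasTR⇒1≤classes {zero} {G = G} _ = contradiction G no-game-on-∅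
HasTR⇒1≤classes {suc n} {zero} (c , _) with c zero
... | ()
HasTR⇒1≤classes {suc n} {suc t} _ = s≤s z≤n

HasTR⇒classes≤players : {G : SimpleGame n} → HasTR G t r → t ≤ n
HasTR⇒classes≤players {n} {t} (c , (onto , _ , _) , _) with t ≤? n
... | yes t≤n = t≤n
... | no t≰n with pigeonhole (≰⇒> t≰n) (λ h → proj₁ (onto h))
...   | h , h′ , h<h′ , same =
  contradiction (cong toℕ (trans (sym (proj₂ (onto h))) (trans (cong c same) (proj₂ (onto h′))))) (λ e → <-irrefl e h<h′)

WG-cast : (e : m ≡ n) (G : SimpleGame m) → WG m t r G ⇔ WG n t r (castGame e G)
WG-cast refl G = mk⇔ (λ w → w) (λ w → w)

WG-extend : ∀ a b {C : SimpleGame m} → WGhat m s r C → WG (b + (a + m)) (sgn b + (sgn a + s)) r (extend a b C)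
WG-extend a b {C} ((weighted , hasTR) , nt) =
  Weighted-addNulls b (addVetoes a C) (Weighted-addVetoes a C weighted) ,
  HasTR-addNulls b (addVetoes a C) (Pivotal-addVetoes-all a C (NonTrivial⇒Pivotal {G = C} nt))
    (HasTR-addVetoes a C (λ j → proj₁ (nt j)) hasTR)

WG-extend⁻ : ∀ a b {C : SimpleGame m} → NonTrivial C → WG (b + (a + m)) t r (extend a b C) →
  ∃ λ s → t ≡ sgn b + (sgn a + s) × WGhat m s r C
WG-extend⁻ a b {C} nt (weighted , hasTR)
  with HasTR-addNulls⁻ b (addVetoes a C) (Pivotal-addVetoes-all a C (NonTrivial⇒Pivotal {G = C} nt)) hasTR
... | t₁ , refl , hasTR₁ with HasTR-addVetoes⁻ a C (λ j → proj₁ (nt j)) hasTR₁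
...   | s , refl , hasTR₂ = s , refl , (Weighted-addVetoes⁻ a C (Weighted-addNulls⁻ b (addVetoes a C) weighted) , hasTR₂) , nt

WG-unanimity : ∀ a b → WG (b + (a + 1)) (sgn b + 1) 1 (extend a b dictator)
WG-unanimity a b =
  Weighted-addNulls b (unanimity a) (Weighted-addVetoes a dictator Weighted-dictator) ,
  HasTR-addNulls b (unanimity a) (unanimity-pivotal a)
    (AllVetoGame.HasTR-AllVeto (unanimity a) (unanimity-AllVeto a) (subst (1 ≤_) (+-comm 1 a) (s≤s z≤n)))

WG-unanimity⁻ : ∀ a b → WG (b + (a + 1)) t r (extend a b dictator) → t ≡ sgn b + 1 × r ≡ 1
WG-unanimity⁻ a b (_ , hasTR) with HasTR-addNulls⁻ b (unanimity a) (unanimity-pivotal a) hasTR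
... | t₁ , refl , hasTR₁
  with AllVetoGame.HasTR-AllVeto⁻ (unanimity a) (unanimity-AllVeto a) (subst (1 ≤_) (+-comm 1 a) (s≤s z≤n)) hasTR₁
...   | refl , r≡1 = refl , r≡1

size-of-extend : ∀ a b m → b + (a + m) ≡ (a + b) + m
size-of-extend a b m = trans (sym (+-assoc b a m)) (cong (_+ m) (+-comm b a))

core-size : ∀ a b {m n} → b + (a + m) ≡ n → m ≡ n ∸ (a + b)
core-size a b {m} e = sym (trans (cong (_∸ (a + b)) (trans (sym e) (size-of-extend a b m))) (m+n∸m≡n (a + b) m))

core-fits : ∀ a b {n} → a + b ≤ n → b + (a + (n ∸ (a + b))) ≡ n
core-fits a b {n = n} a+b≤n = trans (size-of-extend a b (n ∸ (a + b))) (m+[n∸m]≡n a+b≤n)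

sgn-pos : ∀ {x} → 1 ≤ x → sgn x ≡ 1
sgn-pos {suc x} _ = refl

drop-classes : ∀ k {t} → 1 ≤ t ∸ k → k + (t ∸ k) ≡ t
drop-classes k {t} 1≤t-k = m+[n∸m]≡n {k} (<⇒≤ (m∸n≢0⇒n<m {t} {k} (λ e → contradiction (subst (1 ≤_) e 1≤t-k) λ ())))

fits-below : ∀ a b m {n} → b + (a + suc m) ≡ n → a + b ≤ n ∸ 1
fits-below a b m e = subst (λ k → a + b ≤ k ∸ 1) (trans (sym (+-suc (a + b) m)) (trans (sym (size-of-extend a b (suc m))) e))
                       (m≤m+n (a + b) m)

≤∸1⇒< : ∀ {a h} → 1 ≤ a → a ≤ h ∸ 1 → a < h
≤∸1⇒< {h = zero} (s≤s _) ()
≤∸1⇒< {h = suc h} _ a≤h = s≤s a≤h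

module Classification (n t r : ℕ) (ŵ : ℕ → ℕ → ℕ)
  (counts : ∀ m s → 1 ≤ s → s ≤ m → IsoCount (WGhat m s r) (ŵ m s))
  (vanishes : ∀ m s → (s < 1 ⊎ m < s) → ŵ m s ≡ 0) where

  IsoCount-WGhat : ∀ m s → IsoCount (WGhat m s r) (ŵ m s)
  IsoCount-WGhat m s with 1 ≤? s | s ≤? m
  ... | yes 1≤s | yes s≤m = counts m s 1≤s s≤m
  ... | no 1≰s | _ = subst (IsoCount _) (sym (vanishes m s (inj₁ (≰⇒> 1≰s))))
                       (IsoCount-∅ λ C ((_ , hasTR) , _) → 1≰s (HasTR⇒1≤classes {G = C} hasTR))
  ... | yes _ | no s≰m = subst (IsoCount _) (sym (vanishes m s (inj₂ (≰⇒> s≰m))))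
                       (IsoCount-∅ λ C ((_ , hasTR) , _) → s≰m (HasTR⇒classes≤players {G = C} hasTR))

  record HasCore (a b s : ℕ) (G : SimpleGame n) : Set where
    constructor hasCore
    field
      {size} : ℕ
      core : SimpleGame size
      fits : b + (a + size) ≡ n
      core-WGhat : WGhat size s r core
      iso : Iso G (castGame fits (extend a b core))

  HasCore-shape : ∀ {a b s a′ b′ s′} {G H : SimpleGame n} →
    HasCore a b s G → HasCore a′ b′ s′ H → Iso G H → a ≡ a′ × b ≡ b′
  HasCore-shape {a} {b} {_} {a′} {b′} {G = G} {H} (hasCore C e (_ , nt) I) (hasCore C′ e′ (_ , nt′) I′) J
    with extend-rigid a b a′ b′ nt nt′ (Iso-cast⇒HIso e e′ (extend a b C) (extend a′ b′ C′) K)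
    where
    X = castGame e (extend a b C)
    Y = castGame e′ (extend a′ b′ C′)
    K : Iso X Y
    K = Iso-trans {G = X} {G} {Y} (Iso-sym {G = G} {X} I) (Iso-trans {G = G} {H} {Y} J I′)
  ... | a≡a′ , b≡b′ , _ = a≡a′ , b≡b′

  IsoCount-HasCore : ∀ a b s → IsoCount (HasCore a b s) (ŵ (n ∸ (a + b)) s)
  IsoCount-HasCore a b s with a + b ≤? n
  -- Without room for a core, both sides vanish since ŵ 0 s = 0.
  ... | no a+b≰n = subst (IsoCount _) (sym (vanishes _ s (no-room s)))
          (IsoCount-∅ λ { G (hasCore {m} C e _ _) →
            a+b≰n (≤-trans (m≤m+n (a + b) m) (≤-reflexive (trans (sym (size-of-extend a b m)) e))) })
    where
    no-room : ∀ s → s < 1 ⊎ n ∸ (a + b) < s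
    no-room zero = inj₁ (s≤s z≤n)
    no-room (suc s) rewrite m≤n⇒m∸n≡0 (<⇒≤ (≰⇒> a+b≰n)) = inj₂ (s≤s z≤n)
  ... | yes a+b≤n = IsoCount-⇔ HasCore⇔ (IsoCount-image F F-cong F-reflects (IsoCount-WGhat m₀ s))
    where
    m₀ = n ∸ (a + b)
    e₀ = core-fits a b a+b≤n
    F : SimpleGame m₀ → SimpleGame n
    F C = castGame e₀ (extend a b C)
    F-cong : ∀ {X Y} → Iso X Y → Iso (F X) (F Y)
    F-cong {X} {Y} I = Iso-castGame e₀ {extend a b X} {extend a b Y} (addNulls-cong b (addVetoes-cong a {X} {Y} I))
    F-reflects : ∀ {X Y} → WGhat m₀ s r X → WGhat m₀ s r Y → Iso (F X) (F Y) → Iso X Y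
    F-reflects {X} {Y} (_ , nt) (_ , nt′) I =
      HIso⇒Iso {G = X} {Y} (proj₂ (proj₂ (extend-rigid a b a b nt nt′ (Iso-cast⇒HIso e₀ e₀ (extend a b X) (extend a b Y) I))))
    reindex : ∀ {m} (q : m ≡ m₀) (C : SimpleGame m) (e : b + (a + m) ≡ n) {G} → WGhat m s r C →
              Iso G (castGame e (extend a b C)) → ∃ λ C′ → WGhat m₀ s r C′ × Iso G (F C′)
    reindex refl C e w I rewrite ≡-irrelevant e e₀ = C , w , I
    HasCore⇔ : ∀ G → (∃ λ C → WGhat m₀ s r C × Iso G (F C)) ⇔ HasCore a b s G
    HasCore⇔ G = mk⇔ (λ (C , w , I) → hasCore C e₀ w I) (λ (hasCore C e w I) → reindex (core-size a b e) C e {G} w I)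

  HasShape : ℕ → ℕ → SimpleGame n → Set
  HasShape a b G = ∃ λ s → HasCore a b s G

  shape-unique : ∀ {a b a′ b′} {G H : SimpleGame n} → HasShape a b G → HasShape a′ b′ H → Iso G H → a ≡ a′ × b ≡ b′
  shape-unique (_ , x) (_ , y) = HasCore-shape x y

  IsCore : SimpleGame n → Set
  IsCore = HasCore 0 0 t

  Mixed : ℕ → SimpleGame n → Set
  Mixed h G = ∃ λ a → 1 ≤ a × a ≤ h ∸ 1 × HasCore a (h ∸ a) (t ∸ 2) G

  Layer : ℕ → SimpleGame n → Set
  Layer h G = HasCore h 0 (t ∸ 1) G ⊎ (HasCore 0 h (t ∸ 1) G ⊎ Mixed h G)

  HasNontrivialCore : SimpleGame n → Set
  HasNontrivialCore G = IsCore G ⊎ ∃ λ h → 1 ≤ h × h ≤ n ∸ 1 × Layer h G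

  Mixed-shape : ∀ {h G} → Mixed h G → ∃ λ a → ∃ λ b → 1 ≤ a × 1 ≤ b × a + b ≡ h × HasShape a b G
  Mixed-shape {h} (a , 1≤a , a≤h-1 , x) = a , h ∸ a , 1≤a , m<n⇒0<n∸m a<h , m+[n∸m]≡n (<⇒≤ a<h) , _ , x
    where
    a<h : a < h
    a<h = ≤∸1⇒< 1≤a a≤h-1

  Layer-shape : ∀ {h G} → Layer h G → ∃ λ a → ∃ λ b → a + b ≡ h × HasShape a b G
  Layer-shape {h} (inj₁ x) = h , 0 , +-identityʳ h , _ , x
  Layer-shape {h} (inj₂ (inj₁ x)) = 0 , h , refl , _ , x
  Layer-shape (inj₂ (inj₂ mixed)) with Mixed-shape mixed
  ... | a , b , _ , _ , a+b≡h , shape = a , b , a+b≡h , shape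

  layer-count : ℕ → ℕ
  layer-count h = 2 * ŵ (n ∸ h) (t ∸ 1) + (h ∸ 1) * ŵ (n ∸ h) (t ∸ 2)

  IsoCount-Mixed : ∀ h → IsoCount (Mixed h) (sumTo (h ∸ 1) (λ _ → ŵ (n ∸ h) (t ∸ 2)))
  IsoCount-Mixed h = IsoCount-sumTo (λ a → HasCore a (h ∸ a) (t ∸ 2)) distinct (λ _ → ŵ (n ∸ h) (t ∸ 2)) (h ∸ 1) count
    where
    distinct : ∀ {a a′ G H} → a ≢ a′ → HasCore a (h ∸ a) (t ∸ 2) G → HasCore a′ (h ∸ a′) (t ∸ 2) H → ¬ Iso G H
    distinct a≢a′ x y I = a≢a′ (proj₁ (HasCore-shape x y I))
    count : ∀ a → 1 ≤ a → a ≤ h ∸ 1 → IsoCount (HasCore a (h ∸ a) (t ∸ 2)) (ŵ (n ∸ h) (t ∸ 2))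
    count a 1≤a a≤h-1 = subst (λ k → IsoCount (HasCore a (h ∸ a) (t ∸ 2)) (ŵ (n ∸ k) (t ∸ 2)))
      (m+[n∸m]≡n (<⇒≤ (≤∸1⇒< 1≤a a≤h-1))) (IsoCount-HasCore a (h ∸ a) (t ∸ 2))

  IsoCount-Layer : ∀ h → 1 ≤ h → IsoCount (Layer h) (layer-count h)
  IsoCount-Layer h 1≤h = subst (IsoCount (Layer h)) (count-layer (ŵ (n ∸ h) (t ∸ 1)) (ŵ (n ∸ h) (t ∸ 2)))
    (IsoCount-⊎ top≁rest
      (subst (λ k → IsoCount (HasCore h 0 (t ∸ 1)) (ŵ (n ∸ k) (t ∸ 1))) (+-identityʳ h) (IsoCount-HasCore h 0 (t ∸ 1)))
      (IsoCount-⊎ bottom≁mixed (IsoCount-HasCore 0 h (t ∸ 1)) (IsoCount-Mixed h)))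
    where
    count-layer : ∀ x y → x + (x + sumTo (h ∸ 1) (λ _ → y)) ≡ 2 * x + (h ∸ 1) * y
    count-layer x y = begin
      x + (x + sumTo (h ∸ 1) (λ _ → y))  ≡⟨ cong (λ z → x + (x + z)) (sumTo-const (h ∸ 1) y) ⟩
      x + (x + (h ∸ 1) * y)              ≡⟨ +-assoc x x _ ⟨
      (x + x) + (h ∸ 1) * y              ≡⟨ cong (λ z → (x + z) + (h ∸ 1) * y) (+-identityʳ x) ⟨
      2 * x + (h ∸ 1) * y                ∎
      where open ≡-Reasoning
    top≁rest : ∀ {G H} → HasCore h 0 (t ∸ 1) G → HasCore 0 h (t ∸ 1) H ⊎ Mixed h H → ¬ Iso G H
    top≁rest x (inj₁ y) I with HasCore-shape x y I
    ... | refl , refl = contradiction 1≤h λ ()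
    top≁rest x (inj₂ mixed) I with Mixed-shape mixed
    ... | _ , _ , _ , 1≤b , _ , y with shape-unique (_ , x) y I
    ...   | _ , refl = contradiction 1≤b λ ()
    bottom≁mixed : ∀ {G H} → HasCore 0 h (t ∸ 1) G → Mixed h H → ¬ Iso G H
    bottom≁mixed x mixed I with Mixed-shape mixed
    ... | _ , _ , 1≤a , _ , _ , y with shape-unique (_ , x) y I
    ...   | refl , _ = contradiction 1≤a λ ()

  IsoCount-HasNontrivialCore : IsoCount HasNontrivialCore (ŵ n t + sumTo (n ∸ 1) layer-count)
  IsoCount-HasNontrivialCore = IsoCount-⊎ core≁layers (IsoCount-HasCore 0 0 t)
    (IsoCount-sumTo Layer layers-distinct layer-count (n ∸ 1) λ h 1≤h _ → IsoCount-Layer h 1≤h)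
    where
    layers-distinct : ∀ {h h′ G H} → h ≢ h′ → Layer h G → Layer h′ H → ¬ Iso G H
    layers-distinct h≢h′ x y I with Layer-shape x | Layer-shape y
    ... | a , b , refl , shape | a′ , b′ , refl , shape′ with shape-unique shape shape′ I
    ...   | refl , refl = h≢h′ refl
    core≁layers : ∀ {G H} → IsCore G → (∃ λ h → 1 ≤ h × h ≤ n ∸ 1 × Layer h H) → ¬ Iso G H
    core≁layers x (h , 1≤h , _ , y) I with Layer-shape y
    ... | a , b , refl , shape with shape-unique (_ , x) shape I
    ...   | refl , refl = contradiction 1≤h λ ()

  HasCore⇒WG : ∀ {a b s G} → HasCore a b s G → WG n (sgn b + (sgn a + s)) r G
  HasCore⇒WG {a} {b} {s} {G} (hasCore C e w I) =
    Iso-WG {t = sgn b + (sgn a + s)} {G = castGame e (extend a b C)} {G} (Iso-sym {G = G} {castGame e (extend a b C)} I)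
      (to (WG-cast e (extend a b C)) (WG-extend a b w))

  HasCore⇒1≤classes : ∀ {a b s G} → HasCore a b s G → 1 ≤ s
  HasCore⇒1≤classes (hasCore C _ ((_ , hasTR) , _) _) = HasTR⇒1≤classes {G = C} hasTR

  HasNontrivialCore⇒HasCore : ∀ {G} → HasNontrivialCore G → ∃ λ a → ∃ λ b → ∃ λ s → HasCore a b s G
  HasNontrivialCore⇒HasCore (inj₁ x) = _ , _ , _ , x
  HasNontrivialCore⇒HasCore (inj₂ (_ , _ , _ , layer)) with Layer-shape layer
  ... | a , b , _ , s , x = a , b , s , x

  HasNontrivialCore⇒WG : ∀ {G} → HasNontrivialCore G → WG n t r G
  HasNontrivialCore⇒WG {G} (inj₁ x) = HasCore⇒WG {G = G} x
  HasNontrivialCore⇒WG {G} (inj₂ (suc h , _ , _ , inj₁ x)) =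
    subst (λ k → WG n k r G) (drop-classes 1 (HasCore⇒1≤classes x)) (HasCore⇒WG x)
  HasNontrivialCore⇒WG {G} (inj₂ (suc h , _ , _ , inj₂ (inj₁ x))) =
    subst (λ k → WG n k r G) (drop-classes 1 (HasCore⇒1≤classes x)) (HasCore⇒WG x)
  HasNontrivialCore⇒WG {G} (inj₂ (h , _ , _ , inj₂ (inj₂ (a , 1≤a , a≤h-1 , x)))) =
    subst (λ k → WG n k r G) (trans (cong₂ (λ u v → u + (v + (t ∸ 2))) (sgn-pos (m<n⇒0<n∸m (≤∸1⇒< 1≤a a≤h-1))) (sgn-pos 1≤a))
                                   (drop-classes 2 (HasCore⇒1≤classes x))) (HasCore⇒WG x)

  record Unanimity (b : ℕ) (G : SimpleGame n) : Set where
    constructor unanimityWith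
    field
      {vetoes} : ℕ
      fits : b + (vetoes + 1) ≡ n
      iso : Iso G (castGame fits (extend vetoes b dictator))

  classify : ∀ a b {m s G} {C : SimpleGame m} (e : b + (a + m) ≡ n) → WGhat m s r C → t ≡ sgn b + (sgn a + s) →
             Iso G (castGame e (extend a b C)) → HasNontrivialCore G
  classify a b {zero} {C = C} _ _ _ _ = contradiction C no-game-on-∅
  classify zero zero e w refl I = inj₁ (hasCore _ e w I)
  classify (suc a) zero {suc m} e w refl I =
    inj₂ (suc a , s≤s z≤n , subst (_≤ n ∸ 1) (+-identityʳ (suc a)) (fits-below (suc a) zero m e) , inj₁ (hasCore _ e w I))
  classify zero (suc b) {suc m} e w refl I = inj₂ (suc b , s≤s z≤n , fits-below zero (suc b) m e , inj₂ (inj₁ (hasCore _ e w I)))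
  classify (suc a) (suc b) {suc m} {s} {G} e w refl I =
    inj₂ (h , s≤s z≤n , fits-below (suc a) (suc b) m e ,
          inj₂ (inj₂ (suc a , s≤s z≤n , subst (suc a ≤_) (sym (+-suc a b)) (s≤s (m≤m+n a b)) ,
                      subst (λ b′ → HasCore (suc a) b′ s G) (sym (m+n∸m≡n (suc a) (suc b))) (hasCore _ e w I))))
    where h = suc a + suc b

  WG⇒HasNontrivialCore⊎Unanimity : ∀ {G} → WG n t r G → HasNontrivialCore G ⊎ ∃ λ b → Unanimity b G
  WG⇒HasNontrivialCore⊎Unanimity {G} wg with decompose G
  ... | nontrivialCore a b C e nt I with WG-extend⁻ a b nt (from (WG-cast e (extend a b C)) (Iso-WG {G = G} {castGame e (extend a b C)} I wg))
  ...   | s , t≡ , w = inj₁ (classify a b e w t≡ I)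
  WG⇒HasNontrivialCore⊎Unanimity {G} wg | unanimityCore a b e I = inj₂ (b , unanimityWith e I)

  Unanimity⇒WG : ∀ {b G} → Unanimity b G → WG n (sgn b + 1) 1 G
  Unanimity⇒WG {b} {G} (unanimityWith {a} e I) =
    Iso-WG {G = castGame e (extend a b dictator)} {G} (Iso-sym {G = G} {castGame e (extend a b dictator)} I)
      (to (WG-cast e (extend a b dictator)) (WG-unanimity a b))

  WG-Unanimity⁻ : ∀ {b G} → WG n t r G → Unanimity b G → t ≡ sgn b + 1 × r ≡ 1
  WG-Unanimity⁻ {b} {G} wg (unanimityWith {a} e I) =
    WG-unanimity⁻ a b (from (WG-cast e (extend a b dictator)) (Iso-WG {G = G} {castGame e (extend a b dictator)} I wg))

  HasNontrivialCore≁Unanimity : ∀ {b G H} → HasNontrivialCore G → Unanimity b H → ¬ Iso G H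
  HasNontrivialCore≁Unanimity {b} {G} {H} reducible (unanimityWith {a′} e′ I′) J with HasNontrivialCore⇒HasCore reducible
  ... | a , b₀ , s , hasCore {m} C e (_ , nt) I =
    extend-¬HIso-unanimity a b₀ a′ b nt (Iso-cast⇒HIso e e′ (extend a b₀ C) (extend a′ b dictator)
      (Iso-trans {G = castGame e (extend a b₀ C)} {G} {castGame e′ (extend a′ b dictator)} (Iso-sym {G = G} {castGame e (extend a b₀ C)} I)
        (Iso-trans {G = G} {H} {castGame e′ (extend a′ b dictator)} J I′)))

  Unanimity-rigid : ∀ {b b′ G H} → Unanimity b G → Unanimity b′ H → Iso G H → b ≡ b′
  Unanimity-rigid {b} {b′} {G} {H} (unanimityWith {a} e I) (unanimityWith {a′} e′ I′) J =
    unanimity-rigid a b a′ b′ (Iso-cast⇒HIso e e′ (extend a b dictator) (extend a′ b′ dictator)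
      (Iso-trans {G = X} {G} {Y} (Iso-sym {G = G} {X} I) (Iso-trans {G = G} {H} {Y} J I′)))
    where
    X = castGame e (extend a b dictator)
    Y = castGame e′ (extend a′ b′ dictator)

  IsoCount-Unanimity : ∀ b → b < n → IsoCount (Unanimity b) 1
  IsoCount-Unanimity b b<n = IsoCount-single G₀ (unanimityWith e₀ (Iso-refl G₀)) unique
    where
    a₀ = n ∸ suc b
    e₀ : b + (a₀ + 1) ≡ n
    e₀ = trans (cong (b +_) (+-comm a₀ 1)) (trans (+-suc b a₀) (m+[n∸m]≡n b<n))
    G₀ = castGame e₀ (extend a₀ b dictator)
    unique : ∀ G → Unanimity b G → Iso G G₀
    unique G (unanimityWith {a} e I) = reindex (vetoes-size e) e I
      where
      vetoes-size : b + (a + 1) ≡ n → a ≡ a₀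
      vetoes-size e = sym (trans (cong (_∸ suc b) (sym e)) (trans (cong (λ k → (b + k) ∸ suc b) (+-comm a 1))
                             (trans (cong (_∸ suc b) (+-suc b a)) (m+n∸m≡n b a))))
      reindex : ∀ {a} → a ≡ a₀ → (e : b + (a + 1) ≡ n) → Iso G (castGame e (extend a b dictator)) → Iso G G₀
      reindex refl e I rewrite ≡-irrelevant e e₀ = I

  UnanimityWG : SimpleGame n → Set
  UnanimityWG G = WG n t r G × ∃ λ b → Unanimity b G

  IsoCount-WG : ∀ {k} → IsoCount UnanimityWG k → IsoCount (WG n t r) (ŵ n t + sumTo (n ∸ 1) layer-count + k)
  IsoCount-WG count =
    IsoCount-⇔ WG⇔cases (IsoCount-⊎ (λ x (_ , _ , u) → HasNontrivialCore≁Unanimity x u) IsoCount-HasNontrivialCore count)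
    where
    WG⇔cases : ∀ G → (HasNontrivialCore G ⊎ UnanimityWG G) ⇔ WG n t r G
    WG⇔cases G = mk⇔ [ HasNontrivialCore⇒WG , proj₁ ] λ wg → map₂ (wg ,_) (WG⇒HasNontrivialCore⊎Unanimity wg)

  IsoCount-UnanimityWG-none : (1 < r ⊎ 2 < t) → IsoCount UnanimityWG 0
  IsoCount-UnanimityWG-none big = IsoCount-∅ λ { G (wg , _ , u) → excluded big (WG-Unanimity⁻ wg u) }
    where
    excluded : ∀ {b} → (1 < r ⊎ 2 < t) → ¬ (t ≡ sgn b + 1 × r ≡ 1)
    excluded (inj₁ 1<r) (_ , refl) = <-irrefl refl 1<r
    excluded {zero} (inj₂ 2<t) (refl , _) = contradiction 2<t λ { (s≤s ()) }
    excluded {suc b} (inj₂ 2<t) (refl , _) = <-irrefl refl 2<t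

  IsoCount-UnanimityWG-t≡1 : 1 ≤ n → r ≡ 1 → t ≡ 1 → IsoCount UnanimityWG 1
  IsoCount-UnanimityWG-t≡1 1≤n refl refl =
    IsoCount-⇔ (λ G → mk⇔ (λ u → Unanimity⇒WG u , 0 , u) only-b₀) (IsoCount-Unanimity 0 1≤n)
    where
    only-b₀ : ∀ {G} → UnanimityWG G → Unanimity 0 G
    only-b₀ (wg , zero , u) = u
    only-b₀ (wg , suc b , u) = contradiction (proj₁ (WG-Unanimity⁻ wg u)) λ ()

  IsoCount-UnanimityWG-t≡2 : r ≡ 1 → t ≡ 2 → IsoCount UnanimityWG (n ∸ 1)
  IsoCount-UnanimityWG-t≡2 refl refl = subst (IsoCount UnanimityWG) (trans (sumTo-const (n ∸ 1) 1) (*-identityʳ (n ∸ 1)))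
    (IsoCount-⇔ (λ G → mk⇔ to-WG from-WG)
      (IsoCount-sumTo Unanimity (λ b≢b′ u u′ I → b≢b′ (Unanimity-rigid u u′ I)) (λ _ → 1) (n ∸ 1)
        λ b 1≤b b≤n-1 → IsoCount-Unanimity b (≤∸1⇒< 1≤b b≤n-1)))
    where
    to-WG : ∀ {G} → (∃ λ b → 1 ≤ b × b ≤ n ∸ 1 × Unanimity b G) → UnanimityWG G
    to-WG (suc b , _ , _ , u) = Unanimity⇒WG u , suc b , u
    from-WG : ∀ {G} → UnanimityWG G → ∃ λ b → 1 ≤ b × b ≤ n ∸ 1 × Unanimity b G
    from-WG (wg , zero , u) = contradiction (proj₁ (WG-Unanimity⁻ wg u)) λ ()
    from-WG (wg , suc b , u@(unanimityWith {a} e _)) = suc b , s≤s z≤n , ≤-trans (m≤n+m (suc b) a) (fits-below a (suc b) 0 e) , u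

lemma3p1 : (n t r : ℕ) → 1 ≤ n → 1 ≤ t → 1 ≤ r →
    (ŵ : ℕ → ℕ → ℕ) →
    (∀ m s → 1 ≤ s → s ≤ m → IsoCount (WGhat m s r) (ŵ m s)) →
    (∀ m s → (s < 1 ⊎ m < s) → ŵ m s ≡ 0) →
    let rhs = ŵ n t + sumTo (n ∸ 1) (λ h → 2 * ŵ (n ∸ h) (t ∸ 1) + (h ∸ 1) * ŵ (n ∸ h) (t ∸ 2)) in
    ((1 < r ⊎ 2 < t) → IsoCount (WG n t r) rhs) ×
    (r ≡ 1 → t ≡ 1 → IsoCount (WG n t r) (rhs + 1)) ×
    (r ≡ 1 → t ≡ 2 → IsoCount (WG n t r) (rhs + (n ∸ 1)))
lemma3p1 n t r 1≤n _ _ ŵ counts vanishes =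
  (λ big → subst (IsoCount (WG n t r)) (+-identityʳ _) (IsoCount-WG (IsoCount-UnanimityWG-none big))) ,
  (λ r≡1 t≡1 → IsoCount-WG (IsoCount-UnanimityWG-t≡1 1≤n r≡1 t≡1)) ,
  (λ r≡1 t≡2 → IsoCount-WG (IsoCount-UnanimityWG-t≡2 r≡1 t≡2))
  where open Classification n t r ŵ counts vanishes
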